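{- Let $q$ be a prime power, $X$ a subspace of $\mathbb{F}_q^n$ and $M=\mathcal{RE}(X)$. (i) For every $J\subseteq\mathrm{subset}(X)$, $\mathrm{ins}(\mathrm{del}(M,J),J)=M$. (ii) For every $I\subseteq\mathrm{set}(X)\setminus\mathrm{subset}(X)$, $\mathrm{del}(\mathrm{ins}(M,I),I)=M$.
   Context: A $k\times n$ matrix is in rref if every row is nonzero with leading entry $1$ in column $p_i$ for row $i$, $p_1<\cdots<p_k$, and columns $p_1,\dots,p_k$ form the identity (pivotal columns). $\mathcal{RE}(X)$ is the unique rref with row space $X$. $C_m[j]$ = first $m$ entries of column $j$, $R_r[i]$ = last $r$ entries of row $i$. Column $j$ is essential if: when nonpivotal with $p_m<j<p_{m+1}$ ($p_0=0,p_{k+1}=n+1$), $C_m[j]\notin\operatorname{span}\{C_m[j+1],\dots,C_m[n]\}$; when $j=p_m$, $R_{n-j}[m]\notin\operatorname{span}\{R_{n-j}[1],\dots,R_{n-j}[m-1]\}$; otherwise inessential. $\mathrm{set}(X)$ is the set of inessential columns of $\mathcal{RE}(X)$ and $\mathrm{subset}(X)$ the set of inessential pivotal columns. Lexically first basis of rows $r_1,\dots,r_t$: indices $i_1<\cdots<i_s$ with $i_1$ the least index of a nonzero row and $i_{l+1}$ the least index $>i_l$ with $r_{i_{l+1}}\notin\operatorname{span}\{r_{i_1},\dots,r_{i_l}\}$. $\Gamma(b,c)=I_s+b^Tc$. Bijections $\phi_s$ of $\mathbb{F}_q^s$: for $d\ne0$, $\mu_d(0)=1$, $\mu_d(x)=1+dx^{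 -1}$ ($x\ne 0$); $\phi_1=\mu_{ -1}$; $\phi_{s+1}(b_1,\dots,b_{s+1})=(c_1,\dots,c_s,\mu_\alpha(b_{s+1}))$ with $(c_1,\dots,c_s)=\phi_s(b_1,\dots,b_s)$, $\alpha=-1-\sum b_ic_i$; $\Gamma(b,\phi_s(b))$ is always invertible. Single deletion $\mathrm{del}(M,j)$ for inessential pivotal $j=p_m$: $N$ = rows $1..m-1$, columns $j+1..n$; $a=R_{n-j}[m]$; $i_1<\dots<i_s$ lexically first basis indices of rows of $N$, $N_L$ those rows; $c$ unique with $a=cN_L$; $b=\phi_s^{ -1}(c)$; $d\in\mathbb{F}_q^{m-1}$ with $d_{i_l}=b_l$ and for other $u$, $d_u=\sum_l\alpha_lb_l$ where row $u$ of $N$ is $\sum_l\alpha_l(\text{row } i_l)$; add $d_l$ times row $m$ to row $l$ ($l=1..m-1$), then delete row $m$. Single insertion $\mathrm{ins}(M,j)$ for inessential nonpivotal $j$ with $p_m<j<p_{m+1}$: $N$ = rows $1..m$, columns $j+1..n$; $d=C_m[j]$; $i_1<\dots<i_s$, $N_L$ as before; $b=(d_{i_1},\dots,d_{i_s})$, $c=\phi_s(b)$, $a=c\Gamma(b,c)^{ -1}N_L$; insert after row $m$ the row with zeros in columns $1..j-1$, $1$ in column $j$, $a$ in columns $j+1..n$; then for $l=1..m$ subtract $d_l$ times it from row $l$. For $J=\{j_1<\cdots<j_t\}\subseteq\mathrm{subset}(X)$, $\mathrm{del}(M,J)$ is obtained by deleting $j_1$, then $j_2$, ..., then $j_t$ successively;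 for $I=\{j_1<\cdots<j_t\}\subseteq\mathrm{set}(X)\setminus\mathrm{subset}(X)$, $\mathrm{ins}(M,I)$ is obtained by inserting $j_t$, then $j_{t-1}$, ..., then $j_1$ successively. In (i), $\mathrm{ins}(\cdot,J)$ is applied with the same decreasing-order convention. -}

module Defs where

open import Level using (0ℓ)
open import Data.Nat as ℕ using (ℕ; zero; suc)
open import Data.Fin as Fin using (Fin; zero; suc; toℕ; punchIn)
open import Data.Fin.Properties using (_≟_)
open import Data.List as List using (List; []; _∷_; _∷ʳ_; length; lookup; allFin; filter)
open import Data.Vec as Vec using (Vec; []; _∷_)
open import Data.Product using (Σ; ∃; _×_; _,_)
open import Data.Sum using (_⊎_)
open import Relation.Nullary using (¬_; Dec; yes; no)
open import Relation.Binary.PropositionalEquality using (_≡_; _≢_)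
open import Relation.Binary.Definitions using (DecidableEquality)
open import Relation.Nullary.Decidable using (⌊_⌋)
open import Data.Bool using (if_then_else_)
open import Algebra.Core using (Op₁; Op₂)
import Algebra.Structures as AS
open import Function.Bundles using (_↔_; _⇔_)

record FiniteField : Set₁ where
  infixl 7 _*_
  infixl 6 _+_
  field
    Carrier  : Set
    _≟F_     : DecidableEquality Carrier
    _+_ _*_  : Op₂ Carrier
    -_       : Op₁ Carrier
    0# 1#    : Carrier
    isCommutativeRing : AS.IsCommutativeRing _≡_ _+_ _*_ -_ 0# 1#
    -- multiplicative inverse (its value at 0# is irrelevant)
    _⁻¹      : Op₁ Carrier
    ⁻¹-inverse : ∀ x → x ≢ 0# → x * (x ⁻¹) ≡ 1#
    0≢1      : 0# ≢ 1#
    card     : ℕ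
    enum     : Fin card ↔ Carrier

-- Linear algebra over a finite field.  Indices are 0-based:
-- rows 0..k-1 and columns 0..n-1 (the paper uses 1..k, 1..n).

module LinAlg (𝔽 : FiniteField) where
  open FiniteField 𝔽 renaming (Carrier to F)

  Row : ℕ → Set
  Row n = Fin n → F

  Mat : ℕ → ℕ → Set
  Mat k n = Fin k → Fin n → F

  sumF : ∀ {k} → (Fin k → F) → F
  sumF {zero}  f = 0#
  sumF {suc k} f = f zero + sumF (λ i → f (suc i))

  MatEq : ∀ {k k' n} → Mat k n → Mat k' n → Set
  MatEq {k} {k'} A B = Σ (k ≡ k') λ e → ∀ i t → A i t ≡ B (Fin.cast e i) t

  record IsSubspace {n} (X : Row n → Set) : Set where
    field
      zero∈ : X (λ _ → 0#)
      +-closed : ∀ u v → X u → X v → X (λ t → u t + v t)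
      *-closed : ∀ a v → X v → X (λ t → a * v t)

  RowSpaceIs : ∀ {k n} → Mat k n → (Row n → Set) → Set
  RowSpaceIs {k} M X =
    ∀ v → X v ⇔ (∃ λ (c : Fin k → F) → ∀ t → v t ≡ sumF (λ i → c i * M i t))

  Lead : ∀ {k n} → Mat k n → Fin k → Fin n → Set
  Lead M i j = M i j ≡ 1# × (∀ t → t Fin.< j → M i t ≡ 0#)

  IsRREF : ∀ {k n} → Mat k n → Set
  IsRREF {k} {n} M = Σ (Fin k → Fin n) λ p →
      (∀ i → Lead M i (p i))
    × (∀ i i' → i Fin.< i' → p i Fin.< p i')
    × (∀ i i' → i ≢ i' → M i' (p i) ≡ 0#)

  Pivotal : ∀ {k n} → Mat k n → Fin n → Set
  Pivotal M j = ∃ λ m → Lead M m j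

  -- exactly the rows 0..m-1 have their pivot before column j  (p_m < j < p_{m+1})
  Splits : ∀ {k n} → Mat k n → ℕ → Fin n → Set
  Splits M m j = ∀ i t → Lead M i t → (toℕ i ℕ.< m → t Fin.< j) × (t Fin.< j → toℕ i ℕ.< m)

  ColInSpan : ∀ {k n} → Mat k n → ℕ → Fin n → Set
  ColInSpan {k} {n} M m j = ∃ λ (e : Fin n → F) →
      (∀ t → t Fin.≤ j → e t ≡ 0#)
    × (∀ i → toℕ i ℕ.< m → M i j ≡ sumF (λ t → e t * M i t))

  RowInSpan : ∀ {k n} → Mat k n → Fin k → Fin n → Set
  RowInSpan {k} M m j = ∃ λ (c : Fin k → F) →
      (∀ i → m Fin.≤ i → c i ≡ 0#)
    × (∀ t → j Fin.< t → M m t ≡ sumF (λ i → c i * M i t))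

  InessPivotal : ∀ {k n} → Mat k n → Fin n → Set
  InessPivotal M j = ∃ λ m → Lead M m j × RowInSpan M m j

  InessNonpivotal : ∀ {k n} → Mat k n → Fin n → Set
  InessNonpivotal M j =
    (¬ Pivotal M j) × (∃ λ m → Splits M m j × ColInSpan M m j)

  -- j ∈ set(X) and j ∈ subset(X), where M = RE(X)
  InSet : ∀ {k n} → Mat k n → Fin n → Set
  InSet M j = InessPivotal M j ⊎ InessNonpivotal M j

  InSubset : ∀ {k n} → Mat k n → Fin n → Set
  InSubset = InessPivotal

  SpanAfter : ∀ {n} → Fin n → List (Row n) → Row n → Set
  SpanAfter j vs v = ∃ λ (c : Fin (length vs) → F) →
    ∀ t → j Fin.< t → v t ≡ sumF (λ l → c l * lookup vs l t)

  -- greedy scan: LexFirst M j B cands L  —  with already chosen indices B,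
  -- scanning the remaining candidate row indices cands (in order),
  -- the further chosen indices are L.
  data LexFirst {k n} (M : Mat k n) (j : Fin n) : List (Fin k) → List (Fin k) → List (Fin k) → Set where
    done : ∀ {B} → LexFirst M j B [] []
    skip : ∀ {B i is L} → SpanAfter j (List.map M B) (M i) →
           LexFirst M j B is L → LexFirst M j B (i ∷ is) L
    take : ∀ {B i is L} → ¬ SpanAfter j (List.map M B) (M i) →
           LexFirst M j (B ∷ʳ i) is L → LexFirst M j B (i ∷ is) (i ∷ L)

  below : ∀ k → ℕ → List (Fin k)
  below k m = filter (λ i → toℕ i ℕ.<? m) (allFin k)

  LexFirstBasis : ∀ {k n} → Mat k n → ℕ → Fin n → List (Fin k) → Set
  LexFirstBasis {k} M m j L = LexFirst M j [] (below k m) L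

  μ : F → F → F
  μ d x with x ≟F 0#
  ... | yes _ = 1#
  ... | no  _ = 1# + d * (x ⁻¹)

  dot : ∀ {s} → Vec F s → Vec F s → F
  dot []       []       = 0#
  dot (x ∷ xs) (y ∷ ys) = x * y + dot xs ys

  φ : ∀ s → Vec F s → Vec F s
  φ zero    bs = bs
  φ (suc s) bs =
    let b' = Vec.init bs
        c' = φ s b'
        α  = - (1# + dot b' c')
    in  c' Vec.∷ʳ μ α (Vec.last bs)

  Γ : ∀ {s} → Vec F s → Vec F s → Fin s → Fin s → F
  Γ b c x y = (if ⌊ x ≟ y ⌋ then 1# else 0#) + Vec.lookup b x * Vec.lookup c y


  record DelStep {k n} (M : Mat (suc k) n) (j : Fin n) (M' : Mat k n) : Set where
    field
      rref   : IsRREF M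
      m      : Fin (suc k)
      lead   : Lead M m j
      iness  : RowInSpan M m j
      L      : List (Fin (suc k))
      basis  : LexFirstBasis M (toℕ m) j L
      c      : Vec F (length L)
      c-eq   : ∀ t → j Fin.< t → M m t ≡ sumF (λ l → Vec.lookup c l * M (lookup L l) t)
      b      : Vec F (length L)
      b-eq   : φ (length L) b ≡ c
      d      : Fin (suc k) → F
      d-basis : ∀ l → d (lookup L l) ≡ Vec.lookup b l
      d-other : ∀ u → toℕ u ℕ.< toℕ m → (∀ l → lookup L l ≢ u) →
                ∃ λ (α : Fin (length L) → F) →
                    (∀ t → j Fin.< t → M u t ≡ sumF (λ l → α l * M (lookup L l) t))
                  × d u ≡ sumF (λ l → α l * Vec.lookup b l)
      d-zero : ∀ u → toℕ m ℕ.≤ toℕ u → d u ≡ 0#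
      result : ∀ i t → M' i t ≡ M (punchIn m i) t + d (punchIn m i) * M m t

  record InsStep {k n} (M : Mat k n) (j : Fin n) (M' : Mat (suc k) n) : Set where
    field
      rref    : IsRREF M
      nonpiv  : ¬ Pivotal M j
      m       : ℕ
      splits  : Splits M m j
      iness   : ColInSpan M m j
      L       : List (Fin k)
      basis   : LexFirstBasis M m j L
    s : ℕ
    s = length L
    b : Vec F s
    b = Vec.tabulate (λ l → M (lookup L l) j)
    c : Vec F s
    c = φ s b
    field
      e       : Vec F s
      e-eq    : ∀ y → sumF (λ x → Vec.lookup e x * Γ b c x y) ≡ Vec.lookup c y
      r       : Row n
      r-before : ∀ t → t Fin.< j → r t ≡ 0#
      r-at     : r j ≡ 1#
      r-after  : ∀ t → j Fin.< t → r t ≡ sumF (λ x → Vec.lookup e x * M (lookup L x) t)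
      -- position of the new row (after row m, 1-based), i.e. index m (0-based)
      ι       : Fin (suc k)
      ι-pos   : toℕ ι ≡ m
      new-row : ∀ t → M' ι t ≡ r t
      old-rows : ∀ i t → M' (punchIn ι i) t ≡
                   M i t + - ((if ⌊ toℕ i ℕ.<? m ⌋ then M i j else 0#) * r t)

  data DelSeq {n} : ∀ {k k'} → Mat k n → List (Fin n) → Mat k' n → Set where
    []  : ∀ {k} {M : Mat k n} → DelSeq M [] M
    _∷_ : ∀ {k k'} {M : Mat (suc k) n} {j js} {M₁ : Mat k n} {M₂ : Mat k' n} →
          DelStep M j M₁ → DelSeq M₁ js M₂ → DelSeq M (j ∷ js) M₂

  data InsSeq {n} : ∀ {k k'} → Mat k n → List (Fin n) → Mat k' n → Set where
    []  : ∀ {k} {M : Mat k n} → InsSeq M [] M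
    _∷_ : ∀ {k k'} {M : Mat k n} {j js} {M₁ : Mat (suc k) n} {M₂ : Mat k' n} →
          InsStep M j M₁ → InsSeq M₁ js M₂ → InsSeq M (j ∷ js) M₂

  Del : ∀ {k k' n} → Mat k n → List (Fin n) → Mat k' n → Set
  Del M J M' = DelSeq M J M'

  Ins : ∀ {k k' n} → Mat k n → List (Fin n) → Mat k' n → Set
  Ins M I M' = InsSeq M (List.reverse I) M'

  -- "f(g(M,J),J) is defined and equals M":  some chain exists, and every chain returns M
  RoundTrip : ∀ {k n} →
    (∀ {a b} → Mat a n → List (Fin n) → Mat b n → Set) →
    (∀ {a b} → Mat a n → List (Fin n) → Mat b n → Set) →
    Mat k n → List (Fin n) → Set
  RoundTrip {k} {n} G H M J =
      (Σ ℕ λ k₁ → Σ (Mat k₁ n) λ M₁ → Σ ℕ λ k₂ → Σ (Mat k₂ n) λ M₂ → G M J M₁ × H M₁ J M₂)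
    × (∀ {k₁ k₂} (M₁ : Mat k₁ n) (M₂ : Mat k₂ n) → G M J M₁ → H M₁ J M₂ → MatEq M₂ M)

module Submission where

-- Deleting an inessential pivot j = p_m adds d_u times row m to each row u above m and removes
-- row m. Restricted to the columns after j, the rows of the lexically first basis then become
-- Γ(b, c) times the old ones, where c are the coordinates of row m in that basis and b = φ⁻¹(c).
-- Since 1 + b · φ(b) never vanishes, Γ(b, c) = I + bᵀc is invertible, so the same rows form the
-- lexically first basis afterwards, column j above row m now reads b, and the insertion recipe
-- c = φ(b), a = c Γ(b, c)⁻¹ N_L rebuilds row m exactly. Dually, an insertion multiplies the basis
-- rows by I - bᵀc / (1 + b · c) = Γ(b, c)⁻¹, so the deletion recipe recovers b and c and undoes it.
-- Every step is determined by its input (pivots, the greedy scan, φ and Γ), a deletion keeps later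
-- inessential pivots inessential and an insertion keeps earlier inessential columns inessential,
-- so the chains exist and the single-step inverses compose along them.

open import Defs
open import Data.Nat using (ℕ)
open import Data.Fin using (Fin; _<_)
open import Data.List using (List)
open import Data.List.Relation.Unary.All using (All)
open import Data.List.Relation.Unary.Linked using (Linked)
open import Data.Product using (_×_)
open import Relation.Nullary using (¬_)

open import Level using (0ℓ)
open import Algebra.Bundles using (CommutativeRing)
open import Algebra.Solver.Ring.AlmostCommutativeRing using (fromCommutativeRing; _-Raw-AlmostCommutative⟶_)
open import Data.Bool using (if_then_else_)
open import Data.Fin as Fin using (zero; suc; toℕ; punchIn; punchOut)
import Data.Fin.Properties as Finₚ
open import Data.Integer as ℤ using (ℤ; -[1+_]; _⊖_; _◃_; sign; ∣_∣)
import Data.Integer.Properties as ℤₚ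
open import Data.List as List using ([]; _∷_; _∷ʳ_; _++_; length; lookup; map; filter; allFin; reverse)
import Data.List.Properties as Listₚ
open import Data.List.Membership.Propositional using (_∈_)
import Data.List.Membership.Propositional.Properties as ∈ₚ
open import Data.List.Relation.Unary.All as All using ([]; _∷_)
import Data.List.Relation.Unary.All.Properties as Allₚ
open import Data.List.Relation.Unary.AllPairs using (AllPairs; []; _∷_)
open import Data.List.Relation.Unary.Any using (here; there; index)
open import Data.List.Relation.Unary.Any.Properties using (lookup-index)
open import Data.List.Relation.Unary.Linked.Properties using (Linked⇒AllPairs)
open import Data.Maybe using (Maybe; just; nothing)
open import Data.Nat as ℕ using (zero; suc)
import Data.Nat.Properties as ℕₚ
open import Data.Product using (Σ; ∃; _,_; proj₁; proj₂)
open import Data.Sign as Sign using (Sign)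
open import Data.Sum using (_⊎_; inj₁; inj₂)
open import Data.Unit using (⊤)
open import Data.Vec as Vec using (Vec; []; _∷_)
import Data.Vec.Properties as Vecₚ
import Data.Vec.Functional as Vector
import Data.Vec.Functional.Properties as Vectorₚ
open import Function using (_∘_; id)
open import Function.Bundles using (Inverse)
open import Relation.Binary using (Tri; tri<; tri≈; tri>)
open import Relation.Binary.PropositionalEquality
open import Relation.Nullary using (Dec; yes; no; contradiction)
open import Relation.Nullary.Decidable using (⌊_⌋; ¬?; _×-dec_; decidable-stable)

module _ (𝔽 : FiniteField) where
  open FiniteField 𝔽 renaming (Carrier to F)
  open LinAlg 𝔽
  open ≡-Reasoning

  commutativeRing : CommutativeRing 0ℓ 0ℓ
  commutativeRing = record { isCommutativeRing = isCommutativeRing }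

  open CommutativeRing commutativeRing
    using (+-assoc; +-comm; *-assoc; *-comm; distribˡ; distribʳ; +-identityˡ; +-identityʳ;
           *-identityˡ; *-identityʳ; -‿inverseʳ; zeroˡ; zeroʳ)
  open CommutativeRing commutativeRing using (+-monoid; semiring; +-commutativeSemigroup; *-commutativeSemigroup)
  open import Algebra.Properties.Ring (CommutativeRing.ring commutativeRing)
    using (-‿involutive; -‿distribˡ-*; -0#≈0#; -‿+-comm)
  open import Algebra.Properties.Monoid.Mult.TCOptimised +-monoid using (×-homo-+) renaming (_×_ to _×ₙ_)
  open import Algebra.Properties.Semiring.Mult.TCOptimised semiring using (×1-homo-*)
  open import Algebra.Properties.CommutativeSemigroup +-commutativeSemigroup using () renaming (interchange to +-interchange)
  open import Algebra.Properties.CommutativeSemigroup *-commutativeSemigroup using () renaming (interchange to *-interchange)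
  open import Algebra.Properties.Semiring.Sum semiring using (sum; ∑-distrib-+; ∑-comm; sum-remove; *-distribˡ-sum)

  -- The ring solver needs coefficients whose arithmetic computes, so we
  -- solve with integer coefficients interpreted in F.
  ⟦_⟧ℤ : ℤ → F
  ⟦ ℤ.+ n ⟧ℤ      = n ×ₙ 1#
  ⟦ -[1+ n ] ⟧ℤ = - (suc n ×ₙ 1#)

  ⟦_⟧± : Sign → F
  ⟦ Sign.+ ⟧± = 1#
  ⟦ Sign.- ⟧± = - 1#

  ⟦⊖⟧ : ∀ m n → ⟦ m ⊖ n ⟧ℤ ≡ m ×ₙ 1# + - (n ×ₙ 1#)
  ⟦⊖⟧ m       zero    = sym (trans (cong ((m ×ₙ 1#) +_) -0#≈0#) (+-identityʳ _))
  ⟦⊖⟧ zero    (suc n) = sym (+-identityˡ _)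
  ⟦⊖⟧ (suc m) (suc n) = begin
    ⟦ suc m ⊖ suc n ⟧ℤ                    ≡⟨ cong ⟦_⟧ℤ (ℤₚ.[1+m]⊖[1+n]≡m⊖n m n) ⟩
    ⟦ m ⊖ n ⟧ℤ                            ≡⟨ ⟦⊖⟧ m n ⟩
    a + b                                 ≡⟨ +-identityˡ _ ⟨
    0# + (a + b)                          ≡⟨ cong (_+ (a + b)) (-‿inverseʳ 1#) ⟨
    (1# + - 1#) + (a + b)                 ≡⟨ +-interchange 1# (- 1#) a b ⟩
    (1# + a) + (- 1# + b)                 ≡⟨ cong ((1# + a) +_) (-‿+-comm 1# (n ×ₙ 1#)) ⟩
    (1# + a) + - (1# + n ×ₙ 1#)            ≡⟨ cong₂ (λ u v → u + - v) (×-homo-+ 1# 1 m) (×-homo-+ 1# 1 n) ⟨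
    suc m ×ₙ 1# + - (suc n ×ₙ 1#)          ∎
    where
    a b : F
    a = m ×ₙ 1#
    b = - (n ×ₙ 1#)

  ⟦+⟧ : ∀ i j → ⟦ i ℤ.+ j ⟧ℤ ≡ ⟦ i ⟧ℤ + ⟦ j ⟧ℤ
  ⟦+⟧ (ℤ.+ m)      (ℤ.+ n)      = ×-homo-+ 1# m n
  ⟦+⟧ (ℤ.+ m)      -[1+ n ]   = ⟦⊖⟧ m (suc n)
  ⟦+⟧ -[1+ m ]   (ℤ.+ n)      = trans (⟦⊖⟧ n (suc m)) (+-comm _ _)
  ⟦+⟧ -[1+ m ]   -[1+ n ]   = begin
    - (suc (suc (m ℕ.+ n)) ×ₙ 1#)          ≡⟨ cong (λ k → - (suc k ×ₙ 1#)) (ℕₚ.+-suc m n) ⟨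
    - ((suc m ℕ.+ suc n) ×ₙ 1#)            ≡⟨ cong -_ (×-homo-+ 1# (suc m) (suc n)) ⟩
    - (suc m ×ₙ 1# + suc n ×ₙ 1#)           ≡⟨ -‿+-comm _ _ ⟨
    - (suc m ×ₙ 1#) + - (suc n ×ₙ 1#)       ∎

  ⟦◃⟧ : ∀ s n → ⟦ s ◃ n ⟧ℤ ≡ ⟦ s ⟧± * (n ×ₙ 1#)
  ⟦◃⟧ s      zero    = sym (zeroʳ _)
  ⟦◃⟧ Sign.+ (suc n) = sym (*-identityˡ _)
  ⟦◃⟧ Sign.- (suc n) = trans (cong -_ (sym (*-identityˡ _))) (-‿distribˡ-* 1# _)

  ⟦*⟧± : ∀ s t → ⟦ s Sign.* t ⟧± ≡ ⟦ s ⟧± * ⟦ t ⟧±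
  ⟦*⟧± Sign.+ t      = sym (*-identityˡ _)
  ⟦*⟧± Sign.- Sign.+ = sym (*-identityʳ _)
  ⟦*⟧± Sign.- Sign.- = sym (begin
    - 1# * - 1#      ≡⟨ -‿distribˡ-* 1# (- 1#) ⟨
    - (1# * - 1#)    ≡⟨ cong -_ (*-identityˡ _) ⟩
    - - 1#           ≡⟨ -‿involutive 1# ⟩
    1#               ∎)

  ⟦⟧ℤ-signAbs : ∀ i → ⟦ i ⟧ℤ ≡ ⟦ sign i ⟧± * (∣ i ∣ ×ₙ 1#)
  ⟦⟧ℤ-signAbs i = trans (cong ⟦_⟧ℤ (sym (ℤₚ.◃-inverse i))) (⟦◃⟧ (sign i) ∣ i ∣)

  ⟦*⟧ : ∀ i j → ⟦ i ℤ.* j ⟧ℤ ≡ ⟦ i ⟧ℤ * ⟦ j ⟧ℤ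
  ⟦*⟧ i j = begin
    ⟦ i ℤ.* j ⟧ℤ                                                   ≡⟨ ⟦◃⟧ (sign i Sign.* sign j) (∣ i ∣ ℕ.* ∣ j ∣) ⟩
    ⟦ sign i Sign.* sign j ⟧± * ((∣ i ∣ ℕ.* ∣ j ∣) ×ₙ 1#)           ≡⟨ cong₂ _*_ (⟦*⟧± (sign i) (sign j)) (×1-homo-* ∣ i ∣ ∣ j ∣) ⟩
    (⟦ sign i ⟧± * ⟦ sign j ⟧±) * ((∣ i ∣ ×ₙ 1#) * (∣ j ∣ ×ₙ 1#))    ≡⟨ *-interchange _ _ _ _ ⟩
    (⟦ sign i ⟧± * (∣ i ∣ ×ₙ 1#)) * (⟦ sign j ⟧± * (∣ j ∣ ×ₙ 1#))    ≡⟨ cong₂ _*_ (⟦⟧ℤ-signAbs i) (⟦⟧ℤ-signAbs j) ⟨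
    ⟦ i ⟧ℤ * ⟦ j ⟧ℤ                                                ∎

  ⟦-⟧ : ∀ i → ⟦ ℤ.- i ⟧ℤ ≡ - ⟦ i ⟧ℤ
  ⟦-⟧ (ℤ.+ zero)  = sym -0#≈0#
  ⟦-⟧ (ℤ.+ suc n) = refl
  ⟦-⟧ -[1+ n ]  = sym (-‿involutive _)

  ℤ⟶F : ℤ.+-*-rawRing -Raw-AlmostCommutative⟶ fromCommutativeRing commutativeRing
  ℤ⟶F = record
    { ⟦_⟧ = ⟦_⟧ℤ ; +-homo = ⟦+⟧ ; *-homo = ⟦*⟧ ; -‿homo = ⟦-⟧
    ; 0-homo = refl ; 1-homo = refl }

  ℤ-coeff≟ : ∀ i j → Maybe (⟦ i ⟧ℤ ≡ ⟦ j ⟧ℤ)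
  ℤ-coeff≟ i j with i ℤ.≟ j
  ... | yes refl = just refl
  ... | no _     = nothing

  open import Algebra.Solver.Ring ℤ.+-*-rawRing (fromCommutativeRing commutativeRing) ℤ⟶F ℤ-coeff≟
    using (solve; _:=_; _:+_; _:*_; :-_; _:-_; con; Polynomial)

  :0 :1 : ∀ {n} → Polynomial n
  :0 = con (ℤ.+ 0)
  :1 = con (ℤ.+ 1)

  ⁻¹-cancelˡ : ∀ {x} y → x ≢ 0# → x ⁻¹ * (x * y) ≡ y
  ⁻¹-cancelˡ {x} y x≢0 = begin
    x ⁻¹ * (x * y)  ≡⟨ solve 3 (λ x x⁻¹ y → x⁻¹ :* (x :* y) := (x :* x⁻¹) :* y) refl x (x ⁻¹) y ⟩
    (x * x ⁻¹) * y  ≡⟨ cong (_* y) (⁻¹-inverse x x≢0) ⟩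
    1# * y          ≡⟨ *-identityˡ y ⟩
    y               ∎

  x*y≡0⇒x≡0⊎y≡0 : ∀ x y → x * y ≡ 0# → x ≡ 0# ⊎ y ≡ 0#
  x*y≡0⇒x≡0⊎y≡0 x y xy≡0 with x ≟F 0#
  ... | yes x≡0 = inj₁ x≡0
  ... | no  x≢0 = inj₂ (trans (sym (⁻¹-cancelˡ y x≢0)) (trans (cong (x ⁻¹ *_) xy≡0) (zeroʳ _)))

  *-≢0 : ∀ {x y} → x ≢ 0# → y ≢ 0# → x * y ≢ 0#
  *-≢0 {x} {y} x≢0 y≢0 xy≡0 with x*y≡0⇒x≡0⊎y≡0 x y xy≡0
  ... | inj₁ x≡0 = x≢0 x≡0
  ... | inj₂ y≡0 = y≢0 y≡0

  ⁻¹-≢0 : ∀ {x} → x ≢ 0# → x ⁻¹ ≢ 0#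
  ⁻¹-≢0 {x} x≢0 x⁻¹≡0 = 0≢1 (trans (sym (zeroʳ x)) (trans (cong (x *_) (sym x⁻¹≡0)) (⁻¹-inverse x x≢0)))

  ⁻¹-unique : ∀ {x} y → x * y ≡ 1# → x ⁻¹ ≡ y
  ⁻¹-unique {x} y xy≡1 = begin
    x ⁻¹             ≡⟨ *-identityʳ _ ⟨
    x ⁻¹ * 1#        ≡⟨ cong (x ⁻¹ *_) xy≡1 ⟨
    x ⁻¹ * (x * y)   ≡⟨ ⁻¹-cancelˡ y x≢0 ⟩
    y                ∎
    where
    x≢0 : x ≢ 0#
    x≢0 x≡0 = 0≢1 (trans (trans (sym (zeroˡ y)) (cong (_* y) (sym x≡0))) xy≡1)

  [x*y⁻¹]⁻¹ : ∀ {x y} → x ≢ 0# → y ≢ 0# → (x * y ⁻¹) ⁻¹ ≡ y * x ⁻¹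
  [x*y⁻¹]⁻¹ {x} {y} x≢0 y≢0 = ⁻¹-unique (y * x ⁻¹) (begin
    x * y ⁻¹ * (y * x ⁻¹)      ≡⟨ solve 4 (λ x x⁻¹ y y⁻¹ → x :* y⁻¹ :* (y :* x⁻¹) := (x :* x⁻¹) :* (y :* y⁻¹)) refl x (x ⁻¹) y (y ⁻¹) ⟩
    (x * x ⁻¹) * (y * y ⁻¹)    ≡⟨ cong₂ _*_ (⁻¹-inverse x x≢0) (⁻¹-inverse y y≢0) ⟩
    1# * 1#                    ≡⟨ *-identityˡ 1# ⟩
    1#                         ∎)

  x-y≡0⇒x≡y : ∀ {x y} → x + - y ≡ 0# → x ≡ y
  x-y≡0⇒x≡y {x} {y} x-y≡0 = begin
    x               ≡⟨ solve 2 (λ x y → x := (x :- y) :+ y) refl x y ⟩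
    (x + - y) + y   ≡⟨ cong (_+ y) x-y≡0 ⟩
    0# + y          ≡⟨ +-identityˡ y ⟩
    y               ∎

  sumF≡sum : ∀ {k} (f : Fin k → F) → sumF f ≡ sum f
  sumF≡sum {zero}  f = refl
  sumF≡sum {suc k} f = cong (f zero +_) (sumF≡sum (f ∘ suc))

  sumF-cong : ∀ {k} {f g : Fin k → F} → (∀ i → f i ≡ g i) → sumF f ≡ sumF g
  sumF-cong {zero}  f≗g = refl
  sumF-cong {suc k} f≗g = cong₂ _+_ (f≗g zero) (sumF-cong (f≗g ∘ suc))

  sumF-zero : ∀ {k} {f : Fin k → F} → (∀ i → f i ≡ 0#) → sumF f ≡ 0#
  sumF-zero {zero}  f≗0 = refl
  sumF-zero {suc k} f≗0 = trans (cong₂ _+_ (f≗0 zero) (sumF-zero (f≗0 ∘ suc))) (+-identityˡ 0#)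

  sumF-+ : ∀ {k} (f g : Fin k → F) → sumF (λ i → f i + g i) ≡ sumF f + sumF g
  sumF-+ f g = begin
    sumF (λ i → f i + g i)  ≡⟨ sumF≡sum (λ i → f i + g i) ⟩
    sum (λ i → f i + g i)   ≡⟨ ∑-distrib-+ f g ⟩
    sum f + sum g           ≡⟨ cong₂ _+_ (sumF≡sum f) (sumF≡sum g) ⟨
    sumF f + sumF g         ∎

  sumF-*ˡ : ∀ {k} a (f : Fin k → F) → a * sumF f ≡ sumF (λ i → a * f i)
  sumF-*ˡ a f = begin
    a * sumF f              ≡⟨ cong (a *_) (sumF≡sum f) ⟩
    a * sum f               ≡⟨ *-distribˡ-sum a f ⟩
    sum (λ i → a * f i)     ≡⟨ sumF≡sum (λ i → a * f i) ⟨
    sumF (λ i → a * f i)    ∎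

  sumF-*ʳ : ∀ {k} a (f : Fin k → F) → sumF f * a ≡ sumF (λ i → f i * a)
  sumF-*ʳ a f = trans (*-comm _ a) (trans (sumF-*ˡ a f) (sumF-cong (λ i → *-comm a (f i))))

  sumF-neg : ∀ {k} (f : Fin k → F) → - sumF f ≡ sumF (λ i → - f i)
  sumF-neg f = begin
    - sumF f                  ≡⟨ solve 1 (λ x → :- x := (:- :1) :* x) refl (sumF f) ⟩
    - 1# * sumF f             ≡⟨ sumF-*ˡ (- 1#) f ⟩
    sumF (λ i → - 1# * f i)   ≡⟨ sumF-cong (λ i → solve 1 (λ x → (:- :1) :* x := :- x) refl (f i)) ⟩
    sumF (λ i → - f i)        ∎

  sumF-comm : ∀ {k l} (f : Fin k → Fin l → F) → sumF (λ i → sumF (f i)) ≡ sumF (λ x → sumF (λ i → f i x))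
  sumF-comm f = begin
    sumF (λ i → sumF (f i))              ≡⟨ sumF-cong (λ i → sumF≡sum (f i)) ⟩
    sumF (λ i → sum (f i))               ≡⟨ sumF≡sum (λ i → sum (f i)) ⟩
    sum (λ i → sum (f i))                ≡⟨ ∑-comm f ⟩
    sum (λ x → sum (λ i → f i x))        ≡⟨ sumF≡sum (λ x → sum (λ i → f i x)) ⟨
    sumF (λ x → sum (λ i → f i x))       ≡⟨ sumF-cong (λ x → sumF≡sum (λ i → f i x)) ⟨
    sumF (λ x → sumF (λ i → f i x))      ∎

  sumF-punchIn : ∀ {k} (m : Fin (suc k)) (f : Fin (suc k) → F) → sumF f ≡ f m + sumF (f ∘ punchIn m)
  sumF-punchIn m f = begin
    sumF f                     ≡⟨ sumF≡sum f ⟩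
    sum f                      ≡⟨ sum-remove f ⟩
    f m + sum (f ∘ punchIn m)  ≡⟨ cong (f m +_) (sumF≡sum (f ∘ punchIn m)) ⟨
    f m + sumF (f ∘ punchIn m) ∎

  sumF-single : ∀ {k} (m : Fin k) (f : Fin k → F) → (∀ i → i ≢ m → f i ≡ 0#) → sumF f ≡ f m
  sumF-single {suc k} m f f≡0 = begin
    sumF f                       ≡⟨ sumF-punchIn m f ⟩
    f m + sumF (f ∘ punchIn m)   ≡⟨ cong (f m +_) (sumF-zero (λ i → f≡0 _ (Finₚ.punchInᵢ≢i m i))) ⟩
    f m + 0#                     ≡⟨ +-identityʳ _ ⟩
    f m                          ∎

  -- written exactly as the identity part of Γ, so that Γ unfolds to δ + bᵀc
  δ : ∀ {k} → Fin k → Fin k → F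
  δ x y = if ⌊ x Finₚ.≟ y ⌋ then 1# else 0#

  δ-refl : ∀ {k} (x : Fin k) → δ x x ≡ 1#
  δ-refl x with x Finₚ.≟ x
  ... | yes _  = refl
  ... | no x≢x = contradiction refl x≢x

  δ-≢ : ∀ {k} {x y : Fin k} → x ≢ y → δ x y ≡ 0#
  δ-≢ {x = x} {y} x≢y with x Finₚ.≟ y
  ... | yes x≡y = contradiction x≡y x≢y
  ... | no _    = refl

  sumF-δˡ : ∀ {k} (y : Fin k) (f : Fin k → F) → sumF (λ x → δ x y * f x) ≡ f y
  sumF-δˡ y f = begin
    sumF (λ x → δ x y * f x)   ≡⟨ sumF-single y _ (λ x x≢y → trans (cong (_* f x) (δ-≢ x≢y)) (zeroˡ _)) ⟩
    δ y y * f y                ≡⟨ cong (_* f y) (δ-refl y) ⟩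
    1# * f y                   ≡⟨ *-identityˡ _ ⟩
    f y                        ∎

  sumF-δʳ : ∀ {k} (y : Fin k) (f : Fin k → F) → sumF (λ x → f x * δ y x) ≡ f y
  sumF-δʳ y f = trans (sumF-cong (λ x → *-comm (f x) (δ y x))) (trans (sumF-cong (λ x → cong (_* f x) (δ-sym x))) (sumF-δˡ y f))
    where
    δ-sym : ∀ x → δ y x ≡ δ x y
    δ-sym x with y Finₚ.≟ x | x Finₚ.≟ y
    ... | yes _   | yes _   = refl
    ... | no _    | no _    = refl
    ... | yes y≡x | no x≢y  = contradiction (sym y≡x) x≢y
    ... | no y≢x  | yes x≡y = contradiction (sym x≡y) y≢x

  AgreeAfter : ∀ {n} → Fin n → Row n → Row n → Set
  AgreeAfter j v w = ∀ t → j Fin.< t → v t ≡ w t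

  SupportedAfter : ∀ {n} → Fin n → Row n → Set
  SupportedAfter j e = ∀ t → t Fin.≤ j → e t ≡ 0#

  linComb : ∀ {s n} → (Fin s → F) → (Fin s → Row n) → Row n
  linComb x K t = sumF (λ l → x l * K l t)

  IndependentAfter : ∀ {s n} → Fin n → (Fin s → Row n) → Set
  IndependentAfter j K = ∀ x → AgreeAfter j (linComb x K) (λ _ → 0#) → ∀ l → x l ≡ 0#

  SpannedAfter : ∀ {s n} → Fin n → (Fin s → Row n) → Row n → Set
  SpannedAfter j K v = ∃ λ x → AgreeAfter j v (linComb x K)

  pairing : ∀ {n} → Row n → Row n → F
  pairing e v = sumF (λ t → e t * v t)

  linComb-cong : ∀ {s n} {x y : Fin s → F} {K K′ : Fin s → Row n} t →
                 (∀ l → x l ≡ y l) → (∀ l → K l t ≡ K′ l t) → linComb x K t ≡ linComb y K′ t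
  linComb-cong t x≗y K≗K′ = sumF-cong (λ l → cong₂ _*_ (x≗y l) (K≗K′ l))

  linComb-compose : ∀ {s s′ n} (x : Fin s → F) (α : Fin s → Fin s′ → F) (K : Fin s → Row n) (K′ : Fin s′ → Row n) t →
                    (∀ l → K l t ≡ linComb (α l) K′ t) → linComb x K t ≡ linComb (λ y → sumF (λ l → x l * α l y)) K′ t
  linComb-compose x α K K′ t K≡ = begin
    sumF (λ l → x l * K l t)                               ≡⟨ sumF-cong (λ l → cong (x l *_) (K≡ l)) ⟩
    sumF (λ l → x l * sumF (λ y → α l y * K′ y t))         ≡⟨ sumF-cong (λ l → sumF-*ˡ (x l) (λ y → α l y * K′ y t)) ⟩
    sumF (λ l → sumF (λ y → x l * (α l y * K′ y t)))       ≡⟨ sumF-comm (λ l y → x l * (α l y * K′ y t)) ⟩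
    sumF (λ y → sumF (λ l → x l * (α l y * K′ y t)))       ≡⟨ sumF-cong (λ y → sumF-cong (λ l → sym (*-assoc (x l) (α l y) (K′ y t)))) ⟩
    sumF (λ y → sumF (λ l → x l * α l y * K′ y t))         ≡⟨ sumF-cong (λ y → sym (sumF-*ʳ (K′ y t) (λ l → x l * α l y))) ⟩
    sumF (λ y → sumF (λ l → x l * α l y) * K′ y t)         ∎

  linComb-unique : ∀ {s n} {j : Fin n} {K : Fin s → Row n} → IndependentAfter j K →
                   ∀ x y → AgreeAfter j (linComb x K) (linComb y K) → ∀ l → x l ≡ y l
  linComb-unique {K = K} ind x y x≈y l = x-y≡0⇒x≡y (ind (λ l → x l + - y l) difference≈0 l)
    where
    difference≈0 : AgreeAfter _ (linComb (λ l → x l + - y l) K) (λ _ → 0#)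
    difference≈0 t j<t = begin
      sumF (λ l → (x l + - y l) * K l t)                         ≡⟨ sumF-cong (λ l → solve 3 (λ a b c → (a :- b) :* c := a :* c :+ :- (b :* c)) refl (x l) (y l) (K l t)) ⟩
      sumF (λ l → x l * K l t + - (y l * K l t))                 ≡⟨ sumF-+ (λ l → x l * K l t) (λ l → - (y l * K l t)) ⟩
      linComb x K t + sumF (λ l → - (y l * K l t))               ≡⟨ cong (linComb x K t +_) (sumF-neg (λ l → y l * K l t)) ⟨
      linComb x K t + - linComb y K t                            ≡⟨ cong (λ u → u + - linComb y K t) (x≈y t j<t) ⟩
      linComb y K t + - linComb y K t                            ≡⟨ -‿inverseʳ _ ⟩
      0#                                                         ∎

  pairing-linComb : ∀ {s n} (e : Row n) (x : Fin s → F) (K : Fin s → Row n) →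
                    pairing e (linComb x K) ≡ sumF (λ l → x l * pairing e (K l))
  pairing-linComb e x K = begin
    sumF (λ t → e t * sumF (λ l → x l * K l t))      ≡⟨ sumF-cong (λ t → sumF-*ˡ (e t) (λ l → x l * K l t)) ⟩
    sumF (λ t → sumF (λ l → e t * (x l * K l t)))    ≡⟨ sumF-comm (λ t l → e t * (x l * K l t)) ⟩
    sumF (λ l → sumF (λ t → e t * (x l * K l t)))    ≡⟨ sumF-cong (λ l → sumF-cong (λ t → solve 3 (λ a b c → a :* (b :* c) := b :* (a :* c)) refl (e t) (x l) (K l t))) ⟩
    sumF (λ l → sumF (λ t → x l * (e t * K l t)))    ≡⟨ sumF-cong (λ l → sym (sumF-*ˡ (x l) (λ t → e t * K l t))) ⟩
    sumF (λ l → x l * pairing e (K l))               ∎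

  pairing-+ˡ : ∀ {n} (e e′ v : Row n) → pairing (λ t → e t + e′ t) v ≡ pairing e v + pairing e′ v
  pairing-+ˡ e e′ v = trans (sumF-cong (λ t → distribʳ (v t) (e t) (e′ t))) (sumF-+ (λ t → e t * v t) (λ t → e′ t * v t))

  pairing-*ˡ : ∀ {n} a (e v : Row n) → pairing (λ t → a * e t) v ≡ a * pairing e v
  pairing-*ˡ a e v = trans (sumF-cong (λ t → *-assoc a (e t) (v t))) (sym (sumF-*ˡ a (λ t → e t * v t)))

  pairing-+*ʳ : ∀ {n} (e v w : Row n) a → pairing e (λ t → v t + a * w t) ≡ pairing e v + a * pairing e w
  pairing-+*ʳ e v w a = begin
    sumF (λ t → e t * (v t + a * w t))              ≡⟨ sumF-cong (λ t → solve 4 (λ e v w a → e :* (v :+ a :* w) := e :* v :+ a :* (e :* w)) refl (e t) (v t) (w t) a) ⟩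
    sumF (λ t → e t * v t + a * (e t * w t))        ≡⟨ sumF-+ (λ t → e t * v t) (λ t → a * (e t * w t)) ⟩
    pairing e v + sumF (λ t → a * (e t * w t))      ≡⟨ cong (pairing e v +_) (sumF-*ˡ a (λ t → e t * w t)) ⟨
    pairing e v + a * pairing e w                   ∎

  pairing-δ : ∀ {n} (t₀ : Fin n) (v : Row n) → pairing (δ t₀) v ≡ v t₀
  pairing-δ t₀ v = trans (sumF-cong (λ t → *-comm (δ t₀ t) (v t))) (sumF-δʳ t₀ v)

  pairing-after : ∀ {n} {j : Fin n} {e v w : Row n} → SupportedAfter j e → AgreeAfter j v w → pairing e v ≡ pairing e w
  pairing-after {j = j} {e} {v} {w} e-supp v≈w = sumF-cong same
    where
    same : ∀ t → e t * v t ≡ e t * w t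
    same t with j Fin.<? t
    ... | yes j<t = cong (e t *_) (v≈w t j<t)
    ... | no  j≮t = trans (cong (_* v t) e≡0) (trans (zeroˡ _) (sym (trans (cong (_* w t) e≡0) (zeroˡ _))))
      where
      e≡0 : e t ≡ 0#
      e≡0 = e-supp t (ℕₚ.≮⇒≥ j≮t)

  SpannedAfter-resp : ∀ {s n} {j : Fin n} {K : Fin s → Row n} {v w} → AgreeAfter j v w → SpannedAfter j K v → SpannedAfter j K w
  SpannedAfter-resp v≈w (x , v≈) = x , (λ t j<t → trans (sym (v≈w t j<t)) (v≈ t j<t))

  SpannedAfter-trans : ∀ {s s′ n} {j : Fin n} {K : Fin s → Row n} {K′ : Fin s′ → Row n} {v} →
                       (∀ l → SpannedAfter j K′ (K l)) → SpannedAfter j K v → SpannedAfter j K′ v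
  SpannedAfter-trans {K = K} {K′} K⊆ (x , v≈) =
    (λ y → sumF (λ l → x l * proj₁ (K⊆ l) y)) ,
    (λ t j<t → trans (v≈ t j<t) (linComb-compose x (proj₁ ∘ K⊆) K K′ t (λ l → proj₂ (K⊆ l) t j<t)))

  SpannedAfter-member : ∀ {s n} {j : Fin n} (K : Fin s → Row n) q → SpannedAfter j K (K q)
  SpannedAfter-member K q = (λ l → δ l q) , (λ t _ → sym (sumF-δˡ q (λ l → K l t)))

  SpannedAfter-zero : ∀ {s n} {j : Fin n} (K : Fin s → Row n) {v} → AgreeAfter j v (λ _ → 0#) → SpannedAfter j K v
  SpannedAfter-zero K v≈0 = (λ _ → 0#) , (λ t j<t → trans (v≈0 t j<t) (sym (sumF-zero (λ l → zeroˡ (K l t)))))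

  SpannedAfter-+* : ∀ {s n} {j : Fin n} (K : Fin s → Row n) {v w} a →
                    SpannedAfter j K v → SpannedAfter j K w → SpannedAfter j K (λ t → v t + a * w t)
  SpannedAfter-+* K {v} {w} a (x , v≈) (y , w≈) = (λ l → x l + a * y l) , (λ t j<t → begin
    v t + a * w t                                   ≡⟨ cong₂ (λ p q → p + a * q) (v≈ t j<t) (w≈ t j<t) ⟩
    linComb x K t + a * linComb y K t               ≡⟨ cong (linComb x K t +_) (sumF-*ˡ a (λ l → y l * K l t)) ⟩
    linComb x K t + sumF (λ l → a * (y l * K l t))  ≡⟨ sumF-+ (λ l → x l * K l t) (λ l → a * (y l * K l t)) ⟨
    sumF (λ l → x l * K l t + a * (y l * K l t))    ≡⟨ sumF-cong (λ l → solve 4 (λ x a y k → x :* k :+ a :* (y :* k) := (x :+ a :* y) :* k) refl (x l) a (y l) (K l t)) ⟩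
    linComb (λ l → x l + a * y l) K t               ∎)

  SpannedAfter-≤ : ∀ {s n} {j j′ : Fin n} {K : Fin s → Row n} {v} → j Fin.≤ j′ → SpannedAfter j K v → SpannedAfter j′ K v
  SpannedAfter-≤ j≤j′ (x , v≈) = x , (λ t j′<t → v≈ t (ℕₚ.≤-<-trans j≤j′ j′<t))

  nonzero-after : ∀ {n} (j : Fin n) (v : Row n) → ¬ AgreeAfter j v (λ _ → 0#) → ∃ λ t → j Fin.< t × v t ≢ 0#
  nonzero-after j v v≉0 with Finₚ.any? (λ t → (j Fin.<? t) ×-dec ¬? (v t ≟F 0#))
  ... | yes found = found
  ... | no  none  = contradiction (λ t j<t → decidable-stable (v t ≟F 0#) (λ v≢0 → none (t , j<t , v≢0))) v≉0

  IndependentAfter-eliminate : ∀ {s n} {j : Fin n} {K : Fin (suc s) → Row n} (κ : Fin s → F) → IndependentAfter j K →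
                               IndependentAfter j (λ l t → K (suc l) t + - (κ l * K zero t))
  IndependentAfter-eliminate {K = K} κ ind x x≈0 l = ind z (λ t j<t → trans (z≡x t) (x≈0 t j<t)) (suc l)
    where
    z : Fin (suc _) → F
    z zero    = - sumF (λ l → x l * κ l)
    z (suc l) = x l
    z≡x : ∀ t → linComb z K t ≡ linComb x (λ l t → K (suc l) t + - (κ l * K zero t)) t
    z≡x t = begin
      - sumF (λ l → x l * κ l) * K zero t + sumF (λ l → x l * K (suc l) t)
        ≡⟨ cong (_+ sumF (λ l → x l * K (suc l) t)) (trans (sym (-‿distribˡ-* _ _)) (cong -_ (sumF-*ʳ (K zero t) (λ l → x l * κ l)))) ⟩
      - sumF (λ l → x l * κ l * K zero t) + sumF (λ l → x l * K (suc l) t)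
        ≡⟨ cong (_+ sumF (λ l → x l * K (suc l) t)) (sumF-neg (λ l → x l * κ l * K zero t)) ⟩
      sumF (λ l → - (x l * κ l * K zero t)) + sumF (λ l → x l * K (suc l) t)
        ≡⟨ sumF-+ (λ l → - (x l * κ l * K zero t)) (λ l → x l * K (suc l) t) ⟨
      sumF (λ l → - (x l * κ l * K zero t) + x l * K (suc l) t)
        ≡⟨ sumF-cong (λ l → solve 4 (λ x k a b → :- (x :* k :* a) :+ x :* b := x :* (b :- k :* a)) refl (x l) (κ l) (K zero t) (K (suc l) t)) ⟩
      sumF (λ l → x l * (K (suc l) t + - (κ l * K zero t)))
        ∎

  IndependentAfter⇒dual : ∀ {s n} (j : Fin n) (K : Fin s → Row n) → IndependentAfter j K → ∀ (y : Fin s → F) →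
                          ∃ λ e → SupportedAfter j e × (∀ l → pairing e (K l) ≡ y l)
  IndependentAfter⇒dual {zero}  j K ind y = (λ _ → 0#) , (λ _ _ → refl) , (λ ())
  IndependentAfter⇒dual {suc s} {n} j K ind y = e , e-supp , e-dual
    where
    K₀≉0 : ¬ AgreeAfter j (K zero) (λ _ → 0#)
    K₀≉0 K₀≈0 = 0≢1 (trans (sym (ind (λ l → δ l zero) (λ t j<t → trans (sumF-δˡ zero (λ l → K l t)) (K₀≈0 t j<t)) zero)) (δ-refl {suc s} zero))
    t₀ : Fin n
    t₀ = proj₁ (nonzero-after j (K zero) K₀≉0)
    j<t₀ : j Fin.< t₀
    j<t₀ = proj₁ (proj₂ (nonzero-after j (K zero) K₀≉0))
    p : F
    p = K zero t₀
    p≢0 : p ≢ 0#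
    p≢0 = proj₂ (proj₂ (nonzero-after j (K zero) K₀≉0))
    -- clear column t₀ in the remaining rows, solve for them, then correct along δ t₀
    κ : Fin s → F
    κ l = K (suc l) t₀ * p ⁻¹
    K′ : Fin s → Row n
    K′ l t = K (suc l) t + - (κ l * K zero t)
    IH : ∃ λ e′ → SupportedAfter j e′ × (∀ l → pairing e′ (K′ l) ≡ y (suc l) + - (κ l * y zero))
    IH = IndependentAfter⇒dual j K′ (IndependentAfter-eliminate {K = K} κ ind) (λ l → y (suc l) + - (κ l * y zero))
    e′ : Row n
    e′ = proj₁ IH
    λ₀ : F
    λ₀ = (y zero + - pairing e′ (K zero)) * p ⁻¹
    e : Row n
    e t = e′ t + λ₀ * δ t₀ t
    e-supp : SupportedAfter j e
    e-supp t t≤j = begin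
      e′ t + λ₀ * δ t₀ t  ≡⟨ cong₂ (λ u v → u + λ₀ * v) (proj₁ (proj₂ IH) t t≤j) (δ-≢ (λ t₀≡t → ℕₚ.<⇒≱ j<t₀ (subst (Fin._≤ j) (sym t₀≡t) t≤j))) ⟩
      0# + λ₀ * 0#        ≡⟨ solve 1 (λ a → :0 :+ a :* :0 := :0) refl λ₀ ⟩
      0#                  ∎
    pairing-e : ∀ v → pairing e v ≡ pairing e′ v + λ₀ * v t₀
    pairing-e v = trans (pairing-+ˡ e′ _ v) (cong (pairing e′ v +_) (trans (pairing-*ˡ λ₀ (δ t₀) v) (cong (λ₀ *_) (pairing-δ t₀ v))))
    p⁻¹*p : p ⁻¹ * p ≡ 1#
    p⁻¹*p = trans (*-comm _ p) (⁻¹-inverse p p≢0)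
    e-dual : ∀ l → pairing e (K l) ≡ y l
    e-dual zero = begin
      pairing e (K zero)                                                 ≡⟨ pairing-e (K zero) ⟩
      pairing e′ (K zero) + (y zero + - pairing e′ (K zero)) * p ⁻¹ * p  ≡⟨ solve 4 (λ a b i p → a :+ (b :- a) :* i :* p := a :+ (b :- a) :* (i :* p)) refl (pairing e′ (K zero)) (y zero) (p ⁻¹) p ⟩
      pairing e′ (K zero) + (y zero + - pairing e′ (K zero)) * (p ⁻¹ * p) ≡⟨ cong (λ w → pairing e′ (K zero) + (y zero + - pairing e′ (K zero)) * w) p⁻¹*p ⟩
      pairing e′ (K zero) + (y zero + - pairing e′ (K zero)) * 1#         ≡⟨ solve 2 (λ a b → a :+ (b :- a) :* :1 := b) refl (pairing e′ (K zero)) (y zero) ⟩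
      y zero                                                             ∎
    e-dual (suc l) = begin
      pairing e (K (suc l))                                         ≡⟨ pairing-e (K (suc l)) ⟩
      pairing e′ (K (suc l)) + λ₀ * K (suc l) t₀                    ≡⟨ cong (_+ λ₀ * K (suc l) t₀) (pairing-e′-K l) ⟩
      (pairing e′ (K′ l) + κ l * pairing e′ (K zero)) + λ₀ * K (suc l) t₀
                                                                    ≡⟨ cong (λ w → (w + κ l * pairing e′ (K zero)) + λ₀ * K (suc l) t₀) (proj₂ (proj₂ IH) l) ⟩
      ((y (suc l) + - (κ l * y zero)) + κ l * pairing e′ (K zero)) + (y zero + - pairing e′ (K zero)) * p ⁻¹ * K (suc l) t₀
                                                                    ≡⟨ solve 5 (λ ys y0 i pe k → ((ys :- (k :* i) :* y0) :+ (k :* i) :* pe) :+ (y0 :- pe) :* i :* k := ys) refl (y (suc l)) (y zero) (p ⁻¹) (pairing e′ (K zero)) (K (suc l) t₀) ⟩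
      y (suc l)                                                     ∎
      where
      pairing-e′-K : ∀ l → pairing e′ (K (suc l)) ≡ pairing e′ (K′ l) + κ l * pairing e′ (K zero)
      pairing-e′-K l = begin
        pairing e′ (K (suc l))                                              ≡⟨ sumF-cong (λ t → cong (e′ t *_) (solve 3 (λ a k b → a := (a :- k :* b) :+ k :* b) refl (K (suc l) t) (κ l) (K zero t))) ⟩
        pairing e′ (λ t → K′ l t + κ l * K zero t)                          ≡⟨ trans (sumF-cong (λ t → distribˡ (e′ t) _ _)) (sumF-+ (λ t → e′ t * K′ l t) (λ t → e′ t * (κ l * K zero t))) ⟩
        pairing e′ (K′ l) + sumF (λ t → e′ t * (κ l * K zero t))            ≡⟨ cong (pairing e′ (K′ l) +_) (trans (sumF-cong (λ t → solve 3 (λ a b c → a :* (b :* c) := b :* (a :* c)) refl (e′ t) (κ l) (K zero t))) (sym (sumF-*ˡ (κ l) (λ t → e′ t * K zero t)))) ⟩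
        pairing e′ (K′ l) + κ l * pairing e′ (K zero)                       ∎

  rowsOf : ∀ {k n} → Mat k n → (xs : List (Fin k)) → Fin (length xs) → Row n
  rowsOf M xs l = M (lookup xs l)

  SpanAfter⇒SpannedAfter : ∀ {k n} {M : Mat k n} {j : Fin n} B {v} → SpanAfter j (map M B) v → SpannedAfter j (rowsOf M B) v
  SpanAfter⇒SpannedAfter []      (c , v≈) = c , v≈
  SpanAfter⇒SpannedAfter (u ∷ B) (c , v≈) with SpanAfter⇒SpannedAfter B ((c ∘ suc) , (λ t _ → refl))
  ... | c′ , c′≈ = (c zero Vector.∷ c′) , (λ t j<t → trans (v≈ t j<t) (cong (c zero * _ +_) (c′≈ t j<t)))

  SpannedAfter⇒SpanAfter : ∀ {k n} {M : Mat k n} {j : Fin n} B {v} → SpannedAfter j (rowsOf M B) v → SpanAfter j (map M B) v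
  SpannedAfter⇒SpanAfter []      (c , v≈) = c , v≈
  SpannedAfter⇒SpanAfter (u ∷ B) (c , v≈) with SpannedAfter⇒SpanAfter B ((c ∘ suc) , (λ t _ → refl))
  ... | c′ , c′≈ = (c zero Vector.∷ c′) , (λ t j<t → trans (v≈ t j<t) (cong (c zero * _ +_) (c′≈ t j<t)))

  SpannedAfter-∈ : ∀ {k n} (M : Mat k n) (j : Fin n) {X : List (Fin k)} {u} → u ∈ X → SpannedAfter j (rowsOf M X) (M u)
  SpannedAfter-∈ M j {X} u∈X = subst (SpannedAfter j (rowsOf M X) ∘ M) (sym (lookup-index u∈X)) (SpannedAfter-member (rowsOf M X) (index u∈X))

  SpannedAfter-⊆ : ∀ {k n} (M : Mat k n) (j : Fin n) {B X : List (Fin k)} → (∀ {u} → u ∈ B → u ∈ X) →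
                   ∀ {v} → SpannedAfter j (rowsOf M B) v → SpannedAfter j (rowsOf M X) v
  SpannedAfter-⊆ M j {B} B⊆X = SpannedAfter-trans (λ l → SpannedAfter-∈ M j (B⊆X (∈ₚ.∈-lookup l)))

  ∃F? : {Q : F → Set} → (∀ a → Dec (Q a)) → Dec (∃ Q)
  ∃F? {Q} Q? with Finₚ.any? (Q? ∘ Inverse.to enum)
  ... | yes (i , q) = yes (_ , q)
  ... | no  none    = no (λ (a , q) → none (Inverse.from enum a , subst Q (sym (Inverse.strictlyInverseˡ enum a)) q))

  ∃coefficients? : ∀ s {P : (Fin s → F) → Set} → (∀ {c c′} → (∀ i → c i ≡ c′ i) → P c → P c′) →
                   (∀ c → Dec (P c)) → Dec (∃ P)
  ∃coefficients? zero    resp P? with P? (λ ())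
  ... | yes p = yes (_ , p)
  ... | no ¬p = no (λ (c , p) → ¬p (resp (λ ()) p))
  ∃coefficients? (suc s) {P} resp P?
    with ∃F? (λ a → ∃coefficients? s (λ c≗c′ → resp (λ { zero → refl ; (suc i) → c≗c′ i })) (λ c → P? (a Vector.∷ c)))
  ... | yes (a , c , p) = yes (a Vector.∷ c , p)
  ... | no  none        = no (λ (c , p) → none (c zero , c ∘ suc , resp (λ { zero → refl ; (suc i) → refl }) p))

  SpanAfter? : ∀ {n} (j : Fin n) (vs : List (Row n)) v → Dec (SpanAfter j vs v)
  SpanAfter? j vs v = ∃coefficients? (length vs) (λ c≗c′ v≈ t j<t → trans (v≈ t j<t) (sumF-cong (λ l → cong (_* _) (c≗c′ l))))
                        (λ c → Finₚ.all? (λ t → Dec-after t c))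
    where
    Dec-after : ∀ t c → Dec (j Fin.< t → v t ≡ sumF (λ l → c l * lookup vs l t))
    Dec-after t c with j Fin.<? t | v t ≟F sumF (λ l → c l * lookup vs l t)
    ... | no  j≮t | _       = yes (λ j<t → contradiction j<t j≮t)
    ... | yes _   | yes v≡  = yes (λ _ → v≡)
    ... | yes j<t | no  v≢  = no (λ v≡ → v≢ (v≡ j<t))

  -- The lexically first basis

  lexFirst-exists : ∀ {k n} (M : Mat k n) (j : Fin n) B cs → ∃ (LexFirst M j B cs)
  lexFirst-exists M j B []       = [] , done
  lexFirst-exists M j B (i ∷ cs) with SpanAfter? j (map M B) (M i)
  ... | yes sp = let (L , lf) = lexFirst-exists M j B cs        in L , skip sp lf
  ... | no ¬sp = let (L , lf) = lexFirst-exists M j (B ∷ʳ i) cs in i ∷ L , take ¬sp lf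

  lexFirst-unique : ∀ {k n} {M : Mat k n} {j : Fin n} {B cs L L′} → LexFirst M j B cs L → LexFirst M j B cs L′ → L ≡ L′
  lexFirst-unique done         done          = refl
  lexFirst-unique (skip _ lf)  (skip _ lf′)  = lexFirst-unique lf lf′
  lexFirst-unique (skip sp _)  (take ¬sp _)  = contradiction sp ¬sp
  lexFirst-unique (take ¬sp _) (skip sp _)   = contradiction sp ¬sp
  lexFirst-unique (take _ lf)  (take _ lf′)  = cong (_ ∷_) (lexFirst-unique lf lf′)

  lexFirst-All : ∀ {k n} {M : Mat k n} {j : Fin n} {B cs L} {P : Fin k → Set} → All P cs → LexFirst M j B cs L → All P L
  lexFirst-All []       done        = []
  lexFirst-All (_ ∷ ps) (skip _ lf) = lexFirst-All ps lf
  lexFirst-All (p ∷ ps) (take _ lf) = p ∷ lexFirst-All ps lf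

  lexFirst-spans : ∀ {k n} {M : Mat k n} {j : Fin n} {B cs L} → LexFirst M j B cs L →
                   ∀ {u} → u ∈ cs → SpannedAfter j (rowsOf M (B ++ L)) (M u)
  lexFirst-spans {M = M} {j} {B} (skip {L = L} sp lf) (here refl) = SpannedAfter-⊆ M j {B} {B ++ L} ∈ₚ.∈-++⁺ˡ (SpanAfter⇒SpannedAfter B sp)
  lexFirst-spans (skip _ lf) (there u∈) = lexFirst-spans lf u∈
  lexFirst-spans {M = M} {j} {B} (take {L = L} _ lf) (here refl) = SpannedAfter-∈ M j (∈ₚ.∈-++⁺ʳ B (here refl))
  lexFirst-spans {M = M} {j} {B} (take {i = i} {L = L} _ lf) (there u∈) =
    subst (λ X → SpannedAfter j (rowsOf M X) _) (Listₚ.++-assoc B (i ∷ []) L) (lexFirst-spans lf u∈)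

  ∷ʳ-inject : ∀ {A : Set} (B : List A) x → Fin (length B) → Fin (length (B ∷ʳ x))
  ∷ʳ-inject (_ ∷ B) x zero    = zero
  ∷ʳ-inject (_ ∷ B) x (suc l) = suc (∷ʳ-inject B x l)

  ∷ʳ-last : ∀ {A : Set} (B : List A) x → Fin (length (B ∷ʳ x))
  ∷ʳ-last []      x = zero
  ∷ʳ-last (_ ∷ B) x = suc (∷ʳ-last B x)

  lookup-∷ʳ-inject : ∀ {A : Set} (B : List A) x l → lookup (B ∷ʳ x) (∷ʳ-inject B x l) ≡ lookup B l
  lookup-∷ʳ-inject (_ ∷ B) x zero    = refl
  lookup-∷ʳ-inject (_ ∷ B) x (suc l) = lookup-∷ʳ-inject B x l

  lookup-∷ʳ-last : ∀ {A : Set} (B : List A) x → lookup (B ∷ʳ x) (∷ʳ-last B x) ≡ x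
  lookup-∷ʳ-last []      x = refl
  lookup-∷ʳ-last (_ ∷ B) x = lookup-∷ʳ-last B x

  ∷ʳ-index-view : ∀ {A : Set} (B : List A) x (p : Fin (length (B ∷ʳ x))) → (∃ λ l → p ≡ ∷ʳ-inject B x l) ⊎ p ≡ ∷ʳ-last B x
  ∷ʳ-index-view []      x zero    = inj₂ refl
  ∷ʳ-index-view (_ ∷ B) x zero    = inj₁ (zero , refl)
  ∷ʳ-index-view (_ ∷ B) x (suc p) with ∷ʳ-index-view B x p
  ... | inj₁ (l , refl) = inj₁ (suc l , refl)
  ... | inj₂ refl       = inj₂ refl

  sumF-∷ʳ : ∀ {A : Set} (B : List A) x (f : Fin (length (B ∷ʳ x)) → F) →
            sumF f ≡ sumF (f ∘ ∷ʳ-inject B x) + f (∷ʳ-last B x)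
  sumF-∷ʳ []      x f = +-comm _ _
  sumF-∷ʳ (_ ∷ B) x f = trans (cong (f zero +_) (sumF-∷ʳ B x (f ∘ suc))) (sym (+-assoc _ _ _))

  IndependentRows : ∀ {k n} → Fin n → Mat k n → List (Fin k) → Set
  IndependentRows j M xs = IndependentAfter j (rowsOf M xs)

  -- a nonzero coefficient κ on the new row would put that row in the span of B
  IndependentRows-∷ʳ : ∀ {k n} {M : Mat k n} {j : Fin n} B i → IndependentRows j M B →
                       ¬ SpanAfter j (map M B) (M i) → IndependentRows j M (B ∷ʳ i)
  IndependentRows-∷ʳ {M = M} {j} B i ind ¬sp x x≈0 = x≡0
    where
    y : Fin (length B) → F
    y = x ∘ ∷ʳ-inject B i
    κ : F
    κ = x (∷ʳ-last B i)
    split : ∀ t → linComb x (rowsOf M (B ∷ʳ i)) t ≡ linComb y (rowsOf M B) t + κ * M i t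
    split t = trans (sumF-∷ʳ B i _) (cong₂ _+_ (sumF-cong (λ l → cong (λ u → y l * M u t) (lookup-∷ʳ-inject B i l)))
                                               (cong (λ u → κ * M u t) (lookup-∷ʳ-last B i)))
    κ≡0 : κ ≡ 0#
    κ≡0 with κ ≟F 0#
    ... | yes κ≡0 = κ≡0
    ... | no  κ≢0 = contradiction (SpannedAfter⇒SpanAfter B ((λ l → - (κ ⁻¹) * y l) , Mi≈)) ¬sp
      where
      Mi≈ : AgreeAfter j (M i) (linComb (λ l → - (κ ⁻¹) * y l) (rowsOf M B))
      Mi≈ t j<t = sym (begin
        sumF (λ l → - (κ ⁻¹) * y l * M (lookup B l) t)                          ≡⟨ sumF-cong (λ l → *-assoc (- (κ ⁻¹)) (y l) _) ⟩
        sumF (λ l → - (κ ⁻¹) * (y l * M (lookup B l) t))                        ≡⟨ sumF-*ˡ _ (λ l → y l * M (lookup B l) t) ⟨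
        - (κ ⁻¹) * linComb y (rowsOf M B) t                                      ≡⟨ solve 4 (λ a L k m → :- a :* L := :- a :* (L :+ k :* m) :+ (a :* k) :* m) refl (κ ⁻¹) (linComb y (rowsOf M B) t) κ (M i t) ⟩
        - (κ ⁻¹) * (linComb y (rowsOf M B) t + κ * M i t) + (κ ⁻¹ * κ) * M i t  ≡⟨ cong₂ (λ u w → - (κ ⁻¹) * u + w * M i t) (trans (sym (split t)) (x≈0 t j<t)) (trans (*-comm _ _) (⁻¹-inverse κ κ≢0)) ⟩
        - (κ ⁻¹) * 0# + 1# * M i t                                               ≡⟨ solve 2 (λ a m → :- a :* :0 :+ :1 :* m := m) refl (κ ⁻¹) (M i t) ⟩
        M i t                                                                  ∎)
    y≡0 : ∀ l → y l ≡ 0#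
    y≡0 = ind y (λ t j<t → begin
      linComb y (rowsOf M B) t                  ≡⟨ solve 2 (λ a m → a := a :+ :0 :* m) refl _ (M i t) ⟩
      linComb y (rowsOf M B) t + 0# * M i t     ≡⟨ cong (λ u → linComb y (rowsOf M B) t + u * M i t) κ≡0 ⟨
      linComb y (rowsOf M B) t + κ * M i t      ≡⟨ split t ⟨
      linComb x (rowsOf M (B ∷ʳ i)) t           ≡⟨ x≈0 t j<t ⟩
      0#                                        ∎)
    x≡0 : ∀ p → x p ≡ 0#
    x≡0 p with ∷ʳ-index-view B i p
    ... | inj₁ (l , refl) = y≡0 l
    ... | inj₂ refl       = κ≡0

  lexFirst-independent : ∀ {k n} {M : Mat k n} {j : Fin n} {B cs L} → IndependentRows j M B → LexFirst M j B cs L →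
                         IndependentRows j M (B ++ L)
  lexFirst-independent {M = M} {j} {B} ind done =
    subst (IndependentRows j M) (sym (Listₚ.++-identityʳ B)) ind
  lexFirst-independent ind (skip _ lf) = lexFirst-independent ind lf
  lexFirst-independent {M = M} {j} {B} ind (take {i = i} {L = L} ¬sp lf) =
    subst (IndependentRows j M) (Listₚ.++-assoc B (i ∷ []) L) (lexFirst-independent (IndependentRows-∷ʳ B i ind ¬sp) lf)

  lexFirst-transfer : ∀ {k n} {M M′ : Mat k n} {j : Fin n} (P : Fin k → Set) →
    (∀ B u → All P B → P u → (SpanAfter j (map M B) (M u) → SpanAfter j (map M′ B) (M′ u))
                           × (SpanAfter j (map M′ B) (M′ u) → SpanAfter j (map M B) (M u))) →
    ∀ {B cs L} → All P B → All P cs → LexFirst M j B cs L → LexFirst M′ j B cs L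
  lexFirst-transfer P span⇔ pB []         done = done
  lexFirst-transfer P span⇔ pB (pu ∷ pcs) (skip sp lf) =
    skip (proj₁ (span⇔ _ _ pB pu) sp) (lexFirst-transfer P span⇔ pB pcs lf)
  lexFirst-transfer P span⇔ pB (pu ∷ pcs) (take ¬sp lf) =
    take (¬sp ∘ proj₂ (span⇔ _ _ pB pu)) (lexFirst-transfer P span⇔ (Allₚ.++⁺ pB (pu ∷ [])) pcs lf)

  lexFirst-cong : ∀ {k n} {M M′ : Mat k n} {j : Fin n} → (∀ i t → M i t ≡ M′ i t) →
                  ∀ {B cs L} → LexFirst M j B cs L → LexFirst M′ j B cs L
  lexFirst-cong {k} {n} {M = M} {M′} {j} M≗M′ =
    lexFirst-transfer (λ _ → ⊤) (λ B u _ _ → transport M≗M′ B u , transport (λ i t → sym (M≗M′ i t)) B u) (all-⊤ _) (all-⊤ _)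
    where
    all-⊤ : ∀ (xs : List (Fin k)) → All (λ _ → ⊤) xs
    all-⊤ xs = All.universal (λ _ → _) xs
    transport : ∀ {N N′ : Mat k n} → (∀ i t → N i t ≡ N′ i t) → ∀ B u → SpanAfter j (map N B) (N u) → SpanAfter j (map N′ B) (N′ u)
    transport {N} {N′} N≗N′ B u sp with SpanAfter⇒SpannedAfter B sp
    ... | γ , Nu≈ = SpannedAfter⇒SpanAfter B (γ , (λ t j<t → trans (sym (N≗N′ u t)) (trans (Nu≈ t j<t) (linComb-cong {K = rowsOf N B} {rowsOf N′ B} t (λ _ → refl) (λ l → N≗N′ (lookup B l) t)))))

  SpannedAfter-coordinates : ∀ {k s n} {M M′ : Mat k n} {j : Fin n} {K K′ : Fin s → Row n} (β : Fin k → Fin s → F) {P : Fin k → Set} →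
    IndependentAfter j K →
    (∀ w → P w → AgreeAfter j (M w) (linComb (β w) K)) →
    (∀ w → P w → AgreeAfter j (M′ w) (linComb (β w) K′)) →
    ∀ B u → All P B → P u → SpannedAfter j (rowsOf M B) (M u) → SpannedAfter j (rowsOf M′ B) (M′ u)
  SpannedAfter-coordinates {k} {s} {n} {M = M} {M′} {j} {K} {K′} β {P} ind M≈ M′≈ B u pB pu (γ , Mu≈) = γ , M′u≈
    where
    γβ : Fin s → F
    γβ y = sumF (λ l → γ l * β (lookup B l) y)
    via : ∀ {N : Mat k n} {K : Fin s → Row n} → (∀ w → P w → AgreeAfter j (N w) (linComb (β w) K)) →
          ∀ t → j Fin.< t → linComb γ (rowsOf N B) t ≡ linComb γβ K t
    via {N} {K} N≈ t j<t = linComb-compose γ (β ∘ lookup B) (rowsOf N B) K t (λ l → N≈ (lookup B l) (All.lookup pB (∈ₚ.∈-lookup l)) t j<t)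
    βu≡γβ : ∀ y → β u y ≡ γβ y
    βu≡γβ = linComb-unique ind (β u) γβ (λ t j<t → trans (sym (M≈ u pu t j<t)) (trans (Mu≈ t j<t) (via M≈ t j<t)))
    M′u≈ : AgreeAfter j (M′ u) (linComb γ (rowsOf M′ B))
    M′u≈ t j<t = begin
      M′ u t                    ≡⟨ M′≈ u pu t j<t ⟩
      linComb (β u) K′ t        ≡⟨ linComb-cong {K = K′} {K′} t βu≡γβ (λ _ → refl) ⟩
      linComb γβ K′ t           ≡⟨ via M′≈ t j<t ⟨
      linComb γ (rowsOf M′ B) t ∎

  lexFirst-coordinates : ∀ {k s n} {M M′ : Mat k n} {j : Fin n} {K K′ : Fin s → Row n} (β : Fin k → Fin s → F) {P : Fin k → Set} →
    IndependentAfter j K → IndependentAfter j K′ →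
    (∀ w → P w → AgreeAfter j (M w) (linComb (β w) K)) →
    (∀ w → P w → AgreeAfter j (M′ w) (linComb (β w) K′)) →
    ∀ {cs L} → All P cs → LexFirst M j [] cs L → LexFirst M′ j [] cs L
  lexFirst-coordinates {M = M} {M′} β {P} ind ind′ M≈ M′≈ =
    lexFirst-transfer P (λ B u pB pu →
        SpannedAfter⇒SpanAfter B ∘ SpannedAfter-coordinates β ind  M≈  M′≈ B u pB pu ∘ SpanAfter⇒SpannedAfter B
      , SpannedAfter⇒SpanAfter B ∘ SpannedAfter-coordinates β ind′ M′≈ M≈  B u pB pu ∘ SpanAfter⇒SpannedAfter B)
      []

  SpanAfter-map : ∀ {k₁ k₂ n} (M : Mat k₁ n) (g : Fin k₂ → Fin k₁) (j : Fin n) B v →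
                  SpanAfter j (map M (map g B)) v ≡ SpanAfter j (map (M ∘ g) B) v
  SpanAfter-map M g j B v = cong (λ X → SpanAfter j X v) (sym (Listₚ.map-∘ B))

  lexFirst-map⁻ : ∀ {k₁ k₂ n} {M : Mat k₁ n} (g : Fin k₂ → Fin k₁) {j : Fin n} {B₁} B cs {L} → B₁ ≡ map g B →
                  LexFirst M j B₁ (map g cs) L → ∃ λ L′ → L ≡ map g L′ × LexFirst (M ∘ g) j B cs L′
  lexFirst-map⁻ g B [] refl done = [] , refl , done
  lexFirst-map⁻ {M = M} g {j} B (i ∷ cs) refl (skip sp lf) with lexFirst-map⁻ g B cs refl lf
  ... | L′ , refl , lf′ = L′ , refl , skip (subst id (SpanAfter-map M g j B (M (g i))) sp) lf′
  lexFirst-map⁻ {M = M} g {j} B (i ∷ cs) refl (take ¬sp lf) with lexFirst-map⁻ g (B ∷ʳ i) cs (sym (Listₚ.map-++ g B (i ∷ []))) lf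
  ... | L′ , refl , lf′ = i ∷ L′ , refl , take (¬sp ∘ subst id (sym (SpanAfter-map M g j B (M (g i))))) lf′

  lexFirst-map⁺ : ∀ {k₁ k₂ n} {M : Mat k₁ n} (g : Fin k₂ → Fin k₁) {j : Fin n} {B₁} B cs {L′} → B₁ ≡ map g B →
                  LexFirst (M ∘ g) j B cs L′ → LexFirst M j B₁ (map g cs) (map g L′)
  lexFirst-map⁺ g B [] refl done = done
  lexFirst-map⁺ {M = M} g {j} B (i ∷ cs) refl (skip sp lf) =
    skip (subst id (sym (SpanAfter-map M g j B (M (g i)))) sp) (lexFirst-map⁺ g B cs refl lf)
  lexFirst-map⁺ {M = M} g {j} B (i ∷ cs) refl (take ¬sp lf) =
    take (¬sp ∘ subst id (SpanAfter-map M g j B (M (g i)))) (lexFirst-map⁺ g (B ∷ʳ i) cs (sym (Listₚ.map-++ g B (i ∷ []))) lf)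

  toℕ-punchIn-< : ∀ {k} (m : Fin (suc k)) (i : Fin k) → toℕ i ℕ.< toℕ m → toℕ (punchIn m i) ≡ toℕ i
  toℕ-punchIn-< (suc m) zero    _         = refl
  toℕ-punchIn-< (suc m) (suc i) (ℕ.s≤s p) = cong suc (toℕ-punchIn-< m i p)

  toℕ-punchIn-≥ : ∀ {k} (m : Fin (suc k)) (i : Fin k) → ¬ toℕ i ℕ.< toℕ m → toℕ (punchIn m i) ≡ suc (toℕ i)
  toℕ-punchIn-≥ zero    i       _ = refl
  toℕ-punchIn-≥ (suc m) zero    i≮m = contradiction (ℕ.s≤s ℕ.z≤n) i≮m
  toℕ-punchIn-≥ (suc m) (suc i) i≮m = cong suc (toℕ-punchIn-≥ m i (i≮m ∘ ℕ.s≤s))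

  toℕ≤toℕ-punchIn : ∀ {k} (m : Fin (suc k)) (i : Fin k) → toℕ i ℕ.≤ toℕ (punchIn m i)
  toℕ≤toℕ-punchIn m i with toℕ i ℕ.<? toℕ m
  ... | yes i<m = ℕₚ.≤-reflexive (sym (toℕ-punchIn-< m i i<m))
  ... | no  i≮m = ℕₚ.≤-trans (ℕₚ.n≤1+n _) (ℕₚ.≤-reflexive (sym (toℕ-punchIn-≥ m i i≮m)))

  punchIn-<-below : ∀ {k} (m : Fin (suc k)) (i : Fin k) → toℕ i ℕ.< toℕ m → punchIn m i Fin.< m
  punchIn-<-below m i i<m = subst (ℕ._< toℕ m) (sym (toℕ-punchIn-< m i i<m)) i<m

  punchIn-<-above : ∀ {k} (m : Fin (suc k)) (i : Fin k) → ¬ toℕ i ℕ.< toℕ m → m Fin.< punchIn m i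
  punchIn-<-above m i i≮m = subst (toℕ m ℕ.<_) (sym (toℕ-punchIn-≥ m i i≮m)) (ℕ.s≤s (ℕₚ.≮⇒≥ i≮m))

  punchIn-mono-< : ∀ {k} (m : Fin (suc k)) {i i′ : Fin k} → i Fin.< i′ → punchIn m i Fin.< punchIn m i′
  punchIn-mono-< m {i} {i′} i<i′ = Finₚ.≤∧≢⇒< (Finₚ.punchIn-mono-≤ m i i′ (ℕₚ.<⇒≤ i<i′))
                                              (λ eq → ℕₚ.<-irrefl (cong toℕ (Finₚ.punchIn-injective m i i′ eq)) i<i′)

  punchIn-view : ∀ {k} (m u : Fin (suc k)) → u ≡ m ⊎ ∃ λ i → u ≡ punchIn m i
  punchIn-view m u with m Finₚ.≟ u
  ... | yes m≡u = inj₁ (sym m≡u)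
  ... | no  m≢u = inj₂ (Fin.punchOut m≢u , sym (Finₚ.punchIn-punchOut m≢u))

  below-punchIn : ∀ {k} (m : Fin (suc k)) → below (suc k) (toℕ m) ≡ map (punchIn m) (below k (toℕ m))
  below-punchIn {k} m = begin
    filter <m? (allFin (suc k))                                   ≡⟨ cong (filter <m?) (allFin-∷ʳ k) ⟩
    filter <m? (map Fin.inject₁ (allFin k) ∷ʳ Fin.fromℕ k)         ≡⟨ Listₚ.filter-++ <m? (map Fin.inject₁ (allFin k)) _ ⟩
    filter <m? (map Fin.inject₁ (allFin k)) ++ filter <m? (Fin.fromℕ k ∷ [])
                                                                  ≡⟨ cong (filter <m? (map Fin.inject₁ (allFin k)) ++_) (Listₚ.filter-reject <m? last≮m) ⟩
    filter <m? (map Fin.inject₁ (allFin k)) ++ []                 ≡⟨ Listₚ.++-identityʳ _ ⟩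
    filter <m? (map Fin.inject₁ (allFin k))                       ≡⟨ filter-map-toℕ Fin.inject₁ Finₚ.toℕ-inject₁ (allFin k) ⟩
    map Fin.inject₁ (below k (toℕ m))                             ≡⟨ Listₚ.map-cong-local (All.map (λ {i} → inject₁≡punchIn i) (Allₚ.all-filter _ (allFin k))) ⟩
    map (punchIn m) (below k (toℕ m))                             ∎
    where
    <m? : (i : Fin (suc k)) → Dec (toℕ i ℕ.< toℕ m)
    <m? i = toℕ i ℕ.<? toℕ m
    tabulate-∷ʳ : ∀ {A : Set} k (f : Fin (suc k) → A) → List.tabulate f ≡ List.tabulate (f ∘ Fin.inject₁) ∷ʳ f (Fin.fromℕ k)
    tabulate-∷ʳ zero    f = refl
    tabulate-∷ʳ (suc k) f = cong (f zero ∷_) (tabulate-∷ʳ k (f ∘ suc))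
    allFin-∷ʳ : ∀ k → allFin (suc k) ≡ map Fin.inject₁ (allFin k) ∷ʳ Fin.fromℕ k
    allFin-∷ʳ k = trans (tabulate-∷ʳ k id) (cong (_∷ʳ Fin.fromℕ k) (sym (Listₚ.map-tabulate id Fin.inject₁)))
    last≮m : ¬ toℕ (Fin.fromℕ k) ℕ.< toℕ m
    last≮m = ℕₚ.≤⇒≯ (subst (toℕ m ℕ.≤_) (sym (Finₚ.toℕ-fromℕ k)) (ℕₚ.≤-pred (Finₚ.toℕ<n m)))
    filter-map-toℕ : ∀ {a} (f : Fin a → Fin (suc k)) → (∀ i → toℕ (f i) ≡ toℕ i) → ∀ xs →
                     filter <m? (map f xs) ≡ map f (filter (λ i → toℕ i ℕ.<? toℕ m) xs)
    filter-map-toℕ f toℕ-f [] = refl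
    filter-map-toℕ f toℕ-f (x ∷ xs) with toℕ x ℕ.<? toℕ m
    ... | yes x<m = trans (Listₚ.filter-accept <m? (subst (ℕ._< toℕ m) (sym (toℕ-f x)) x<m))
                          (trans (cong (f x ∷_) (filter-map-toℕ f toℕ-f xs)) (cong (map f) (sym (Listₚ.filter-accept (λ i → toℕ i ℕ.<? toℕ m) x<m))))
    ... | no  x≮m = trans (Listₚ.filter-reject <m? (x≮m ∘ subst (ℕ._< toℕ m) (toℕ-f x)))
                          (trans (filter-map-toℕ f toℕ-f xs) (cong (map f) (sym (Listₚ.filter-reject (λ i → toℕ i ℕ.<? toℕ m) x≮m))))
    inject₁≡punchIn : ∀ i → toℕ i ℕ.< toℕ m → Fin.inject₁ i ≡ punchIn m i
    inject₁≡punchIn i i<m = Finₚ.toℕ-injective (trans (Finₚ.toℕ-inject₁ i) (sym (toℕ-punchIn-< m i i<m)))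

  module Basis {k n} (M : Mat k n) (m : ℕ) (j : Fin n) (L : List (Fin k)) (basis : LexFirstBasis M m j L) where

    Above : Fin k → Set
    Above u = toℕ u ℕ.< m

    all-below : All Above (below k m)
    all-below = Allₚ.all-filter (λ i → toℕ i ℕ.<? m) (allFin k)

    basis-above : ∀ l → Above (lookup L l)
    basis-above l = All.lookup (lexFirst-All all-below basis) (∈ₚ.∈-lookup l)

    K : Fin (length L) → Row n
    K = rowsOf M L

    independent : IndependentAfter j K
    independent = lexFirst-independent {B = []} (λ _ _ ()) basis

    spans : ∀ u → Above u → SpannedAfter j K (M u)
    spans u u<m = lexFirst-spans basis (∈ₚ.∈-filter⁺ (λ i → toℕ i ℕ.<? m) (∈ₚ.∈-allFin u) u<m)

  -- The bijections μ and φ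

  μ-0 : ∀ d → μ d 0# ≡ 1#
  μ-0 d with 0# ≟F 0#
  ... | yes _   = refl
  ... | no 0≢0 = contradiction refl 0≢0

  μ-≢0 : ∀ d {x} → x ≢ 0# → μ d x ≡ 1# + d * x ⁻¹
  μ-≢0 d {x} x≢0 with x ≟F 0#
  ... | yes x≡0 = contradiction x≡0 x≢0
  ... | no  _   = refl

  ν : F → F → F
  ν d z with z ≟F 1#
  ... | yes _ = 0#
  ... | no  _ = d * (z + - 1#) ⁻¹

  ν-1 : ∀ d → ν d 1# ≡ 0#
  ν-1 d with 1# ≟F 1#
  ... | yes _   = refl
  ... | no 1≢1 = contradiction refl 1≢1

  ν-≢1 : ∀ d {z} → z ≢ 1# → ν d z ≡ d * (z + - 1#) ⁻¹
  ν-≢1 d {z} z≢1 with z ≟F 1#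
  ... | yes z≡1 = contradiction z≡1 z≢1
  ... | no  _   = refl

  [1+x]-1 : ∀ x → (1# + x) + - 1# ≡ x
  [1+x]-1 = solve 1 (λ x → (:1 :+ x) :- :1 := x) refl

  d*[x*d⁻¹] : ∀ {d} x → d ≢ 0# → d * (x * d ⁻¹) ≡ x
  d*[x*d⁻¹] {d} x d≢0 = begin
    d * (x * d ⁻¹)    ≡⟨ solve 3 (λ d x d⁻¹ → d :* (x :* d⁻¹) := x :* (d :* d⁻¹)) refl d x (d ⁻¹) ⟩
    x * (d * d ⁻¹)    ≡⟨ cong (x *_) (⁻¹-inverse d d≢0) ⟩
    x * 1#            ≡⟨ *-identityʳ x ⟩
    x                 ∎

  ν∘μ : ∀ {d} → d ≢ 0# → ∀ x → ν d (μ d x) ≡ x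
  ν∘μ {d} d≢0 x with x ≟F 0#
  ... | yes refl = ν-1 d
  ... | no  x≢0 = begin
    ν d (1# + d * x ⁻¹)            ≡⟨ ν-≢1 d μ≢1 ⟩
    d * ((1# + d * x ⁻¹) + - 1#) ⁻¹ ≡⟨ cong (λ w → d * w ⁻¹) ([1+x]-1 (d * x ⁻¹)) ⟩
    d * (d * x ⁻¹) ⁻¹              ≡⟨ cong (d *_) ([x*y⁻¹]⁻¹ d≢0 x≢0) ⟩
    d * (x * d ⁻¹)                 ≡⟨ d*[x*d⁻¹] x d≢0 ⟩
    x                              ∎
    where
    μ≢1 : 1# + d * x ⁻¹ ≢ 1#
    μ≢1 μ≡1 = *-≢0 d≢0 (⁻¹-≢0 x≢0) (trans (sym ([1+x]-1 _)) (trans (cong (_+ - 1#) μ≡1) (-‿inverseʳ 1#)))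

  μ∘ν : ∀ {d} → d ≢ 0# → ∀ z → μ d (ν d z) ≡ z
  μ∘ν {d} d≢0 z with z ≟F 1#
  ... | yes refl = μ-0 d
  ... | no  z≢1 = begin
    μ d (d * w ⁻¹)                  ≡⟨ μ-≢0 d (*-≢0 d≢0 (⁻¹-≢0 w≢0)) ⟩
    1# + d * (d * w ⁻¹) ⁻¹          ≡⟨ cong (λ u → 1# + d * u) ([x*y⁻¹]⁻¹ d≢0 w≢0) ⟩
    1# + d * (w * d ⁻¹)             ≡⟨ cong (1# +_) (d*[x*d⁻¹] w d≢0) ⟩
    1# + (z + - 1#)                 ≡⟨ solve 1 (λ z → :1 :+ (z :- :1) := z) refl z ⟩
    z                               ∎
    where
    w : F
    w = z + - 1#
    w≢0 : w ≢ 0#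
    w≢0 = z≢1 ∘ x-y≡0⇒x≡y

  dot-∷ʳ : ∀ {s} (xs ys : Vec F s) x y → dot (xs Vec.∷ʳ x) (ys Vec.∷ʳ y) ≡ dot xs ys + x * y
  dot-∷ʳ []       []       x y = +-comm _ _
  dot-∷ʳ (a ∷ xs) (b ∷ ys) x y = trans (cong (a * b +_) (dot-∷ʳ xs ys x y)) (sym (+-assoc _ _ _))

  dot≡sumF : ∀ {s} (xs ys : Vec F s) → dot xs ys ≡ sumF (λ i → Vec.lookup xs i * Vec.lookup ys i)
  dot≡sumF []       []       = refl
  dot≡sumF (a ∷ xs) (b ∷ ys) = cong (a * b +_) (dot≡sumF xs ys)

  φ-α : ∀ {s} → Vec F s → F
  φ-α {s} b = - (1# + dot b (φ s b))

  φ-∷ʳ : ∀ s (b : Vec F s) x → φ (suc s) (b Vec.∷ʳ x) ≡ φ s b Vec.∷ʳ μ (φ-α b) x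
  φ-∷ʳ s b x rewrite Vecₚ.init-∷ʳ x b | Vecₚ.last-∷ʳ x b = refl

  1+dot-φ-∷ʳ≢0 : ∀ {s} (b : Vec F s) x → 1# + dot b (φ s b) ≢ 0# → 1# + dot (b Vec.∷ʳ x) (φ s b Vec.∷ʳ μ (φ-α b) x) ≢ 0#
  1+dot-φ-∷ʳ≢0 {s} b x 1+D≢0 with x ≟F 0#
  ... | yes refl = λ ≡0 → 1+D≢0 (begin
    1# + D                                  ≡⟨ cong (1# +_) (+-identityʳ D) ⟨
    1# + (D + 0#)                           ≡⟨ cong (λ u → 1# + (D + u)) (zeroˡ 1#) ⟨
    1# + (D + 0# * 1#)                      ≡⟨ cong (1# +_) (dot-∷ʳ b (φ s b) 0# 1#) ⟨
    1# + dot (b Vec.∷ʳ 0#) (φ s b Vec.∷ʳ 1#)        ≡⟨ ≡0 ⟩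
    0#                                      ∎)
    where
    D : F
    D = dot b (φ s b)
  ... | no  x≢0 = λ ≡0 → x≢0 (begin
    x                                             ≡⟨ solve 2 (λ x D → x := x :+ (:1 :+ D) :* (:1 :- :1)) refl x D ⟩
    x + (1# + D) * (1# + - 1#)                    ≡⟨ cong (λ u → x + (1# + D) * (1# + - u)) (⁻¹-inverse x x≢0) ⟨
    x + (1# + D) * (1# + - (x * x ⁻¹))            ≡⟨ solve 3 (λ D x x⁻¹ → x :+ (:1 :+ D) :* (:1 :- x :* x⁻¹) := :1 :+ (D :+ x :* (:1 :+ :- (:1 :+ D) :* x⁻¹))) refl D x (x ⁻¹) ⟩
    1# + (D + x * (1# + - (1# + D) * x ⁻¹))       ≡⟨ cong (1# +_) (dot-∷ʳ b (φ s b) x _) ⟨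
    1# + dot (b Vec.∷ʳ x) (φ s b Vec.∷ʳ (1# + - (1# + D) * x ⁻¹)) ≡⟨ ≡0 ⟩
    0#                                            ∎)
    where
    D : F
    D = dot b (φ s b)

  1+dot-φ≢0 : ∀ s (b : Vec F s) → 1# + dot b (φ s b) ≢ 0#
  1+dot-φ≢0 zero    [] 1+0≡0 = 0≢1 (sym (trans (sym (+-identityʳ 1#)) 1+0≡0))
  1+dot-φ≢0 (suc s) bx with Vec.initLast bx
  ... | b , x , refl = 1+dot-φ-∷ʳ≢0 b x (1+dot-φ≢0 s b)

  φ-α≢0 : ∀ {s} (b : Vec F s) → φ-α b ≢ 0#
  φ-α≢0 {s} b α≡0 = 1+dot-φ≢0 s b (trans (sym (-‿involutive _)) (trans (cong -_ α≡0) -0#≈0#))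

  φ-injective : ∀ s {b b′ : Vec F s} → φ s b ≡ φ s b′ → b ≡ b′
  φ-injective zero    {[]} {[]} _ = refl
  φ-injective (suc s) {bx} {bx′} eq with Vec.initLast bx | Vec.initLast bx′
  ... | b , x , refl | b′ , x′ , refl
    with Vecₚ.∷ʳ-injective (φ s b) (φ s b′) eq
  ... | φb≡φb′ , μx≡μx′ with φ-injective s φb≡φb′
  ... | refl = cong (b Vec.∷ʳ_) (trans (sym (ν∘μ (φ-α≢0 b) x)) (trans (cong (ν (φ-α b)) μx≡μx′) (ν∘μ (φ-α≢0 b) x′)))

  φ-surjective : ∀ s (c : Vec F s) → ∃ λ b → φ s b ≡ c
  φ-surjective zero    [] = [] , refl
  φ-surjective (suc s) cz with Vec.initLast cz
  ... | c , z , refl with φ-surjective s c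
  ... | b , refl = b Vec.∷ʳ ν (φ-α b) z , trans (φ-∷ʳ s b _) (cong (φ s b Vec.∷ʳ_) (μ∘ν (φ-α≢0 b) z))

  -- Γ(b, c) = I + bᵀc

  Vec-ext : ∀ {s} {u v : Vec F s} → (∀ i → Vec.lookup u i ≡ Vec.lookup v i) → u ≡ v
  Vec-ext {u = u} {v} u≗v = trans (sym (Vecₚ.tabulate∘lookup u)) (trans (Vecₚ.tabulate-cong u≗v) (Vecₚ.tabulate∘lookup v))

  Γ-apply : ∀ {s} (b c : Vec F s) (f : Fin s → F) y →
            sumF (λ x → f x * Γ b c x y) ≡ f y + sumF (λ x → f x * Vec.lookup b x) * Vec.lookup c y
  Γ-apply b c f y = begin
    sumF (λ x → f x * (δ x y + Vec.lookup b x * Vec.lookup c y))                         ≡⟨ sumF-cong (λ x → distribˡ (f x) _ _) ⟩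
    sumF (λ x → f x * δ x y + f x * (Vec.lookup b x * Vec.lookup c y))                   ≡⟨ sumF-+ (λ x → f x * δ x y) (λ x → f x * (Vec.lookup b x * Vec.lookup c y)) ⟩
    sumF (λ x → f x * δ x y) + sumF (λ x → f x * (Vec.lookup b x * Vec.lookup c y))      ≡⟨ cong₂ _+_ (trans (sumF-cong (λ x → *-comm (f x) (δ x y))) (sumF-δˡ y f))
                                                                                          (trans (sumF-cong (λ x → sym (*-assoc (f x) _ _))) (sym (sumF-*ʳ (Vec.lookup c y) (λ x → f x * Vec.lookup b x)))) ⟩
    f y + sumF (λ x → f x * Vec.lookup b x) * Vec.lookup c y                             ∎

  -- x (I + bᵀv) = 0 forces x = 0 when 1 + v · b ≠ 0: pairing with b gives (x·b)(1 + v·b) = 0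
  I+bᵀv-injective : ∀ {s} (b v x : Fin s → F) → 1# + sumF (λ z → v z * b z) ≢ 0# →
                    (∀ y → x y + sumF (λ z → x z * b z) * v y ≡ 0#) → ∀ y → x y ≡ 0#
  I+bᵀv-injective b v x 1+v·b≢0 x[I+bᵀv]≡0 y = begin
    x y                   ≡⟨ solve 3 (λ x E v → x := (x :+ E :* v) :- E :* v) refl (x y) E (v y) ⟩
    (x y + E * v y) + - (E * v y)   ≡⟨ cong₂ (λ u w → u + - (w * v y)) (x[I+bᵀv]≡0 y) E≡0 ⟩
    0# + - (0# * v y)     ≡⟨ solve 1 (λ v → :0 :+ :- (:0 :* v) := :0) refl (v y) ⟩
    0#                    ∎
    where
    E : F
    E = sumF (λ z → x z * b z)
    E*[1+v·b]≡0 : E * (1# + sumF (λ z → v z * b z)) ≡ 0#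
    E*[1+v·b]≡0 = begin
      E * (1# + sumF (λ z → v z * b z))              ≡⟨ trans (distribˡ E _ _) (cong₂ _+_ (*-identityʳ E) (sumF-*ˡ E (λ z → v z * b z))) ⟩
      E + sumF (λ z → E * (v z * b z))               ≡⟨ sumF-+ (λ z → x z * b z) (λ z → E * (v z * b z)) ⟨
      sumF (λ z → x z * b z + E * (v z * b z))       ≡⟨ sumF-cong (λ z → solve 4 (λ x b E v → x :* b :+ E :* (v :* b) := (x :+ E :* v) :* b) refl (x z) (b z) E (v z)) ⟩
      sumF (λ z → (x z + E * v z) * b z)             ≡⟨ sumF-zero (λ z → trans (cong (_* b z) (x[I+bᵀv]≡0 z)) (zeroˡ (b z))) ⟩
      0#                                             ∎
    E≡0 : E ≡ 0#
    E≡0 with x*y≡0⇒x≡0⊎y≡0 E _ E*[1+v·b]≡0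
    ... | inj₁ E≡0  = E≡0
    ... | inj₂ ≡0   = contradiction ≡0 1+v·b≢0

  Γ-solution : ∀ {s} (b c : Vec F s) → Vec F s
  Γ-solution b c = Vec.tabulate (λ x → Vec.lookup c x * (1# + dot b c) ⁻¹)

  Γ-solution-solves : ∀ {s} (b c : Vec F s) → 1# + dot b c ≢ 0# →
                      ∀ y → sumF (λ x → Vec.lookup (Γ-solution b c) x * Γ b c x y) ≡ Vec.lookup c y
  Γ-solution-solves {s} b c 1+D≢0 y = begin
    sumF (λ x → e x * Γ b c x y)                         ≡⟨ Γ-apply b c e y ⟩
    e y + sumF (λ x → e x * Vec.lookup b x) * Vec.lookup c y     ≡⟨ cong₂ (λ u v → u + v * Vec.lookup c y) (Vecₚ.lookup∘tabulate _ y) e·b ⟩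
    Vec.lookup c y * w + (D * w) * Vec.lookup c y                ≡⟨ solve 3 (λ c w D → c :* w :+ (D :* w) :* c := c :* ((:1 :+ D) :* w)) refl (Vec.lookup c y) w D ⟩
    Vec.lookup c y * ((1# + D) * w)                          ≡⟨ cong (Vec.lookup c y *_) (⁻¹-inverse _ 1+D≢0) ⟩
    Vec.lookup c y * 1#                                      ≡⟨ *-identityʳ _ ⟩
    Vec.lookup c y                                           ∎
    where
    e : Fin s → F
    e = Vec.lookup (Γ-solution b c)
    D w : F
    D = dot b c
    w = (1# + D) ⁻¹
    e·b : sumF (λ x → e x * Vec.lookup b x) ≡ D * w
    e·b = begin
      sumF (λ x → e x * Vec.lookup b x)                      ≡⟨ sumF-cong (λ x → trans (cong (_* Vec.lookup b x) (Vecₚ.lookup∘tabulate _ x)) (solve 3 (λ c w b → c :* w :* b := b :* c :* w) refl (Vec.lookup c x) w (Vec.lookup b x))) ⟩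
      sumF (λ x → Vec.lookup b x * Vec.lookup c x * w)           ≡⟨ sumF-*ʳ w (λ x → Vec.lookup b x * Vec.lookup c x) ⟨
      sumF (λ x → Vec.lookup b x * Vec.lookup c x) * w           ≡⟨ cong (_* w) (dot≡sumF b c) ⟨
      D * w                                              ∎

  Γ-solution-unique : ∀ {s} (b c e : Vec F s) → 1# + dot b c ≢ 0# →
                      (∀ y → sumF (λ x → Vec.lookup e x * Γ b c x y) ≡ Vec.lookup c y) → e ≡ Γ-solution b c
  Γ-solution-unique {s} b c e 1+D≢0 eΓ≡c = Vec-ext (λ y → x-y≡0⇒x≡y (I+bᵀv-injective (Vec.lookup b) (Vec.lookup c) x 1+c·b≢0 x[I+bᵀc]≡0 y))
    where
    σ : Fin s → F
    σ = Vec.lookup (Γ-solution b c)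
    x : Fin s → F
    x y = Vec.lookup e y + - σ y
    1+c·b≢0 : 1# + sumF (λ z → Vec.lookup c z * Vec.lookup b z) ≢ 0#
    1+c·b≢0 = subst (λ u → 1# + u ≢ 0#) (trans (dot≡sumF b c) (sumF-cong (λ z → *-comm (Vec.lookup b z) _))) 1+D≢0
    x[I+bᵀc]≡0 : ∀ y → x y + sumF (λ z → x z * Vec.lookup b z) * Vec.lookup c y ≡ 0#
    x[I+bᵀc]≡0 y = begin
      x y + sumF (λ z → x z * Vec.lookup b z) * Vec.lookup c y                   ≡⟨ Γ-apply b c x y ⟨
      sumF (λ z → x z * Γ b c z y)                                       ≡⟨ sumF-cong (λ z → solve 3 (λ e σ g → (e :- σ) :* g := e :* g :+ :- (σ :* g)) refl (Vec.lookup e z) (σ z) (Γ b c z y)) ⟩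
      sumF (λ z → Vec.lookup e z * Γ b c z y + - (σ z * Γ b c z y))          ≡⟨ sumF-+ (λ z → Vec.lookup e z * Γ b c z y) (λ z → - (σ z * Γ b c z y)) ⟩
      sumF (λ z → Vec.lookup e z * Γ b c z y) + sumF (λ z → - (σ z * Γ b c z y))
                                                                         ≡⟨ cong₂ _+_ (eΓ≡c y) (sym (sumF-neg (λ z → σ z * Γ b c z y))) ⟩
      Vec.lookup c y + - sumF (λ z → σ z * Γ b c z y)                        ≡⟨ cong (λ u → Vec.lookup c y + - u) (Γ-solution-solves b c 1+D≢0 y) ⟩
      Vec.lookup c y + - Vec.lookup c y                                          ≡⟨ -‿inverseʳ _ ⟩
      0#                                                                 ∎

  -- Reduced row echelon form

  Lead-unique : ∀ {k n} {M : Mat k n} {i t t′} → Lead M i t → Lead M i t′ → t ≡ t′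
  Lead-unique {t = t} {t′} (Mit≡1 , before-t) (Mit′≡1 , before-t′) with Finₚ.<-cmp t t′
  ... | tri< t<t′ _ _ = contradiction (trans (sym (before-t′ t t<t′)) Mit≡1) 0≢1
  ... | tri≈ _ t≡t′ _ = t≡t′
  ... | tri> _ _ t′<t = contradiction (trans (sym (before-t t′ t′<t)) Mit′≡1) 0≢1

  module Pivots {k n} {M : Mat k n} (rref : IsRREF M) where
    p : Fin k → Fin n
    p = proj₁ rref

    leads : ∀ i → Lead M i (p i)
    leads = proj₁ (proj₂ rref)

    p-mono : ∀ {i i′} → i Fin.< i′ → p i Fin.< p i′
    p-mono = proj₁ (proj₂ (proj₂ rref)) _ _

    pivot-column : ∀ {i i′} → i ≢ i′ → M i′ (p i) ≡ 0#
    pivot-column = proj₂ (proj₂ (proj₂ rref)) _ _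

    Lead⇒≡p : ∀ {i t} → Lead M i t → t ≡ p i
    Lead⇒≡p {i} lead = Lead-unique {M = M} lead (leads i)

    Lead-row-unique : ∀ {i i′ t} → Lead M i t → Lead M i′ t → i ≡ i′
    Lead-row-unique {i} {i′} lead lead′ with i Finₚ.≟ i′
    ... | yes i≡i′ = i≡i′
    ... | no  i≢i′ = contradiction (trans (sym (pivot-column i≢i′)) (trans (cong (M i′) (sym (Lead⇒≡p lead))) (proj₁ lead′))) 0≢1

    p-reflects-< : ∀ {i i′} → p i Fin.< p i′ → i Fin.< i′
    p-reflects-< {i} {i′} pi<pi′ with Finₚ.<-cmp i i′
    ... | tri< i<i′ _ _ = i<i′
    ... | tri≈ _ refl _ = contradiction pi<pi′ (ℕₚ.<-irrefl refl)
    ... | tri> _ _ i′<i = contradiction (p-mono i′<i) (ℕₚ.<-asym pi<pi′)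

    Lead-column : ∀ {m j i} → Lead M m j → i ≢ m → M i j ≡ 0#
    Lead-column {m} {j} {i} lead i≢m = trans (cong (M i) (Lead⇒≡p lead)) (pivot-column (i≢m ∘ sym))

  _≈[_]_ : ∀ {s₁ s₂} → Vec F s₁ → s₁ ≡ s₂ → Vec F s₂ → Set
  w ≈[ eq ] v = ∀ x → Vec.lookup w x ≡ Vec.lookup v (Fin.cast eq x)

  ≈[refl]⇒≡ : ∀ {s} {w v : Vec F s} → w ≈[ refl ] v → w ≡ v
  ≈[refl]⇒≡ {v = v} w≈v = Vec-ext (λ x → trans (w≈v x) (cong (Vec.lookup v) (Finₚ.cast-is-id refl x)))

  ≡⇒≈[refl] : ∀ {s} {w v : Vec F s} → w ≡ v → w ≈[ refl ] v
  ≡⇒≈[refl] {v = v} refl x = cong (Vec.lookup v) (sym (Finₚ.cast-is-id refl x))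

  φ-cast : ∀ {s₁ s₂} (eq : s₁ ≡ s₂) {w v} → w ≈[ eq ] v → φ s₁ w ≈[ eq ] φ s₂ v
  φ-cast refl {w} {v} w≈v = ≡⇒≈[refl] (cong (φ _) (≈[refl]⇒≡ {w = w} {v} w≈v))

  Γ-solution-cast : ∀ {s₁ s₂} (eq : s₁ ≡ s₂) {w w′ v v′} → w ≈[ eq ] v → w′ ≈[ eq ] v′ → Γ-solution w w′ ≈[ eq ] Γ-solution v v′
  Γ-solution-cast refl {w} {w′} {v} {v′} w≈v w′≈v′ = ≡⇒≈[refl] (cong₂ Γ-solution (≈[refl]⇒≡ {w = w} {v} w≈v) (≈[refl]⇒≡ {w = w′} {v′} w′≈v′))

  sumF-cast : ∀ {s₁ s₂} (eq : s₁ ≡ s₂) (f : Fin s₂ → F) → sumF f ≡ sumF (f ∘ Fin.cast eq)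
  sumF-cast refl f = sumF-cong (λ x → cong f (sym (Finₚ.cast-is-id refl x)))

  lookup-≡map : ∀ {X Y : Set} (g : X → Y) {ys : List Y} (xs : List X) → ys ≡ List.map g xs →
                Σ (length xs ≡ length ys) λ eq → ∀ x → List.lookup ys (Fin.cast eq x) ≡ g (List.lookup xs x)
  lookup-≡map g []       refl = refl , λ ()
  lookup-≡map g (a ∷ xs) refl with lookup-≡map g xs refl
  ... | eq , lookup≡ = cong suc eq , λ { zero → refl ; (suc x) → lookup≡ x }

  -- Single deletions

  rowsAbove : ∀ {k n} → Mat k n → ℕ → Fin k → Row n
  rowsAbove M m i t with toℕ i ℕ.<? m
  ... | yes _ = M i t
  ... | no  _ = 0#

  rowsAbove-< : ∀ {k n} (M : Mat k n) {m i} t → toℕ i ℕ.< m → rowsAbove M m i t ≡ M i t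
  rowsAbove-< M {m} {i} t i<m with toℕ i ℕ.<? m
  ... | yes _   = refl
  ... | no  i≮m = contradiction i<m i≮m

  rowsAbove-≮ : ∀ {k n} (M : Mat k n) {m i} t → ¬ toℕ i ℕ.< m → rowsAbove M m i t ≡ 0#
  rowsAbove-≮ M {m} {i} t i≮m with toℕ i ℕ.<? m
  ... | yes i<m = contradiction i<m i≮m
  ... | no  _   = refl

  SpannedAfter-rowsAbove : ∀ {k n} {j : Fin n} (M : Mat k n) {m} u → toℕ u ℕ.< m → SpannedAfter j (rowsAbove M m) (M u)
  SpannedAfter-rowsAbove M {m} u u<m = SpannedAfter-resp (λ t _ → rowsAbove-< M t u<m) (SpannedAfter-member (rowsAbove M m) u)

  RowInSpan⇒SpannedAfter : ∀ {k n} {M : Mat k n} {m : Fin k} {j : Fin n} → RowInSpan M m j → SpannedAfter j (rowsAbove M (toℕ m)) (M m)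
  RowInSpan⇒SpannedAfter {M = M} {m} (c , c≡0 , Mm≈) = c , (λ t j<t → trans (Mm≈ t j<t) (sumF-cong (λ i → same i t)))
    where
    same : ∀ i t → c i * M i t ≡ c i * rowsAbove M (toℕ m) i t
    same i t with toℕ i ℕ.<? toℕ m
    ... | yes _   = refl
    ... | no  i≮m = trans (cong (_* M i t) (c≡0 i (ℕₚ.≮⇒≥ i≮m))) (trans (zeroˡ _) (sym (zeroʳ _)))

  SpannedAfter⇒RowInSpan : ∀ {k n} {M : Mat k n} {m : Fin k} {j : Fin n} → SpannedAfter j (rowsAbove M (toℕ m)) (M m) → RowInSpan M m j
  SpannedAfter⇒RowInSpan {k} {M = M} {m} (γ , Mm≈) = c , c≡0 , (λ t j<t → trans (Mm≈ t j<t) (sumF-cong (λ i → same i t)))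
    where
    c : Fin k → F
    c i with toℕ i ℕ.<? toℕ m
    ... | yes _ = γ i
    ... | no  _ = 0#
    c≡0 : ∀ i → m Fin.≤ i → c i ≡ 0#
    c≡0 i m≤i with toℕ i ℕ.<? toℕ m
    ... | yes i<m = contradiction m≤i (ℕₚ.<⇒≱ i<m)
    ... | no  _   = refl
    same : ∀ i t → γ i * rowsAbove M (toℕ m) i t ≡ c i * M i t
    same i t with toℕ i ℕ.<? toℕ m
    ... | yes _ = refl
    ... | no  _ = trans (zeroʳ _) (sym (zeroˡ _))

  module DeletionStep {k n} {A : Mat (suc k) n} {j : Fin n} {A′ : Mat k n} (D : DelStep A j A′) where
    open DelStep D
    open Pivots rref
    open Basis A (toℕ m) j L basis public

    s : ℕ
    s = length L

    A″ : Mat (suc k) n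
    A″ u t = A u t + d u * A m t

    punchIn≢m : ∀ i → punchIn m i ≢ m
    punchIn≢m = Finₚ.punchInᵢ≢i m

    coordinates : ∀ u → Above u → Σ (Fin s → F) λ α → AgreeAfter j (A u) (linComb α K) × d u ≡ sumF (λ l → α l * Vec.lookup b l)
    coordinates u u<m with Finₚ.any? (λ l → lookup L l Finₚ.≟ u)
    ... | yes (q , refl) = (λ l → δ l q) , proj₂ (SpannedAfter-member K q) , trans (d-basis q) (sym (sumF-δˡ q (Vec.lookup b)))
    ... | no  u∉L        = d-other u u<m (λ l eq → u∉L (l , eq))

    β : Fin (suc k) → Fin s → F
    β u with toℕ u ℕ.<? toℕ m
    ... | yes u<m = proj₁ (coordinates u u<m)
    ... | no  _   = λ _ → 0#

    A≈βK : ∀ u → Above u → AgreeAfter j (A u) (linComb (β u) K)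
    A≈βK u u<m with toℕ u ℕ.<? toℕ m
    ... | yes u<m′ = proj₁ (proj₂ (coordinates u u<m′))
    ... | no  u≮m  = contradiction u<m u≮m

    d≡βb : ∀ u → Above u → d u ≡ sumF (λ l → β u l * Vec.lookup b l)
    d≡βb u u<m with toℕ u ℕ.<? toℕ m
    ... | yes u<m′ = proj₂ (proj₂ (coordinates u u<m′))
    ... | no  u≮m  = contradiction u<m u≮m

    K″ : Fin s → Row n
    K″ = rowsOf A″ L

    A″≈βK″ : ∀ u → Above u → AgreeAfter j (A″ u) (linComb (β u) K″)
    A″≈βK″ u u<m t j<t = begin
      A u t + d u * A m t                                             ≡⟨ cong₂ (λ x y → x + y * A m t) (A≈βK u u<m t j<t) (d≡βb u u<m) ⟩
      linComb (β u) K t + sumF (λ l → β u l * Vec.lookup b l) * A m t ≡⟨ cong (linComb (β u) K t +_) (sumF-*ʳ (A m t) (λ l → β u l * Vec.lookup b l)) ⟩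
      linComb (β u) K t + sumF (λ l → β u l * Vec.lookup b l * A m t) ≡⟨ sumF-+ (λ l → β u l * K l t) (λ l → β u l * Vec.lookup b l * A m t) ⟨
      sumF (λ l → β u l * K l t + β u l * Vec.lookup b l * A m t)     ≡⟨ sumF-cong (λ l → solve 4 (λ x k b a → x :* k :+ x :* b :* a := x :* (k :+ b :* a)) refl (β u l) (K l t) (Vec.lookup b l) (A m t)) ⟩
      sumF (λ l → β u l * (K l t + Vec.lookup b l * A m t))           ≡⟨ sumF-cong (λ l → cong (λ z → β u l * (K l t + z * A m t)) (sym (d-basis l))) ⟩
      linComb (β u) K″ t                                              ∎

    1+b·c≢0 : 1# + dot b c ≢ 0#
    1+b·c≢0 = subst (λ z → 1# + dot b z ≢ 0#) b-eq (1+dot-φ≢0 s b)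

    K″≈ΓK : ∀ l → AgreeAfter j (K″ l) (linComb (λ x → Γ b c l x) K)
    K″≈ΓK l t j<t = begin
      K l t + d (lookup L l) * A m t                                             ≡⟨ cong₂ (λ z w → K l t + z * w) (d-basis l) (c-eq t j<t) ⟩
      K l t + Vec.lookup b l * sumF (λ x → Vec.lookup c x * K x t)               ≡⟨ cong (K l t +_) (sumF-*ˡ (Vec.lookup b l) (λ x → Vec.lookup c x * K x t)) ⟩
      K l t + sumF (λ x → Vec.lookup b l * (Vec.lookup c x * K x t))             ≡⟨ cong (_+ sumF (λ x → Vec.lookup b l * (Vec.lookup c x * K x t))) (sumF-δʳ l (λ x → K x t)) ⟨
      sumF (λ x → K x t * δ l x) + sumF (λ x → Vec.lookup b l * (Vec.lookup c x * K x t))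
                                                                                 ≡⟨ sumF-+ (λ x → K x t * δ l x) (λ x → Vec.lookup b l * (Vec.lookup c x * K x t)) ⟨
      sumF (λ x → K x t * δ l x + Vec.lookup b l * (Vec.lookup c x * K x t))     ≡⟨ sumF-cong (λ x → solve 4 (λ k d b c → k :* d :+ b :* (c :* k) := (d :+ b :* c) :* k) refl (K x t) (δ l x) (Vec.lookup b l) (Vec.lookup c x)) ⟩
      linComb (λ x → Γ b c l x) K t                                              ∎

    independent″ : IndependentAfter j K″
    independent″ x x≈0 = I+bᵀv-injective (Vec.lookup b) (Vec.lookup c) x 1+c·b≢0 (λ y → trans (sym (Γ-apply b c x y)) (xΓ≡0 y))
      where
      1+c·b≢0 : 1# + sumF (λ z → Vec.lookup c z * Vec.lookup b z) ≢ 0#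
      1+c·b≢0 = subst (λ u → 1# + u ≢ 0#) (trans (dot≡sumF b c) (sumF-cong (λ z → *-comm (Vec.lookup b z) _))) 1+b·c≢0
      xΓ≡0 : ∀ y → sumF (λ l → x l * Γ b c l y) ≡ 0#
      xΓ≡0 = independent (λ y → sumF (λ l → x l * Γ b c l y))
               (λ t j<t → trans (sym (linComb-compose x (Γ b c) K″ K t (λ l → K″≈ΓK l t j<t))) (x≈0 t j<t))

    basis″ : LexFirst A″ j [] (below (suc k) (toℕ m)) L
    basis″ = lexFirst-coordinates β independent independent″ A≈βK A″≈βK″ all-below basis

    private
      map⁻ : ∃ λ L′ → L ≡ map (punchIn m) L′ × LexFirst (A″ ∘ punchIn m) j [] (below k (toℕ m)) L′
      map⁻ = lexFirst-map⁻ (punchIn m) [] (below k (toℕ m)) refl (subst (λ X → LexFirst A″ j [] X L) (below-punchIn m) basis″)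

    L′ : List (Fin k)
    L′ = proj₁ map⁻

    L≡map-L′ : L ≡ map (punchIn m) L′
    L≡map-L′ = proj₁ (proj₂ map⁻)

    basis′ : LexFirstBasis A′ (toℕ m) j L′
    basis′ = lexFirst-cong (λ i t → sym (result i t)) (proj₂ (proj₂ map⁻))

    p′ : Fin k → Fin n
    p′ = p ∘ punchIn m

    d*Am≡0-before : ∀ u t → t Fin.< p u → d u * A m t ≡ 0#
    d*Am≡0-before u t t<pu with toℕ u ℕ.<? toℕ m
    ... | yes u<m = trans (cong (d u *_) (proj₂ (leads m) t (ℕₚ.<-trans t<pu (p-mono u<m)))) (zeroʳ _)
    ... | no  u≮m = trans (cong (_* A m t) (d-zero u (ℕₚ.≮⇒≥ u≮m))) (zeroˡ _)

    leads′ : ∀ i → Lead A′ i (p′ i)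
    leads′ i = (begin
        A′ i (p′ i)                                         ≡⟨ result i _ ⟩
        A u (p u) + d u * A m (p u)                         ≡⟨ cong₂ (λ x y → x + d u * y) (proj₁ (leads u)) (pivot-column (punchIn≢m i)) ⟩
        1# + d u * 0#                                       ≡⟨ solve 1 (λ x → :1 :+ x :* :0 := :1) refl (d u) ⟩
        1#                                                  ∎)
      , λ t t<p′ → begin
        A′ i t                                              ≡⟨ result i t ⟩
        A u t + d u * A m t                                 ≡⟨ cong₂ _+_ (proj₂ (leads u) t t<p′) (d*Am≡0-before u t t<p′) ⟩
        0# + 0#                                             ≡⟨ +-identityˡ 0# ⟩
        0#                                                  ∎
      where
      u : Fin (suc k)
      u = punchIn m i

    rref′ : IsRREF A′
    rref′ = p′ , leads′ , (λ i i′ → p-mono ∘ punchIn-mono-< m) , λ i i′ i≢i′ → begin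
        A′ i′ (p′ i)                                        ≡⟨ result i′ _ ⟩
        A (punchIn m i′) (p′ i) + d (punchIn m i′) * A m (p′ i)
                                                            ≡⟨ cong₂ (λ x y → x + d (punchIn m i′) * y) (pivot-column (i≢i′ ∘ Finₚ.punchIn-injective m i i′)) (pivot-column (punchIn≢m i)) ⟩
        0# + d (punchIn m i′) * 0#                          ≡⟨ solve 1 (λ x → :0 :+ x :* :0 := :0) refl (d (punchIn m i′)) ⟩
        0#                                                  ∎

    module Pivots′ = Pivots rref′

    j≡pm : j ≡ p m
    j≡pm = Lead⇒≡p lead

    nonpivotal′ : ¬ Pivotal A′ j
    nonpivotal′ (i , lead′) = punchIn≢m i (Lead-row-unique (subst (Lead A (punchIn m i)) (sym (Pivots′.Lead⇒≡p lead′)) (leads (punchIn m i))) lead)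

    splits′ : Splits A′ (toℕ m) j
    splits′ i t lead′ = (λ i<m → subst₂ Fin._<_ (sym t≡p′) (sym j≡pm) (p-mono (punchIn-<-below m i i<m)))
                      , λ t<j → ℕₚ.≤-<-trans (toℕ≤toℕ-punchIn m i) (p-reflects-< (subst₂ Fin._<_ t≡p′ j≡pm t<j))
      where
      t≡p′ : t ≡ p′ i
      t≡p′ = Pivots′.Lead⇒≡p lead′

    column-j′ : ∀ i → toℕ i ℕ.< toℕ m → A′ i j ≡ d (punchIn m i)
    column-j′ i i<m = begin
      A′ i j                                              ≡⟨ result i j ⟩
      A (punchIn m i) j + d (punchIn m i) * A m j         ≡⟨ cong₂ (λ x y → x + d (punchIn m i) * y) (Lead-column lead (punchIn≢m i)) (proj₁ lead) ⟩
      0# + d (punchIn m i) * 1#                           ≡⟨ solve 1 (λ x → :0 :+ x :* :1 := x) refl (d (punchIn m i)) ⟩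
      d (punchIn m i)                                     ∎

    -- a functional dual to K″ reads off column j of the rows above m
    inessential′ : ColInSpan A′ (toℕ m) j
    inessential′ = e , e-supp , column-j≡
      where
      dual : ∃ λ e → SupportedAfter j e × (∀ l → pairing e (K″ l) ≡ Vec.lookup b l)
      dual = IndependentAfter⇒dual j K″ independent″ (Vec.lookup b)
      e : Row n
      e = proj₁ dual
      e-supp : SupportedAfter j e
      e-supp = proj₁ (proj₂ dual)
      column-j≡ : ∀ i → toℕ i ℕ.< toℕ m → A′ i j ≡ sumF (λ t → e t * A′ i t)
      column-j≡ i i<m = begin
        A′ i j                                   ≡⟨ column-j′ i i<m ⟩
        d u                                      ≡⟨ d≡βb u u<m ⟩
        sumF (λ l → β u l * Vec.lookup b l)      ≡⟨ sumF-cong (λ l → cong (β u l *_) (sym (proj₂ (proj₂ dual) l))) ⟩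
        sumF (λ l → β u l * pairing e (K″ l))    ≡⟨ pairing-linComb e (β u) K″ ⟨
        pairing e (linComb (β u) K″)             ≡⟨ pairing-after e-supp (A″≈βK″ u u<m) ⟨
        pairing e (A″ u)                         ≡⟨ sumF-cong (λ t → cong (e t *_) (sym (result i t))) ⟩
        sumF (λ t → e t * A′ i t)                ∎
        where
        u : Fin (suc k)
        u = punchIn m i
        u<m : Above u
        u<m = punchIn-<-below m i i<m

    private
      L≈L′ : Σ (length L′ ≡ s) λ eq → ∀ x → lookup L (Fin.cast eq x) ≡ punchIn m (lookup L′ x)
      L≈L′ = lookup-≡map (punchIn m) L′ L≡map-L′

    s′≡s : length L′ ≡ s
    s′≡s = proj₁ L≈L′

    lookup-L : ∀ x → lookup L (Fin.cast s′≡s x) ≡ punchIn m (lookup L′ x)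
    lookup-L = proj₂ L≈L′

    L′-above : ∀ x → toℕ (lookup L′ x) ℕ.< toℕ m
    L′-above x = ℕₚ.≤-<-trans (toℕ≤toℕ-punchIn m (lookup L′ x)) (subst Above (lookup-L x) (basis-above (Fin.cast s′≡s x)))

    b′ : Vec F (length L′)
    b′ = Vec.tabulate (λ l → A′ (lookup L′ l) j)

    b′≈b : b′ ≈[ s′≡s ] b
    b′≈b x = begin
      Vec.lookup b′ x                       ≡⟨ Vecₚ.lookup∘tabulate _ x ⟩
      A′ (lookup L′ x) j                    ≡⟨ column-j′ (lookup L′ x) (L′-above x) ⟩
      d (punchIn m (lookup L′ x))           ≡⟨ cong d (lookup-L x) ⟨
      d (lookup L (Fin.cast s′≡s x))        ≡⟨ d-basis _ ⟩
      Vec.lookup b (Fin.cast s′≡s x)        ∎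

    c′≈c : φ (length L′) b′ ≈[ s′≡s ] c
    c′≈c x = trans (φ-cast s′≡s {b′} {b} b′≈b x) (cong (λ z → Vec.lookup z (Fin.cast s′≡s x)) b-eq)

    e′ : Vec F (length L′)
    e′ = Γ-solution b′ (φ (length L′) b′)

    -- row m is recovered from the new basis rows: K″ = Γ K and e Γ = c
    Am≈e′K′ : ∀ t → j Fin.< t → A m t ≡ sumF (λ x → Vec.lookup e′ x * A′ (lookup L′ x) t)
    Am≈e′K′ t j<t = sym (begin
      sumF (λ x → Vec.lookup e′ x * A′ (lookup L′ x) t)                  ≡⟨ sumF-cong (λ x → cong₂ _*_ (Γ-solution-cast s′≡s {b′} {φ _ b′} {b} {c} b′≈b c′≈c x) (trans (result (lookup L′ x) t) (cong (λ u → A″ u t) (sym (lookup-L x))))) ⟩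
      sumF (λ x → Vec.lookup e (Fin.cast s′≡s x) * K″ (Fin.cast s′≡s x) t) ≡⟨ sumF-cast s′≡s (λ x → Vec.lookup e x * K″ x t) ⟨
      linComb (Vec.lookup e) K″ t                                        ≡⟨ linComb-compose (Vec.lookup e) (Γ b c) K″ K t (λ l → K″≈ΓK l t j<t) ⟩
      linComb (λ y → sumF (λ l → Vec.lookup e l * Γ b c l y)) K t        ≡⟨ linComb-cong {K = K} {K} t (Γ-solution-solves b c 1+b·c≢0) (λ _ → refl) ⟩
      linComb (Vec.lookup c) K t                                         ≡⟨ c-eq t j<t ⟨
      A m t                                                              ∎)
      where e = Γ-solution b c

    A-from-A′ : ∀ i t → A (punchIn m i) t ≡ A′ i t + - ((if ⌊ toℕ i ℕ.<? toℕ m ⌋ then A′ i j else 0#) * A m t)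
    A-from-A′ i t with toℕ i ℕ.<? toℕ m
    ... | yes i<m = begin
      A u t                                ≡⟨ solve 3 (λ x y z → x := x :+ y :* z :- y :* z) refl (A u t) (d u) (A m t) ⟩
      A u t + d u * A m t + - (d u * A m t) ≡⟨ cong₂ (λ v w → v + - (w * A m t)) (sym (result i t)) (sym (column-j′ i i<m)) ⟩
      A′ i t + - (A′ i j * A m t)          ∎
      where
      u : Fin (suc k)
      u = punchIn m i
    ... | no  i≮m = begin
      A u t                                ≡⟨ solve 2 (λ x z → x := x :+ :0 :* z :- :0 :* z) refl (A u t) (A m t) ⟩
      A u t + 0# * A m t + - (0# * A m t)  ≡⟨ cong (λ v → A u t + v * A m t + - (0# * A m t)) (sym (d-zero u (ℕₚ.≤-trans (ℕₚ.≮⇒≥ i≮m) (toℕ≤toℕ-punchIn m i)))) ⟩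
      A u t + d u * A m t + - (0# * A m t) ≡⟨ cong (λ v → v + - (0# * A m t)) (sym (result i t)) ⟩
      A′ i t + - (0# * A m t)              ∎
      where
      u : Fin (suc k)
      u = punchIn m i

    inverse : InsStep A′ j A
    inverse = record
      { rref = rref′ ; nonpiv = nonpivotal′ ; m = toℕ m ; splits = splits′ ; iness = inessential′
      ; L = L′ ; basis = basis′
      ; e = e′ ; e-eq = Γ-solution-solves b′ _ (1+dot-φ≢0 _ b′)
      ; r = A m ; r-before = proj₂ lead ; r-at = proj₁ lead ; r-after = Am≈e′K′
      ; ι = m ; ι-pos = refl ; new-row = λ _ → refl ; old-rows = A-from-A′ }

    -- a later pivot row m₂ survives unchanged (d vanishes below row m), and every row above it
    -- in A is a combination of rows above it in A′ together with row m = e′ K′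
    preserves-InessPivotal : ∀ {j′} → j Fin.< j′ → InessPivotal A j′ → InessPivotal A′ j′
    preserves-InessPivotal {j′} j<j′ (m₂ , lead₂ , inessential₂) = i₂ , lead′ , SpannedAfter⇒RowInSpan A′i₂-spanned
      where
      m≢m₂ : m ≢ m₂
      m≢m₂ m≡m₂ = ℕₚ.<-irrefl (cong toℕ (Lead-unique {M = A} (subst (λ z → Lead A z j) m≡m₂ lead) lead₂)) j<j′
      i₂ : Fin k
      i₂ = punchOut m≢m₂
      punchIn-i₂ : punchIn m i₂ ≡ m₂
      punchIn-i₂ = Finₚ.punchIn-punchOut m≢m₂
      m<m₂ : m Fin.< m₂
      m<m₂ = p-reflects-< (subst₂ Fin._<_ j≡pm (Lead⇒≡p lead₂) j<j′)
      i₂≮m : ¬ toℕ i₂ ℕ.< toℕ m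
      i₂≮m i₂<m = ℕₚ.<-asym m<m₂ (subst (λ z → toℕ z ℕ.< toℕ m) punchIn-i₂ (punchIn-<-below m i₂ i₂<m))
      toℕ-m₂ : toℕ m₂ ≡ suc (toℕ i₂)
      toℕ-m₂ = trans (cong toℕ (sym punchIn-i₂)) (toℕ-punchIn-≥ m i₂ i₂≮m)
      lead′ : Lead A′ i₂ j′
      lead′ = subst (Lead A′ i₂) (trans (cong p punchIn-i₂) (sym (Lead⇒≡p lead₂))) (leads′ i₂)
      A′i₂≡Am₂ : ∀ t → A′ i₂ t ≡ A m₂ t
      A′i₂≡Am₂ t = begin
        A′ i₂ t                                          ≡⟨ result i₂ t ⟩
        A (punchIn m i₂) t + d (punchIn m i₂) * A m t    ≡⟨ cong (λ z → A z t + d z * A m t) punchIn-i₂ ⟩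
        A m₂ t + d m₂ * A m t                            ≡⟨ cong (λ z → A m₂ t + z * A m t) (d-zero m₂ (ℕₚ.<⇒≤ m<m₂)) ⟩
        A m₂ t + 0# * A m t                              ≡⟨ solve 2 (λ x y → x :+ :0 :* y := x) refl (A m₂ t) (A m t) ⟩
        A m₂ t                                           ∎
      Above′ : Fin k → Row n
      Above′ = rowsAbove A′ (toℕ i₂)
      Am-spanned : SpannedAfter j′ Above′ (A m)
      Am-spanned = SpannedAfter-≤ (ℕₚ.<⇒≤ j<j′)
        (SpannedAfter-trans {K = rowsOf A′ L′} (λ x → SpannedAfter-rowsAbove A′ (lookup L′ x) (ℕₚ.<-≤-trans (L′-above x) (ℕₚ.≮⇒≥ i₂≮m)))
                            (Vec.lookup e′ , Am≈e′K′))
      row-spanned : ∀ i → Dec (toℕ i ℕ.< toℕ m₂) → SpannedAfter j′ Above′ (rowsAbove A (toℕ m₂) i)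
      row-spanned i (no  i≮m₂) = SpannedAfter-zero Above′ (λ t _ → rowsAbove-≮ A t i≮m₂)
      row-spanned i (yes i<m₂) with punchIn-view m i
      ... | inj₁ refl = SpannedAfter-resp (λ t _ → sym (rowsAbove-< A t i<m₂)) Am-spanned
      ... | inj₂ (i′ , refl) = SpannedAfter-resp (λ t _ → sym (trans (rowsAbove-< A t i<m₂) (A≡ t)))
                                 (SpannedAfter-+* Above′ (- d (punchIn m i′)) (SpannedAfter-rowsAbove A′ i′ i′<i₂) Am-spanned)
        where
        A≡ : ∀ t → A (punchIn m i′) t ≡ A′ i′ t + - d (punchIn m i′) * A m t
        A≡ t = begin
          A (punchIn m i′) t                                                      ≡⟨ solve 3 (λ x y z → x := (x :+ y :* z) :+ :- y :* z) refl (A (punchIn m i′) t) (d (punchIn m i′)) (A m t) ⟩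
          (A (punchIn m i′) t + d (punchIn m i′) * A m t) + - d (punchIn m i′) * A m t ≡⟨ cong (_+ - d (punchIn m i′) * A m t) (sym (result i′ t)) ⟩
          A′ i′ t + - d (punchIn m i′) * A m t                                    ∎
        i′<i₂ : toℕ i′ ℕ.< toℕ i₂
        i′<i₂ = ℕₚ.≤∧≢⇒< (ℕₚ.≤-pred (subst (toℕ i′ ℕ.<_) toℕ-m₂ (ℕₚ.≤-<-trans (toℕ≤toℕ-punchIn m i′) i<m₂)))
                         (λ eq → ℕₚ.<-irrefl (cong toℕ (trans (cong (punchIn m) (Finₚ.toℕ-injective eq)) punchIn-i₂)) i<m₂)
      A′i₂-spanned : SpannedAfter j′ Above′ (A′ i₂)
      A′i₂-spanned = SpannedAfter-resp (λ t _ → sym (A′i₂≡Am₂ t))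
                       (SpannedAfter-trans (λ i → row-spanned i (toℕ i ℕ.<? toℕ m₂)) (RowInSpan⇒SpannedAfter inessential₂))

  deletion-exists : ∀ {k n} {A : Mat (suc k) n} {j : Fin n} → IsRREF A → InessPivotal A j → ∃ (DelStep A j)
  deletion-exists {k} {n} {A} {j} rref (m , lead , inessential) = A′ , record
    { rref = rref ; m = m ; lead = lead ; iness = inessential ; L = L ; basis = basis
    ; c = c ; c-eq = c-eq ; b = b ; b-eq = proj₂ (φ-surjective s c) ; d = d ; d-basis = d-basis
    ; d-other = λ u u<m _ → α u , α-coordinates u (toℕ u ℕ.<? toℕ m) u<m , refl
    ; d-zero = λ u m≤u → d-zero u (toℕ u ℕ.<? toℕ m) m≤u
    ; result = λ _ _ → refl }
    where
    L : List (Fin (suc k))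
    L = proj₁ (lexFirst-exists A j [] (below (suc k) (toℕ m)))
    basis : LexFirstBasis A (toℕ m) j L
    basis = proj₂ (lexFirst-exists A j [] (below (suc k) (toℕ m)))
    open Basis A (toℕ m) j L basis
    s : ℕ
    s = length L
    above-spanned : ∀ i → Dec (toℕ i ℕ.< toℕ m) → SpannedAfter j K (rowsAbove A (toℕ m) i)
    above-spanned i (yes i<m) = SpannedAfter-resp (λ t _ → sym (rowsAbove-< A t i<m)) (spans i i<m)
    above-spanned i (no  i≮m) = SpannedAfter-zero K (λ t _ → rowsAbove-≮ A t i≮m)
    Am-spanned : SpannedAfter j K (A m)
    Am-spanned = SpannedAfter-trans (λ i → above-spanned i (toℕ i ℕ.<? toℕ m)) (RowInSpan⇒SpannedAfter inessential)
    c : Vec F s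
    c = Vec.tabulate (proj₁ Am-spanned)
    c-eq : ∀ t → j Fin.< t → A m t ≡ sumF (λ l → Vec.lookup c l * A (lookup L l) t)
    c-eq t j<t = trans (proj₂ Am-spanned t j<t) (sumF-cong (λ l → cong (_* A (lookup L l) t) (sym (Vecₚ.lookup∘tabulate _ l))))
    b : Vec F s
    b = proj₁ (φ-surjective s c)
    α-when : ∀ u → Dec (toℕ u ℕ.< toℕ m) → Fin s → F
    α-when u (yes u<m) = proj₁ (spans u u<m)
    α-when u (no  _)   = λ _ → 0#
    α : Fin (suc k) → Fin s → F
    α u = α-when u (toℕ u ℕ.<? toℕ m)
    α-coordinates : ∀ u (u<m? : Dec (toℕ u ℕ.< toℕ m)) → toℕ u ℕ.< toℕ m → AgreeAfter j (A u) (linComb (α-when u u<m?) K)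
    α-coordinates u (yes u<m) _   = proj₂ (spans u u<m)
    α-coordinates u (no  u≮m) u<m = contradiction u<m u≮m
    d-when : ∀ u → Dec (toℕ u ℕ.< toℕ m) → F
    d-when u u<m? = sumF (λ l → α-when u u<m? l * Vec.lookup b l)
    d : Fin (suc k) → F
    d u = d-when u (toℕ u ℕ.<? toℕ m)
    d-zero : ∀ u (u<m? : Dec (toℕ u ℕ.< toℕ m)) → toℕ m ℕ.≤ toℕ u → d-when u u<m? ≡ 0#
    d-zero u (yes u<m) m≤u = contradiction m≤u (ℕₚ.<⇒≱ u<m)
    d-zero u (no  _)   _   = sumF-zero (λ l → zeroˡ (Vec.lookup b l))
    d-basis : ∀ l → d (lookup L l) ≡ Vec.lookup b l
    d-basis l = begin
      d (lookup L l)                                  ≡⟨ sumF-cong (λ x → cong (_* Vec.lookup b x) (α≡δ x)) ⟩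
      sumF (λ x → δ x l * Vec.lookup b x)             ≡⟨ sumF-δˡ l (Vec.lookup b) ⟩
      Vec.lookup b l                                  ∎
      where
      α≡δ : ∀ x → α (lookup L l) x ≡ δ x l
      α≡δ = linComb-unique independent _ _ (λ t j<t → trans (sym (α-coordinates (lookup L l) (toℕ (lookup L l) ℕ.<? toℕ m) (basis-above l) t j<t)) (proj₂ (SpannedAfter-member K l) t j<t))
    A′ : Mat k n
    A′ i t = A (punchIn m i) t + d (punchIn m i) * A m t

  -- m, L, c, b and d are all forced: m by the leading entry, L by determinism of the scan,
  -- c by independence of the basis rows, b by injectivity of φ, d by the coordinates of the rows above m
  deletion-unique : ∀ {k n} {A : Mat (suc k) n} {j : Fin n} {A₁ A₂ : Mat k n} → DelStep A j A₁ → DelStep A j A₂ → ∀ i t → A₁ i t ≡ A₂ i t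
  deletion-unique {A = A} {A₁ = A₁} {A₂}
    D₁@record { rref = rref ; m = m ; lead = lead₁ ; basis = basis₁ ; c = c₁ ; c-eq = c-eq₁ ; b = b₁ ; b-eq = b-eq₁ ; d = d₁ ; d-zero = d-zero₁ ; result = result₁ }
    D₂@record { m = m₂ ; lead = lead₂ ; basis = basis₂ ; c = c₂ ; c-eq = c-eq₂ ; b = b₂ ; b-eq = b-eq₂ ; d = d₂ ; d-zero = d-zero₂ ; result = result₂ }
    with Pivots.Lead-row-unique rref lead₁ lead₂
  ... | refl with lexFirst-unique basis₁ basis₂
  ... | refl = λ i t → begin
      A₁ i t                                         ≡⟨ result₁ i t ⟩
      A (punchIn m i) t + d₁ (punchIn m i) * A m t   ≡⟨ cong (λ z → A (punchIn m i) t + z * A m t) (d₁≡d₂ (punchIn m i)) ⟩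
      A (punchIn m i) t + d₂ (punchIn m i) * A m t   ≡⟨ result₂ i t ⟨
      A₂ i t                                         ∎
    where
    module S₁ = DeletionStep D₁
    module S₂ = DeletionStep D₂
    c₁≡c₂ : c₁ ≡ c₂
    c₁≡c₂ = Vec-ext (linComb-unique S₁.independent (Vec.lookup c₁) (Vec.lookup c₂) (λ t j<t → trans (sym (c-eq₁ t j<t)) (c-eq₂ t j<t)))
    b₁≡b₂ : b₁ ≡ b₂
    b₁≡b₂ = φ-injective _ (trans b-eq₁ (trans c₁≡c₂ (sym b-eq₂)))
    d₁≡d₂ : ∀ u → d₁ u ≡ d₂ u
    d₁≡d₂ u with toℕ u ℕ.<? toℕ m
    ... | no  u≮m = trans (d-zero₁ u (ℕₚ.≮⇒≥ u≮m)) (sym (d-zero₂ u (ℕₚ.≮⇒≥ u≮m)))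
    ... | yes u<m = begin
      d₁ u                                           ≡⟨ S₁.d≡βb u u<m ⟩
      sumF (λ l → S₁.β u l * Vec.lookup b₁ l)        ≡⟨ sumF-cong (λ l → cong₂ (λ x y → x * Vec.lookup y l) (β₁≡β₂ l) b₁≡b₂) ⟩
      sumF (λ l → S₂.β u l * Vec.lookup b₂ l)        ≡⟨ S₂.d≡βb u u<m ⟨
      d₂ u                                           ∎
      where
      β₁≡β₂ : ∀ l → S₁.β u l ≡ S₂.β u l
      β₁≡β₂ = linComb-unique S₁.independent (S₁.β u) (S₂.β u) (λ t j<t → trans (sym (S₁.A≈βK u u<m t j<t)) (S₂.A≈βK u u<m t j<t))

  -- Single insertions

  module InsertionStep {k n} {A : Mat k n} {j : Fin n} {A′ : Mat (suc k) n} (I : InsStep A j A′) where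
    open InsStep I
    open Pivots rref
    open Basis A m j L basis public

    lookup-b : ∀ l → Vec.lookup b l ≡ A (lookup L l) j
    lookup-b l = Vecₚ.lookup∘tabulate _ l

    1+b·c≢0 : 1# + dot b c ≢ 0#
    1+b·c≢0 = 1+dot-φ≢0 s b

    e≡Γ-solution : e ≡ Γ-solution b c
    e≡Γ-solution = Γ-solution-unique b c e 1+b·c≢0 e-eq

    f : Row n
    f = proj₁ iness
    f-supp : SupportedAfter j f
    f-supp = proj₁ (proj₂ iness)
    column-j : ∀ i → toℕ i ℕ.< m → A i j ≡ pairing f (A i)
    column-j = proj₂ (proj₂ iness)

    dᵢ : Fin k → F
    dᵢ i = if ⌊ toℕ i ℕ.<? m ⌋ then A i j else 0#

    dᵢ-< : ∀ {i} → toℕ i ℕ.< m → dᵢ i ≡ A i j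
    dᵢ-< {i} i<m with toℕ i ℕ.<? m
    ... | yes _   = refl
    ... | no  i≮m = contradiction i<m i≮m

    dᵢ-≮ : ∀ {i} → ¬ toℕ i ℕ.< m → dᵢ i ≡ 0#
    dᵢ-≮ {i} i≮m with toℕ i ℕ.<? m
    ... | yes i<m = contradiction i<m i≮m
    ... | no  _   = refl

    A₀ : Mat k n
    A₀ i = A′ (punchIn ι i)

    A₀-< : ∀ i t → toℕ i ℕ.< m → A₀ i t ≡ A i t + - (A i j * r t)
    A₀-< i t i<m = trans (old-rows i t) (cong (λ z → A i t + - (z * r t)) (dᵢ-< i<m))

    A₀-≮ : ∀ i t → ¬ toℕ i ℕ.< m → A₀ i t ≡ A i t
    A₀-≮ i t i≮m = trans (old-rows i t) (trans (cong (λ z → A i t + - (z * r t)) (dᵢ-≮ i≮m)) (solve 2 (λ a r → a :+ :- (:0 :* r) := a) refl (A i t) (r t)))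

    coordinates : ∀ u → Dec (toℕ u ℕ.< m) → Fin s → F
    coordinates u (yes u<m) = proj₁ (spans u u<m)
    coordinates u (no  _)   = λ _ → 0#

    β : Fin k → Fin s → F
    β u = coordinates u (toℕ u ℕ.<? m)

    A≈βK : ∀ u → toℕ u ℕ.< m → AgreeAfter j (A u) (linComb (β u) K)
    A≈βK u u<m with toℕ u ℕ.<? m
    ... | yes u<m′ = proj₂ (spans u u<m′)
    ... | no  u≮m  = contradiction u<m u≮m

    pairing-f-K : ∀ l → pairing f (K l) ≡ Vec.lookup b l
    pairing-f-K l = trans (sym (column-j (lookup L l) (basis-above l))) (sym (lookup-b l))

    column-j≡βb : ∀ u → toℕ u ℕ.< m → A u j ≡ sumF (λ l → β u l * Vec.lookup b l)
    column-j≡βb u u<m = begin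
      A u j                                     ≡⟨ column-j u u<m ⟩
      pairing f (A u)                           ≡⟨ pairing-after f-supp (A≈βK u u<m) ⟩
      pairing f (linComb (β u) K)               ≡⟨ pairing-linComb f (β u) K ⟩
      sumF (λ l → β u l * pairing f (K l))      ≡⟨ sumF-cong (λ l → cong (β u l *_) (pairing-f-K l)) ⟩
      sumF (λ l → β u l * Vec.lookup b l)       ∎

    K₀ : Fin s → Row n
    K₀ = rowsOf A₀ L

    K₀≡ : ∀ l t → K₀ l t ≡ K l t + - (Vec.lookup b l * r t)
    K₀≡ l t = trans (A₀-< (lookup L l) t (basis-above l)) (cong (λ z → K l t + - (z * r t)) (sym (lookup-b l)))

    A₀≈βK₀ : ∀ u → toℕ u ℕ.< m → AgreeAfter j (A₀ u) (linComb (β u) K₀)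
    A₀≈βK₀ u u<m t j<t = begin
      A₀ u t                                                          ≡⟨ A₀-< u t u<m ⟩
      A u t + - (A u j * r t)                                         ≡⟨ cong₂ (λ x y → x + - (y * r t)) (A≈βK u u<m t j<t) (column-j≡βb u u<m) ⟩
      linComb (β u) K t + - (sumF (λ l → β u l * Vec.lookup b l) * r t)
                                                                      ≡⟨ cong (λ z → linComb (β u) K t + - z) (sumF-*ʳ (r t) (λ l → β u l * Vec.lookup b l)) ⟩
      linComb (β u) K t + - sumF (λ l → β u l * Vec.lookup b l * r t) ≡⟨ cong (linComb (β u) K t +_) (sumF-neg (λ l → β u l * Vec.lookup b l * r t)) ⟩
      linComb (β u) K t + sumF (λ l → - (β u l * Vec.lookup b l * r t))
                                                                      ≡⟨ sumF-+ (λ l → β u l * K l t) (λ l → - (β u l * Vec.lookup b l * r t)) ⟨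
      sumF (λ l → β u l * K l t + - (β u l * Vec.lookup b l * r t))   ≡⟨ sumF-cong (λ l → trans (solve 4 (λ x k b r → x :* k :- x :* b :* r := x :* (k :- b :* r)) refl (β u l) (K l t) (Vec.lookup b l) (r t)) (cong (β u l *_) (sym (K₀≡ l t)))) ⟩
      linComb (β u) K₀ t                                              ∎

    K₀≈[I-bᵀe]K : ∀ l → AgreeAfter j (K₀ l) (linComb (λ x → δ l x + - (Vec.lookup b l * Vec.lookup e x)) K)
    K₀≈[I-bᵀe]K l t j<t = begin
      K₀ l t                                                          ≡⟨ K₀≡ l t ⟩
      K l t + - (bₗ * r t)                                            ≡⟨ cong (λ z → K l t + - (bₗ * z)) (r-after t j<t) ⟩
      K l t + - (bₗ * linComb (Vec.lookup e) K t)                     ≡⟨ cong (λ z → K l t + - z) (sumF-*ˡ bₗ (λ x → Vec.lookup e x * K x t)) ⟩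
      K l t + - sumF (λ x → bₗ * (Vec.lookup e x * K x t))            ≡⟨ cong₂ _+_ (sym (sumF-δʳ l (λ x → K x t))) (sumF-neg (λ x → bₗ * (Vec.lookup e x * K x t))) ⟩
      sumF (λ x → K x t * δ l x) + sumF (λ x → - (bₗ * (Vec.lookup e x * K x t)))
                                                                      ≡⟨ sumF-+ (λ x → K x t * δ l x) (λ x → - (bₗ * (Vec.lookup e x * K x t))) ⟨
      sumF (λ x → K x t * δ l x + - (bₗ * (Vec.lookup e x * K x t)))  ≡⟨ sumF-cong (λ x → solve 4 (λ k d b e → k :* d :- b :* (e :* k) := (d :- b :* e) :* k) refl (K x t) (δ l x) bₗ (Vec.lookup e x)) ⟩
      linComb (λ x → δ l x + - (bₗ * Vec.lookup e x)) K t             ∎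
      where bₗ = Vec.lookup b l

    D w : F
    D = dot b c
    w = (1# + D) ⁻¹

    e·b≡D*w : sumF (λ z → Vec.lookup e z * Vec.lookup b z) ≡ D * w
    e·b≡D*w = begin
      sumF (λ z → Vec.lookup e z * Vec.lookup b z)             ≡⟨ sumF-cong (λ z → cong (λ v → Vec.lookup v z * Vec.lookup b z) e≡Γ-solution) ⟩
      sumF (λ z → Vec.lookup (Γ-solution b c) z * Vec.lookup b z)
                                                               ≡⟨ sumF-cong (λ z → trans (cong (_* Vec.lookup b z) (Vecₚ.lookup∘tabulate _ z)) (solve 3 (λ c w b → c :* w :* b := b :* c :* w) refl (Vec.lookup c z) w (Vec.lookup b z))) ⟩
      sumF (λ z → Vec.lookup b z * Vec.lookup c z * w)         ≡⟨ sumF-*ʳ w (λ z → Vec.lookup b z * Vec.lookup c z) ⟨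
      sumF (λ z → Vec.lookup b z * Vec.lookup c z) * w         ≡⟨ cong (_* w) (dot≡sumF b c) ⟨
      D * w                                                    ∎

    -- (1 - D/(1 + D)) (1 + D) = 1
    1-e·b≢0 : 1# + - sumF (λ z → Vec.lookup e z * Vec.lookup b z) ≢ 0#
    1-e·b≢0 ≡0 = 0≢1 (begin
      0#                                         ≡⟨ zeroˡ (1# + D) ⟨
      0# * (1# + D)                              ≡⟨ cong (_* (1# + D)) (trans (cong (λ u → 1# + - u) (sym e·b≡D*w)) ≡0) ⟨
      (1# + - (D * w)) * (1# + D)                ≡⟨ solve 2 (λ D w → (:1 :- D :* w) :* (:1 :+ D) := (:1 :+ D) :- D :* ((:1 :+ D) :* w)) refl D w ⟩
      (1# + D) + - (D * ((1# + D) * w))          ≡⟨ cong (λ u → (1# + D) + - (D * u)) (⁻¹-inverse _ 1+b·c≢0) ⟩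
      (1# + D) + - (D * 1#)                      ≡⟨ solve 1 (λ D → (:1 :+ D) :- D :* :1 := :1) refl D ⟩
      1#                                         ∎)

    independent₀ : IndependentAfter j K₀
    independent₀ x x≈0 = I+bᵀv-injective (Vec.lookup b) (λ y → - Vec.lookup e y) x 1+v·b≢0 (λ y → trans (x[I-bᵀe] y) (x[I-bᵀe]K≡0 y))
      where
      E = sumF (λ z → x z * Vec.lookup b z)
      1+v·b≢0 : 1# + sumF (λ z → - Vec.lookup e z * Vec.lookup b z) ≢ 0#
      1+v·b≢0 = subst (λ u → 1# + u ≢ 0#) (trans (sumF-neg (λ z → Vec.lookup e z * Vec.lookup b z)) (sumF-cong (λ z → -‿distribˡ-* (Vec.lookup e z) (Vec.lookup b z)))) 1-e·b≢0
      x[I-bᵀe] : ∀ y → x y + E * - Vec.lookup e y ≡ sumF (λ l → x l * (δ l y + - (Vec.lookup b l * Vec.lookup e y)))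
      x[I-bᵀe] y = sym (begin
        sumF (λ l → x l * (δ l y + - (Vec.lookup b l * Vec.lookup e y)))      ≡⟨ sumF-cong (λ l → solve 4 (λ x d b e → x :* (d :- b :* e) := d :* x :+ :- (x :* b :* e)) refl (x l) (δ l y) (Vec.lookup b l) (Vec.lookup e y)) ⟩
        sumF (λ l → δ l y * x l + - (x l * Vec.lookup b l * Vec.lookup e y))  ≡⟨ sumF-+ (λ l → δ l y * x l) (λ l → - (x l * Vec.lookup b l * Vec.lookup e y)) ⟩
        sumF (λ l → δ l y * x l) + sumF (λ l → - (x l * Vec.lookup b l * Vec.lookup e y))
                                                                              ≡⟨ cong₂ _+_ (sumF-δˡ y x) (sym (sumF-neg (λ l → x l * Vec.lookup b l * Vec.lookup e y))) ⟩
        x y + - sumF (λ l → x l * Vec.lookup b l * Vec.lookup e y)            ≡⟨ cong (λ z → x y + - z) (sumF-*ʳ (Vec.lookup e y) (λ l → x l * Vec.lookup b l)) ⟨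
        x y + - (E * Vec.lookup e y)                                          ≡⟨ cong (x y +_) (solve 2 (λ E e → :- (E :* e) := E :* (:- e)) refl E (Vec.lookup e y)) ⟩
        x y + E * - Vec.lookup e y                                            ∎)
      x[I-bᵀe]K≡0 : ∀ y → sumF (λ l → x l * (δ l y + - (Vec.lookup b l * Vec.lookup e y))) ≡ 0#
      x[I-bᵀe]K≡0 = independent _ (λ t j<t → trans (sym (linComb-compose x (λ l y → δ l y + - (Vec.lookup b l * Vec.lookup e y)) K₀ K t (λ l → K₀≈[I-bᵀe]K l t j<t))) (x≈0 t j<t))

    basis₀ : LexFirst A₀ j [] (below k m) L
    basis₀ = lexFirst-coordinates β independent independent₀ A≈βK A₀≈βK₀ all-below basis

    L⁺ : List (Fin (suc k))
    L⁺ = map (punchIn ι) L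

    basis⁺ : LexFirstBasis A′ (toℕ ι) j L⁺
    basis⁺ = subst (λ X → LexFirst A′ j [] X L⁺) (trans (cong (map (punchIn ι) ∘ below k) (sym ι-pos)) (sym (below-punchIn ι)))
                   (lexFirst-map⁺ (punchIn ι) [] (below k m) refl basis₀)

    p<j : ∀ i → toℕ i ℕ.< m → p i Fin.< j
    p<j i i<m = proj₁ (splits i (p i) (leads i)) i<m

    j<p : ∀ i → ¬ toℕ i ℕ.< m → j Fin.< p i
    j<p i i≮m with Finₚ.<-cmp (p i) j
    ... | tri< pi<j _ _ = contradiction (proj₂ (splits i (p i) (leads i)) pi<j) i≮m
    ... | tri≈ _ pi≡j _ = contradiction (i , subst (Lead A i) pi≡j (leads i)) nonpiv
    ... | tri> _ _ j<pi = j<pi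

    r-pivot : ∀ i → r (p i) ≡ 0#
    r-pivot i with toℕ i ℕ.<? m
    ... | yes i<m = r-before (p i) (p<j i i<m)
    ... | no  i≮m = trans (r-after (p i) (j<p i i≮m)) (sumF-zero (λ x → trans (cong (Vec.lookup e x *_) (pivot-column (i≢L x))) (zeroʳ _)))
      where
      i≢L : ∀ x → i ≢ lookup L x
      i≢L x refl = i≮m (basis-above x)

    punchIn-<ι : ∀ i → toℕ i ℕ.< m → punchIn ι i Fin.< ι
    punchIn-<ι i i<m = punchIn-<-below ι i (subst (toℕ i ℕ.<_) (sym ι-pos) i<m)

    ι<punchIn : ∀ i → ¬ toℕ i ℕ.< m → ι Fin.< punchIn ι i
    ι<punchIn i i≮m = punchIn-<-above ι i (i≮m ∘ subst (toℕ i ℕ.<_) ι-pos)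

    p⁺ : Fin (suc k) → Fin n
    p⁺ = Vector.insertAt p ι j

    p⁺-ι : p⁺ ι ≡ j
    p⁺-ι = Vectorₚ.insertAt-lookup p ι j

    p⁺-punchIn : ∀ i → p⁺ (punchIn ι i) ≡ p i
    p⁺-punchIn i = Vectorₚ.insertAt-punchIn p ι j i

    lead-ι : Lead A′ ι j
    lead-ι = trans (new-row j) r-at , (λ t t<j → trans (new-row t) (r-before t t<j))

    dᵢ*r≡0-before : ∀ i {t} → t Fin.< p i → dᵢ i * r t ≡ 0#
    dᵢ*r≡0-before i {t} t<pi = vanishes (toℕ i ℕ.<? m)
      where
      vanishes : Dec (toℕ i ℕ.< m) → dᵢ i * r t ≡ 0#
      vanishes (yes i<m) = trans (cong (dᵢ i *_) (r-before t (ℕₚ.<-trans t<pi (p<j i i<m)))) (zeroʳ _)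
      vanishes (no  i≮m) = trans (cong (_* r t) (dᵢ-≮ i≮m)) (zeroˡ _)

    lead-punchIn : ∀ i → Lead A′ (punchIn ι i) (p i)
    lead-punchIn i = (begin
        A₀ i (p i)                  ≡⟨ old-rows i (p i) ⟩
        A i (p i) + - (dᵢ i * r (p i)) ≡⟨ cong₂ (λ x y → x + - (dᵢ i * y)) (proj₁ (leads i)) (r-pivot i) ⟩
        1# + - (dᵢ i * 0#)          ≡⟨ solve 1 (λ d → :1 :- d :* :0 := :1) refl (dᵢ i) ⟩
        1#                          ∎)
      , λ t t<pi → begin
        A₀ i t                      ≡⟨ old-rows i t ⟩
        A i t + - (dᵢ i * r t)      ≡⟨ cong₂ (λ x y → x + - y) (proj₂ (leads i) t t<pi) (dᵢ*r≡0-before i t<pi) ⟩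
        0# + - 0#                   ≡⟨ solve 0 (:0 :- :0 := :0) refl ⟩
        0#                          ∎

    rref⁺ : IsRREF A′
    rref⁺ = p⁺ , leads⁺ , mono⁺ , pivot-column⁺
      where
      leads⁺ : ∀ u → Lead A′ u (p⁺ u)
      leads⁺ u with punchIn-view ι u
      ... | inj₁ refl       = subst (Lead A′ ι) (sym p⁺-ι) lead-ι
      ... | inj₂ (i , refl) = subst (Lead A′ (punchIn ι i)) (sym (p⁺-punchIn i)) (lead-punchIn i)
      mono⁺ : ∀ u u′ → u Fin.< u′ → p⁺ u Fin.< p⁺ u′
      mono⁺ u u′ u<u′ with punchIn-view ι u | punchIn-view ι u′
      ... | inj₁ refl       | inj₁ refl        = contradiction u<u′ (ℕₚ.<-irrefl refl)
      ... | inj₁ refl       | inj₂ (i′ , refl) = subst₂ Fin._<_ (sym p⁺-ι) (sym (p⁺-punchIn i′)) (j<p i′ (λ i′<m → ℕₚ.<-asym u<u′ (punchIn-<ι i′ i′<m)))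
      ... | inj₂ (i , refl) | inj₁ refl        = subst₂ Fin._<_ (sym (p⁺-punchIn i)) (sym p⁺-ι) (p<j i (punchIn<ι⇒<m i u<u′))
        where
        punchIn<ι⇒<m : ∀ i → punchIn ι i Fin.< ι → toℕ i ℕ.< m
        punchIn<ι⇒<m i lt with toℕ i ℕ.<? m
        ... | yes i<m = i<m
        ... | no  i≮m = contradiction (ι<punchIn i i≮m) (ℕₚ.<-asym lt)
      ... | inj₂ (i , refl) | inj₂ (i′ , refl) = subst₂ Fin._<_ (sym (p⁺-punchIn i)) (sym (p⁺-punchIn i′)) (p-mono (i<i′ (Finₚ.<-cmp i i′)))
        where
        i<i′ : Tri (i Fin.< i′) (i ≡ i′) (i′ Fin.< i) → i Fin.< i′
        i<i′ (tri< lt _ _) = lt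
        i<i′ (tri≈ _ refl _) = contradiction u<u′ (ℕₚ.<-irrefl refl)
        i<i′ (tri> _ _ gt) = contradiction (punchIn-mono-< ι gt) (ℕₚ.<-asym u<u′)
      pivot-column⁺ : ∀ u u′ → u ≢ u′ → A′ u′ (p⁺ u) ≡ 0#
      pivot-column⁺ u u′ u≢u′ with punchIn-view ι u | punchIn-view ι u′
      ... | inj₁ refl       | inj₁ refl        = contradiction refl u≢u′
      ... | inj₁ refl       | inj₂ (i′ , refl) = trans (cong (A₀ i′) p⁺-ι) (column-j-old (toℕ i′ ℕ.<? m))
        where
        column-j-old : Dec (toℕ i′ ℕ.< m) → A₀ i′ j ≡ 0#
        column-j-old (yes i′<m) = trans (A₀-< i′ j i′<m) (trans (cong (λ z → A i′ j + - (A i′ j * z)) r-at) (solve 1 (λ a → a :- a :* :1 := :0) refl (A i′ j)))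
        column-j-old (no  i′≮m) = trans (A₀-≮ i′ j i′≮m) (proj₂ (leads i′) j (j<p i′ i′≮m))
      ... | inj₂ (i , refl) | inj₁ refl        = trans (cong (A′ ι) (p⁺-punchIn i)) (trans (new-row (p i)) (r-pivot i))
      ... | inj₂ (i , refl) | inj₂ (i′ , refl) = begin
        A₀ i′ (p⁺ (punchIn ι i))            ≡⟨ cong (A₀ i′) (p⁺-punchIn i) ⟩
        A₀ i′ (p i)                         ≡⟨ old-rows i′ (p i) ⟩
        A i′ (p i) + - (dᵢ i′ * r (p i))    ≡⟨ cong₂ (λ x y → x + - (dᵢ i′ * y)) (pivot-column (u≢u′ ∘ cong (punchIn ι))) (r-pivot i) ⟩
        0# + - (dᵢ i′ * 0#)                 ≡⟨ solve 1 (λ d → :0 :- d :* :0 := :0) refl (dᵢ i′) ⟩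
        0#                                  ∎

    private
      L⁺≈L : Σ (s ≡ length L⁺) λ eq → ∀ x → lookup L⁺ (Fin.cast eq x) ≡ punchIn ι (lookup L x)
      L⁺≈L = lookup-≡map (punchIn ι) L refl

    s≡s⁺ : s ≡ length L⁺
    s≡s⁺ = proj₁ L⁺≈L

    ←ₗ : Fin (length L⁺) → Fin s
    ←ₗ = Fin.cast (sym s≡s⁺)

    lookup-L⁺ : ∀ y → lookup L⁺ y ≡ punchIn ι (lookup L (←ₗ y))
    lookup-L⁺ y = trans (cong (lookup L⁺) (sym (Finₚ.cast-involutive s≡s⁺ (sym s≡s⁺) y))) (proj₂ L⁺≈L (←ₗ y))

    sumF-L⁺ : ∀ (g : Fin s → F) (h : Fin (suc k) → F) →
              sumF (λ y → g (←ₗ y) * h (lookup L⁺ y)) ≡ sumF (λ x → g x * h (punchIn ι (lookup L x)))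
    sumF-L⁺ g h = trans (sumF-cast s≡s⁺ _) (sumF-cong (λ x → cong₂ (λ u v → g u * h v) (Finₚ.cast-involutive (sym s≡s⁺) s≡s⁺ x) (proj₂ L⁺≈L x)))

    b⁺ c⁺ : Vec F (length L⁺)
    b⁺ = Vec.tabulate (Vec.lookup b ∘ ←ₗ)
    c⁺ = Vec.tabulate (Vec.lookup c ∘ ←ₗ)

    φ-b⁺ : φ (length L⁺) b⁺ ≡ c⁺
    φ-b⁺ = Vec-ext (λ y → trans (φ-cast (sym s≡s⁺) {b⁺} {b} (Vecₚ.lookup∘tabulate _) y) (sym (Vecₚ.lookup∘tabulate _ y)))

    -- r = c K₀, because c (I - bᵀe) = c - (c·b) c/(1 + D) = c/(1 + D) = e
    r≈cK₀ : AgreeAfter j r (linComb (Vec.lookup c) K₀)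
    r≈cK₀ t j<t = sym (begin
      linComb (Vec.lookup c) K₀ t                                       ≡⟨ sumF-cong (λ l → trans (cong (Vec.lookup c l *_) (K₀≡ l t)) (solve 4 (λ c k b r → c :* (k :- b :* r) := c :* k :+ :- (c :* b :* r)) refl (Vec.lookup c l) (K l t) (Vec.lookup b l) (r t))) ⟩
      sumF (λ l → Vec.lookup c l * K l t + - (Vec.lookup c l * Vec.lookup b l * r t))
                                                                        ≡⟨ sumF-+ (λ l → Vec.lookup c l * K l t) (λ l → - (Vec.lookup c l * Vec.lookup b l * r t)) ⟩
      linComb (Vec.lookup c) K t + sumF (λ l → - (Vec.lookup c l * Vec.lookup b l * r t))
                                                                        ≡⟨ cong (linComb (Vec.lookup c) K t +_) (sumF-neg (λ l → Vec.lookup c l * Vec.lookup b l * r t)) ⟨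
      linComb (Vec.lookup c) K t + - sumF (λ l → Vec.lookup c l * Vec.lookup b l * r t)
                                                                        ≡⟨ cong (λ z → linComb (Vec.lookup c) K t + - z) (sumF-*ʳ (r t) (λ l → Vec.lookup c l * Vec.lookup b l)) ⟨
      linComb (Vec.lookup c) K t + - (sumF (λ l → Vec.lookup c l * Vec.lookup b l) * r t)
                                                                        ≡⟨ cong₂ (λ u v → u + - (v * r t)) cK≡[1+D]r c·b≡D ⟩
      (1# + D) * r t + - (D * r t)                                      ≡⟨ solve 2 (λ D r → (:1 :+ D) :* r :- D :* r := r) refl D (r t) ⟩
      r t                                                               ∎)
      where
      c·b≡D : sumF (λ l → Vec.lookup c l * Vec.lookup b l) ≡ D
      c·b≡D = trans (sumF-cong (λ l → *-comm (Vec.lookup c l) (Vec.lookup b l))) (sym (dot≡sumF b c))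
      cK≡[1+D]r : linComb (Vec.lookup c) K t ≡ (1# + D) * r t
      cK≡[1+D]r = begin
        linComb (Vec.lookup c) K t                                      ≡⟨ *-identityˡ _ ⟨
        1# * linComb (Vec.lookup c) K t                                 ≡⟨ cong (_* linComb (Vec.lookup c) K t) (⁻¹-inverse _ 1+b·c≢0) ⟨
        (1# + D) * w * linComb (Vec.lookup c) K t                       ≡⟨ *-assoc _ _ _ ⟩
        (1# + D) * (w * linComb (Vec.lookup c) K t)                     ≡⟨ cong ((1# + D) *_) (sumF-*ˡ w (λ l → Vec.lookup c l * K l t)) ⟩
        (1# + D) * sumF (λ l → w * (Vec.lookup c l * K l t))           ≡⟨ cong ((1# + D) *_) (sumF-cong (λ l → trans (solve 3 (λ w c k → w :* (c :* k) := c :* w :* k) refl w (Vec.lookup c l) (K l t))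
                                                                              (cong (_* K l t) (trans (sym (Vecₚ.lookup∘tabulate _ l)) (cong (λ v → Vec.lookup v l) (sym e≡Γ-solution)))))) ⟩
        (1# + D) * linComb (Vec.lookup e) K t                           ≡⟨ cong ((1# + D) *_) (r-after t j<t) ⟨
        (1# + D) * r t                                                  ∎

    d⁺ : Fin (suc k) → F
    d⁺ = Vector.insertAt dᵢ ι 0#

    d⁺-zero : ∀ u → toℕ ι ℕ.≤ toℕ u → d⁺ u ≡ 0#
    d⁺-zero u ι≤u with punchIn-view ι u
    ... | inj₁ refl       = Vectorₚ.insertAt-lookup dᵢ ι 0#
    ... | inj₂ (i , refl) = trans (Vectorₚ.insertAt-punchIn dᵢ ι 0# i) (dᵢ-≮ (λ i<m → ℕₚ.<⇒≱ (punchIn-<ι i i<m) ι≤u))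

    d⁺-other : ∀ u → toℕ u ℕ.< toℕ ι → (∀ l → lookup L⁺ l ≢ u) →
               ∃ λ (α : Fin (length L⁺) → F) → AgreeAfter j (A′ u) (λ t → sumF (λ l → α l * A′ (lookup L⁺ l) t))
                                              × d⁺ u ≡ sumF (λ l → α l * Vec.lookup b⁺ l)
    d⁺-other u u<ι _ with punchIn-view ι u
    ... | inj₁ refl       = contradiction u<ι (ℕₚ.<-irrefl refl)
    ... | inj₂ (i , refl) = β i ∘ ←ₗ , (λ t j<t → trans (A₀≈βK₀ i i<m t j<t) (sym (sumF-L⁺ (β i) (λ u → A′ u t)))) , (begin
        d⁺ (punchIn ι i)                            ≡⟨ Vectorₚ.insertAt-punchIn dᵢ ι 0# i ⟩
        dᵢ i                                        ≡⟨ dᵢ-< i<m ⟩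
        A i j                                       ≡⟨ column-j≡βb i i<m ⟩
        sumF (λ x → β i x * Vec.lookup b x)         ≡⟨ sumF-cast (sym s≡s⁺) (λ x → β i x * Vec.lookup b x) ⟩
        sumF (λ y → β i (←ₗ y) * Vec.lookup b (←ₗ y)) ≡⟨ sumF-cong (λ y → cong (β i (←ₗ y) *_) (sym (Vecₚ.lookup∘tabulate _ y))) ⟩
        sumF (λ y → β i (←ₗ y) * Vec.lookup b⁺ y)   ∎)
      where
      i<m : toℕ i ℕ.< m
      i<m with toℕ i ℕ.<? m
      ... | yes i<m = i<m
      ... | no  i≮m = contradiction (ι<punchIn i i≮m) (ℕₚ.<-asym u<ι)

    inverse : DelStep A′ j A
    inverse = record
      { rref = rref⁺ ; m = ι ; lead = lead-ι
      ; iness = SpannedAfter⇒RowInSpan {M = A′} (SpannedAfter-trans {K = K₀} {rowsAbove A′ (toℕ ι)} (λ l → SpannedAfter-rowsAbove A′ _ (punchIn-<ι _ (basis-above l)))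
                                                          (SpannedAfter-resp (λ t _ → sym (new-row t)) (Vec.lookup c , r≈cK₀)))
      ; L = L⁺ ; basis = basis⁺
      ; c = c⁺ ; c-eq = λ t j<t → begin
          A′ ι t                                              ≡⟨ new-row t ⟩
          r t                                                 ≡⟨ r≈cK₀ t j<t ⟩
          linComb (Vec.lookup c) K₀ t                         ≡⟨ sumF-L⁺ (Vec.lookup c) (λ u → A′ u t) ⟨
          sumF (λ y → Vec.lookup c (←ₗ y) * A′ (lookup L⁺ y) t) ≡⟨ sumF-cong (λ y → cong (_* A′ (lookup L⁺ y) t) (sym (Vecₚ.lookup∘tabulate _ y))) ⟩
          sumF (λ y → Vec.lookup c⁺ y * A′ (lookup L⁺ y) t)   ∎
      ; b = b⁺ ; b-eq = φ-b⁺ ; d = d⁺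
      ; d-basis = λ y → begin
          d⁺ (lookup L⁺ y)                                    ≡⟨ cong d⁺ (lookup-L⁺ y) ⟩
          d⁺ (punchIn ι (lookup L (←ₗ y)))                    ≡⟨ Vectorₚ.insertAt-punchIn dᵢ ι 0# _ ⟩
          dᵢ (lookup L (←ₗ y))                                ≡⟨ dᵢ-< (basis-above (←ₗ y)) ⟩
          A (lookup L (←ₗ y)) j                               ≡⟨ lookup-b (←ₗ y) ⟨
          Vec.lookup b (←ₗ y)                                 ≡⟨ Vecₚ.lookup∘tabulate _ y ⟨
          Vec.lookup b⁺ y                                     ∎
      ; d-other = d⁺-other ; d-zero = d⁺-zero
      ; result = λ i t → begin
          A i t                                               ≡⟨ solve 3 (λ a d r → a := (a :- d :* r) :+ d :* r) refl (A i t) (dᵢ i) (r t) ⟩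
          (A i t + - (dᵢ i * r t)) + dᵢ i * r t               ≡⟨ cong₂ _+_ (sym (old-rows i t)) (cong₂ _*_ (sym (Vectorₚ.insertAt-punchIn dᵢ ι 0# i)) (sym (new-row t))) ⟩
          A′ (punchIn ι i) t + d⁺ (punchIn ι i) * A′ ι t      ∎ }

    -- a functional for column j′ in A′ is the old one corrected along f, which reads off column j:
    -- g = f / (1 - e·b) satisfies ⟨g, A₀ i⟩ = A i j for the rows i above m
    preserves-InessNonpivotal : ∀ {j′} → j′ Fin.< j → InessNonpivotal A j′ → InessNonpivotal A′ j′
    preserves-InessNonpivotal {j′} j′<j (nonpiv₀ , m₀ , splits₀ , f₀ , f₀-supp , column₀) = nonpiv′ , m₁ , splits′ , f′ , f′-supp , column′
      where
      m₁ : ℕ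
      m₁ = m₀ ℕ.⊓ m
      m₁≤m : m₁ ℕ.≤ m
      m₁≤m = ℕₚ.m⊓n≤n m₀ m
      splits₁ : Splits A m₁ j′
      splits₁ i t lead-i with m₀ ℕ.≤? m
      ... | yes m₀≤m = subst (λ z → Splits A z j′) (sym (ℕₚ.m≤n⇒m⊓n≡m m₀≤m)) splits₀ i t lead-i
      ... | no  m₀≰m = subst (λ z → (toℕ i ℕ.< z → t Fin.< j′) × (t Fin.< j′ → toℕ i ℕ.< z)) (sym (ℕₚ.m≥n⇒m⊓n≡n (ℕₚ.<⇒≤ (ℕₚ.≰⇒> m₀≰m))))
                         ((λ i<m → proj₁ (splits₀ i t lead-i) (ℕₚ.<-trans i<m (ℕₚ.≰⇒> m₀≰m))) , (λ t<j′ → proj₂ (splits i t lead-i) (ℕₚ.<-trans t<j′ j′<j)))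
      column₁ : ∀ i → toℕ i ℕ.< m₁ → A i j′ ≡ sumF (λ t → f₀ t * A i t)
      column₁ i i<m₁ = column₀ i (ℕₚ.<-≤-trans i<m₁ (ℕₚ.m⊓n≤m m₀ m))
      ι≮m₁ : ¬ toℕ ι ℕ.< m₁
      ι≮m₁ ι<m₁ = ℕₚ.<⇒≱ ι<m₁ (subst (m₁ ℕ.≤_) (sym ι-pos) m₁≤m)
      module Pivots⁺ = Pivots rref⁺
      nonpiv′ : ¬ Pivotal A′ j′
      nonpiv′ (u , lead-u) with punchIn-view ι u
      ... | inj₁ refl       = ℕₚ.<-irrefl (cong toℕ (trans (Pivots⁺.Lead⇒≡p lead-u) p⁺-ι)) j′<j
      ... | inj₂ (i , refl) = nonpiv₀ (i , subst (Lead A i) (sym (trans (Pivots⁺.Lead⇒≡p lead-u) (p⁺-punchIn i))) (leads i))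
      splits′ : Splits A′ m₁ j′
      splits′ u t lead-u with punchIn-view ι u
      ... | inj₁ refl       = (λ ι<m₁ → contradiction ι<m₁ ι≮m₁) , (λ t<j′ → contradiction (subst (Fin._< j′) (trans (Pivots⁺.Lead⇒≡p lead-u) p⁺-ι) t<j′) (ℕₚ.<-asym j′<j))
      ... | inj₂ (i , refl) =
          (λ u<m₁ → subst (Fin._< j′) (sym t≡pi) (proj₁ (splits₁ i (p i) (leads i)) (ℕₚ.≤-<-trans (toℕ≤toℕ-punchIn ι i) u<m₁)))
        , (λ t<j′ → let i<m₁ = proj₂ (splits₁ i (p i) (leads i)) (subst (Fin._< j′) t≡pi t<j′) in
                    subst (ℕ._< m₁) (sym (toℕ-punchIn-< ι i (subst (toℕ i ℕ.<_) (sym ι-pos) (ℕₚ.<-≤-trans i<m₁ m₁≤m)))) i<m₁)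
        where
        t≡pi : t ≡ p i
        t≡pi = trans (Pivots⁺.Lead⇒≡p lead-u) (p⁺-punchIn i)
      e·b κ : F
      e·b = sumF (λ z → Vec.lookup e z * Vec.lookup b z)
      κ = (1# + - e·b) ⁻¹
      g : Row n
      g t = κ * f t
      pairing-f-r : pairing f r ≡ e·b
      pairing-f-r = begin
        pairing f r                                    ≡⟨ pairing-after f-supp r-after ⟩
        pairing f (linComb (Vec.lookup e) K)           ≡⟨ pairing-linComb f (Vec.lookup e) K ⟩
        sumF (λ x → Vec.lookup e x * pairing f (K x))  ≡⟨ sumF-cong (λ x → cong (Vec.lookup e x *_) (pairing-f-K x)) ⟩
        e·b                                            ∎
      A₀≡A-Aj*r : ∀ i → toℕ i ℕ.< m → ∀ t → A₀ i t ≡ A i t + - A i j * r t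
      A₀≡A-Aj*r i i<m t = trans (A₀-< i t i<m) (cong (A i t +_) (-‿distribˡ-* _ _))
      pairing-g-A₀ : ∀ i → toℕ i ℕ.< m → pairing g (A₀ i) ≡ A i j
      pairing-g-A₀ i i<m = begin
        pairing g (A₀ i)                                ≡⟨ pairing-*ˡ κ f (A₀ i) ⟩
        κ * pairing f (A₀ i)                            ≡⟨ cong (κ *_) (sumF-cong (λ t → cong (f t *_) (A₀≡A-Aj*r i i<m t))) ⟩
        κ * pairing f (λ t → A i t + - A i j * r t)     ≡⟨ cong (κ *_) (pairing-+*ʳ f (A i) r (- A i j)) ⟩
        κ * (pairing f (A i) + - A i j * pairing f r)   ≡⟨ cong₂ (λ u v → κ * (u + - A i j * v)) (sym (column-j i i<m)) pairing-f-r ⟩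
        κ * (A i j + - A i j * e·b)                     ≡⟨ solve 3 (λ κ a e → κ :* (a :+ :- a :* e) := a :* ((:1 :- e) :* κ)) refl κ (A i j) e·b ⟩
        A i j * ((1# + - e·b) * κ)                      ≡⟨ cong (A i j *_) (⁻¹-inverse _ 1-e·b≢0) ⟩
        A i j * 1#                                      ≡⟨ *-identityʳ _ ⟩
        A i j                                           ∎
      ⟨f₀,r⟩ : F
      ⟨f₀,r⟩ = pairing f₀ r
      f′ : Row n
      f′ t = f₀ t + ⟨f₀,r⟩ * g t
      f′-supp : SupportedAfter j′ f′
      f′-supp t t≤j′ = begin
        f₀ t + ⟨f₀,r⟩ * (κ * f t)                       ≡⟨ cong₂ (λ u v → u + ⟨f₀,r⟩ * (κ * v)) (f₀-supp t t≤j′) (f-supp t (ℕₚ.≤-trans t≤j′ (ℕₚ.<⇒≤ j′<j))) ⟩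
        0# + ⟨f₀,r⟩ * (κ * 0#)                          ≡⟨ solve 2 (λ a b → :0 :+ a :* (b :* :0) := :0) refl ⟨f₀,r⟩ κ ⟩
        0#                                              ∎
      column′ : ∀ u → toℕ u ℕ.< m₁ → A′ u j′ ≡ sumF (λ t → f′ t * A′ u t)
      column′ u u<m₁ with punchIn-view ι u
      ... | inj₁ refl       = contradiction u<m₁ ι≮m₁
      ... | inj₂ (i , refl) = begin
        A₀ i j′                                         ≡⟨ A₀-< i j′ i<m ⟩
        A i j′ + - (A i j * r j′)                       ≡⟨ cong (λ z → A i j′ + - (A i j * z)) (r-before j′ j′<j) ⟩
        A i j′ + - (A i j * 0#)                         ≡⟨ solve 2 (λ a b → a :- b :* :0 := a) refl (A i j′) (A i j) ⟩
        A i j′                                          ≡⟨ column₁ i i<m₁ ⟩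
        pairing f₀ (A i)                                ≡⟨ sumF-cong (λ t → cong (f₀ t *_) (A≡A₀+Aj*r t)) ⟩
        pairing f₀ (λ t → A₀ i t + A i j * r t)         ≡⟨ pairing-+*ʳ f₀ (A₀ i) r (A i j) ⟩
        pairing f₀ (A₀ i) + A i j * ⟨f₀,r⟩              ≡⟨ cong (λ z → pairing f₀ (A₀ i) + z * ⟨f₀,r⟩) (sym (pairing-g-A₀ i i<m)) ⟩
        pairing f₀ (A₀ i) + pairing g (A₀ i) * ⟨f₀,r⟩   ≡⟨ cong (pairing f₀ (A₀ i) +_) (trans (*-comm _ _) (sym (pairing-*ˡ ⟨f₀,r⟩ g (A₀ i)))) ⟩
        pairing f₀ (A₀ i) + pairing (λ t → ⟨f₀,r⟩ * g t) (A₀ i)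
                                                        ≡⟨ pairing-+ˡ f₀ (λ t → ⟨f₀,r⟩ * g t) (A₀ i) ⟨
        sumF (λ t → f′ t * A₀ i t)                      ∎
        where
        i<m₁ : toℕ i ℕ.< m₁
        i<m₁ = ℕₚ.≤-<-trans (toℕ≤toℕ-punchIn ι i) u<m₁
        i<m : toℕ i ℕ.< m
        i<m = ℕₚ.<-≤-trans i<m₁ m₁≤m
        A≡A₀+Aj*r : ∀ t → A i t ≡ A₀ i t + A i j * r t
        A≡A₀+Aj*r t = trans (solve 3 (λ a d r → a := (a :- d :* r) :+ d :* r) refl (A i t) (A i j) (r t)) (cong (_+ A i j * r t) (sym (A₀-< i t i<m)))

  insertion-exists : ∀ {k n} {A : Mat k n} {j : Fin n} → IsRREF A → InessNonpivotal A j → ∃ (InsStep A j)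
  insertion-exists {k} {n} {A} {j} rref (nonpiv , m₀ , splits₀ , f , f-supp , column₀) = A′ , record
    { rref = rref ; nonpiv = nonpiv ; m = m ; splits = splits ; iness = f , f-supp , (λ i i<m → column₀ i (ℕₚ.<-≤-trans i<m (ℕₚ.m⊓n≤m m₀ k)))
    ; L = L ; basis = basis
    ; e = e ; e-eq = Γ-solution-solves b c (1+dot-φ≢0 s b)
    ; r = r ; r-before = r-before ; r-at = r-at ; r-after = r-after
    ; ι = ι ; ι-pos = Finₚ.toℕ-fromℕ< (ℕ.s≤s (ℕₚ.m⊓n≤n m₀ k))
    ; new-row = λ t → cong (_$ t) (Vectorₚ.insertAt-lookup old-rows ι r)
    ; old-rows = λ i t → cong (_$ t) (Vectorₚ.insertAt-punchIn old-rows ι r i) }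
    where
    open import Function using (_$_)
    -- past the last row the split index only needs to be k
    m : ℕ
    m = m₀ ℕ.⊓ k
    splits : Splits A m j
    splits i t lead-i with m₀ ℕ.≤? k
    ... | yes m₀≤k = subst (λ z → Splits A z j) (sym (ℕₚ.m≤n⇒m⊓n≡m m₀≤k)) splits₀ i t lead-i
    ... | no  m₀≰k = subst (λ z → (toℕ i ℕ.< z → t Fin.< j) × (t Fin.< j → toℕ i ℕ.< z)) (sym (ℕₚ.m≥n⇒m⊓n≡n (ℕₚ.<⇒≤ (ℕₚ.≰⇒> m₀≰k))))
                       ((λ i<k → proj₁ (splits₀ i t lead-i) (ℕₚ.<-trans i<k (ℕₚ.≰⇒> m₀≰k))) , (λ _ → Finₚ.toℕ<n i))
    L : List (Fin k)
    L = proj₁ (lexFirst-exists A j [] (below k m))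
    basis : LexFirstBasis A m j L
    basis = proj₂ (lexFirst-exists A j [] (below k m))
    s : ℕ
    s = length L
    b : Vec F s
    b = Vec.tabulate (λ l → A (lookup L l) j)
    c e : Vec F s
    c = φ s b
    e = Γ-solution b c
    r-by : ∀ t → Tri (t Fin.< j) (t ≡ j) (j Fin.< t) → F
    r-by t (tri< _ _ _) = 0#
    r-by t (tri≈ _ _ _) = 1#
    r-by t (tri> _ _ _) = sumF (λ x → Vec.lookup e x * A (lookup L x) t)
    r : Row n
    r t = r-by t (Finₚ.<-cmp t j)
    r-before : ∀ t → t Fin.< j → r t ≡ 0#
    r-before t t<j with Finₚ.<-cmp t j
    ... | tri< _ _ _     = refl
    ... | tri≈ _ refl _  = contradiction t<j (ℕₚ.<-irrefl refl)
    ... | tri> _ _ j<t   = contradiction t<j (ℕₚ.<-asym j<t)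
    r-at : r j ≡ 1#
    r-at with Finₚ.<-cmp j j
    ... | tri< j<j _ _ = contradiction j<j (ℕₚ.<-irrefl refl)
    ... | tri≈ _ _ _   = refl
    ... | tri> _ _ j<j = contradiction j<j (ℕₚ.<-irrefl refl)
    r-after : ∀ t → j Fin.< t → r t ≡ sumF (λ x → Vec.lookup e x * A (lookup L x) t)
    r-after t j<t with Finₚ.<-cmp t j
    ... | tri< t<j _ _ = contradiction t<j (ℕₚ.<-asym j<t)
    ... | tri≈ _ refl _ = contradiction j<t (ℕₚ.<-irrefl refl)
    ... | tri> _ _ _   = refl
    ι : Fin (suc k)
    ι = Fin.fromℕ< (ℕ.s≤s (ℕₚ.m⊓n≤n m₀ k))
    old-rows : Mat k n
    old-rows i t = A i t + - ((if ⌊ toℕ i ℕ.<? m ⌋ then A i j else 0#) * r t)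
    A′ : Mat (suc k) n
    A′ = Vector.insertAt old-rows ι r

  -- the row with index b < a has its pivot before j by the first split, but then must lie above b by the second
  Splits-< : ∀ {k n} {A : Mat k n} {j : Fin n} → IsRREF A → ∀ {a b} → b ℕ.< k → b ℕ.< a → Splits A a j → ¬ Splits A b j
  Splits-< {k} rref {a} {b} b<k b<a splits-a splits-b = ℕₚ.<-irrefl refl (subst (ℕ._< b) (Finₚ.toℕ-fromℕ< b<k)
    (proj₂ (splits-b row _ (leads row)) (proj₁ (splits-a row _ (leads row)) (subst (ℕ._< a) (sym (Finₚ.toℕ-fromℕ< b<k)) b<a))))
    where
    open Pivots rref
    row : Fin k
    row = Fin.fromℕ< b<k

  Splits-unique : ∀ {k n} {A : Mat k n} {j : Fin n} → IsRREF A → ∀ {m₁ m₂} → m₁ ℕ.≤ k → m₂ ℕ.≤ k →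
                  Splits A m₁ j → Splits A m₂ j → m₁ ≡ m₂
  Splits-unique rref {m₁} {m₂} m₁≤k m₂≤k splits₁ splits₂ with ℕₚ.<-cmp m₁ m₂
  ... | tri< m₁<m₂ _ _ = contradiction splits₁ (Splits-< rref (ℕₚ.<-≤-trans m₁<m₂ m₂≤k) m₁<m₂ splits₂)
  ... | tri≈ _ m₁≡m₂ _ = m₁≡m₂
  ... | tri> _ _ m₂<m₁ = contradiction splits₂ (Splits-< rref (ℕₚ.<-≤-trans m₂<m₁ m₁≤k) m₂<m₁ splits₁)

  -- m and ι by the pivots, L by determinism of the scan, e by uniqueness of the Γ-solution, r from e
  insertion-unique : ∀ {k n} {A : Mat k n} {j : Fin n} {A₁ A₂ : Mat (suc k) n} → InsStep A j A₁ → InsStep A j A₂ → ∀ u t → A₁ u t ≡ A₂ u t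
  insertion-unique {k} {A = A} {j} {A₁} {A₂}
    record { rref = rref ; m = m ; splits = splits₁ ; L = L ; basis = basis₁ ; e = e₁ ; e-eq = e-eq₁ ; r = r₁ ; r-before = r-before₁ ; r-at = r-at₁
           ; r-after = r-after₁ ; ι = ι ; ι-pos = ι-pos₁ ; new-row = new-row₁ ; old-rows = old-rows₁ }
    record { m = m₂ ; splits = splits₂ ; basis = basis₂ ; e = e₂ ; e-eq = e-eq₂ ; r = r₂ ; r-before = r-before₂ ; r-at = r-at₂
           ; r-after = r-after₂ ; ι = ι₂ ; ι-pos = ι-pos₂ ; new-row = new-row₂ ; old-rows = old-rows₂ }
    with Splits-unique rref (subst (ℕ._≤ k) ι-pos₁ (ℕₚ.≤-pred (Finₚ.toℕ<n ι))) (subst (ℕ._≤ k) ι-pos₂ (ℕₚ.≤-pred (Finₚ.toℕ<n ι₂))) splits₁ splits₂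
  ... | refl with Finₚ.toℕ-injective (trans ι-pos₁ (sym ι-pos₂))
  ... | refl with lexFirst-unique basis₁ basis₂
  ... | refl = A₁≡A₂
    where
    b c : Vec F (length L)
    b = Vec.tabulate (λ l → A (lookup L l) j)
    c = φ (length L) b
    e₁≡e₂ : e₁ ≡ e₂
    e₁≡e₂ = trans (Γ-solution-unique b c e₁ (1+dot-φ≢0 _ b) e-eq₁) (sym (Γ-solution-unique b c e₂ (1+dot-φ≢0 _ b) e-eq₂))
    r₁≡r₂ : ∀ t → r₁ t ≡ r₂ t
    r₁≡r₂ t with Finₚ.<-cmp t j
    ... | tri< t<j _ _ = trans (r-before₁ t t<j) (sym (r-before₂ t t<j))
    ... | tri≈ _ refl _ = trans r-at₁ (sym r-at₂)
    ... | tri> _ _ j<t = trans (r-after₁ t j<t) (trans (cong (λ e → sumF (λ x → Vec.lookup e x * _)) e₁≡e₂) (sym (r-after₂ t j<t)))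
    A₁≡A₂ : ∀ u t → A₁ u t ≡ A₂ u t
    A₁≡A₂ u t with punchIn-view ι u
    ... | inj₁ refl       = trans (new-row₁ t) (trans (r₁≡r₂ t) (sym (new-row₂ t)))
    ... | inj₂ (i , refl) = trans (old-rows₁ i t) (trans (cong (λ z → A i t + - ((if ⌊ toℕ i ℕ.<? m ⌋ then A i j else 0#) * z)) (r₁≡r₂ t)) (sym (old-rows₂ i t)))

  -- Chains of deletions and insertions

  _≗ₘ_ : ∀ {k n} → Mat k n → Mat k n → Set
  A ≗ₘ B = ∀ i t → A i t ≡ B i t

  ≗ₘ⇒MatEq : ∀ {k n} {A B : Mat k n} → A ≗ₘ B → MatEq A B
  ≗ₘ⇒MatEq {B = B} A≗B = refl , (λ i t → trans (A≗B i t) (cong (λ z → B z t) (sym (Finₚ.cast-is-id refl i))))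

  MatEq-refl⇒≗ₘ : ∀ {k n} {A B : Mat k n} → MatEq A B → A ≗ₘ B
  MatEq-refl⇒≗ₘ {B = B} (refl , A≡B) i t = trans (A≡B i t) (cong (λ z → B z t) (Finₚ.cast-is-id refl i))

  MatEq-trans : ∀ {k₁ k₂ k₃ n} {A : Mat k₁ n} {B : Mat k₂ n} {C : Mat k₃ n} → MatEq A B → MatEq B C → MatEq A C
  MatEq-trans {A = A} {B} {C} (refl , A≡B) (refl , B≡C) =
    ≗ₘ⇒MatEq (λ i t → trans (MatEq-refl⇒≗ₘ {A = A} {B} (refl , A≡B) i t) (MatEq-refl⇒≗ₘ {A = B} {C} (refl , B≡C) i t))

  Lead-resp : ∀ {k n} {A B : Mat k n} → A ≗ₘ B → ∀ {i t} → Lead A i t → Lead B i t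
  Lead-resp A≗B {i} {t} (Ait≡1 , before) = trans (sym (A≗B i t)) Ait≡1 , (λ t′ t′<t → trans (sym (A≗B i t′)) (before t′ t′<t))

  IsRREF-resp : ∀ {k n} {A B : Mat k n} → A ≗ₘ B → IsRREF A → IsRREF B
  IsRREF-resp A≗B (p , leads , mono , pivot-column) = p , Lead-resp A≗B ∘ leads , mono , (λ i i′ i≢i′ → trans (sym (A≗B i′ (p i))) (pivot-column i i′ i≢i′))

  linComb-rows-resp : ∀ {k n} {A B : Mat k n} → A ≗ₘ B → ∀ {s} (xs : Fin s → Fin k) (c : Fin s → F) t →
                      sumF (λ l → c l * A (xs l) t) ≡ sumF (λ l → c l * B (xs l) t)
  linComb-rows-resp A≗B xs c t = sumF-cong (λ l → cong (c l *_) (A≗B (xs l) t))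

  DelStep-resp : ∀ {k n} {A B : Mat (suc k) n} {j : Fin n} {A′ : Mat k n} → A ≗ₘ B → DelStep A j A′ → DelStep B j A′
  DelStep-resp {A = A} {B} {j} A≗B D = record
    { rref = IsRREF-resp A≗B rref ; m = m ; lead = Lead-resp A≗B lead
    ; iness = proj₁ iness , proj₁ (proj₂ iness) , (λ t j<t → trans (sym (A≗B m t)) (trans (proj₂ (proj₂ iness) t j<t) (linComb-rows-resp A≗B Function.id (proj₁ iness) t)))
    ; L = L ; basis = lexFirst-cong A≗B basis
    ; c = c ; c-eq = λ t j<t → trans (sym (A≗B m t)) (trans (c-eq t j<t) (linComb-rows-resp A≗B (lookup L) (Vec.lookup c) t))
    ; b = b ; b-eq = b-eq ; d = d ; d-basis = d-basis
    ; d-other = λ u u<m u∉L → let (α , Au≈ , d≡) = d-other u u<m u∉L in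
        α , (λ t j<t → trans (sym (A≗B u t)) (trans (Au≈ t j<t) (linComb-rows-resp A≗B (lookup L) α t))) , d≡
    ; d-zero = d-zero
    ; result = λ i t → trans (result i t) (cong₂ (λ x y → x + d (punchIn m i) * y) (A≗B (punchIn m i) t) (A≗B m t)) }
    where open DelStep D

  InsStep-resp : ∀ {k n} {A B : Mat k n} {j : Fin n} {A′ : Mat (suc k) n} → A ≗ₘ B → InsStep A j A′ → InsStep B j A′
  InsStep-resp {A = A} {B} {j} A≗B I = record
    { rref = IsRREF-resp A≗B rref
    ; nonpiv = λ (i , lead) → nonpiv (i , Lead-resp (λ i t → sym (A≗B i t)) lead)
    ; m = m ; splits = λ i t lead → splits i t (Lead-resp (λ i t → sym (A≗B i t)) lead)
    ; iness = proj₁ iness , proj₁ (proj₂ iness) , (λ i i<m → trans (sym (A≗B i j)) (trans (proj₂ (proj₂ iness) i i<m) (sumF-cong (λ t → cong (proj₁ iness t *_) (A≗B i t)))))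
    ; L = L ; basis = lexFirst-cong A≗B basis
    ; e = e′ ; e-eq = subst (λ b → ∀ y → sumF (λ x → Vec.lookup e′ x * Γ b (φ s b) x y) ≡ Vec.lookup (φ s b) y) b-resp e-eq
    ; r = r ; r-before = r-before ; r-at = r-at
    ; r-after = λ t j<t → trans (r-after t j<t) (linComb-rows-resp A≗B (lookup L) (Vec.lookup e′) t)
    ; ι = ι ; ι-pos = ι-pos ; new-row = new-row
    ; old-rows = λ i t → trans (old-rows i t) (cong₂ (λ x y → x + - ((if ⌊ toℕ i ℕ.<? m ⌋ then y else 0#) * r t)) (A≗B i t) (A≗B i j)) }
    where
    open InsStep I renaming (e to e′)
    b-resp : Vec.tabulate (λ l → A (lookup L l) j) ≡ Vec.tabulate (λ l → B (lookup L l) j)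
    b-resp = Vecₚ.tabulate-cong (λ l → A≗B (lookup L l) j)

  InsSeq-∷ʳ : ∀ {n k k₁} {A : Mat k n} {B : Mat k₁ n} {C : Mat (suc k₁) n} {xs j} → InsSeq A xs B → InsStep B j C → InsSeq A (xs ∷ʳ j) C
  InsSeq-∷ʳ []           I = I ∷ []
  InsSeq-∷ʳ (I′ ∷ steps) I = I′ ∷ InsSeq-∷ʳ steps I

  DelSeq-∷ʳ : ∀ {n k k₁} {A : Mat k n} {B : Mat (suc k₁) n} {C : Mat k₁ n} {xs j} → DelSeq A xs B → DelStep B j C → DelSeq A (xs ∷ʳ j) C
  DelSeq-∷ʳ []           D = D ∷ []
  DelSeq-∷ʳ (D′ ∷ steps) D = D′ ∷ DelSeq-∷ʳ steps D

  InsSeq-++⁻ : ∀ {n k k₂} {A : Mat k n} {C : Mat k₂ n} xs ys → InsSeq A (xs ++ ys) C →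
               ∃ λ k₁ → Σ (Mat k₁ n) λ B → InsSeq A xs B × InsSeq B ys C
  InsSeq-++⁻ {k = k} {A = A} [] ys steps = k , A , [] , steps
  InsSeq-++⁻ (x ∷ xs) ys (I ∷ steps) with InsSeq-++⁻ xs ys steps
  ... | k₁ , B , steps₁ , steps₂ = k₁ , B , I ∷ steps₁ , steps₂

  DelSeq⇒InsSeq : ∀ {n k k₁} {A : Mat k n} {B : Mat k₁ n} {J} → DelSeq A J B → InsSeq B (reverse J) A
  DelSeq⇒InsSeq [] = []
  DelSeq⇒InsSeq {J = j ∷ js} (D ∷ steps) =
    subst (λ X → InsSeq _ X _) (sym (Listₚ.unfold-reverse j js)) (InsSeq-∷ʳ (DelSeq⇒InsSeq steps) (DeletionStep.inverse D))

  InsSeq⇒DelSeq : ∀ {n k k₁} {A : Mat k n} {B : Mat k₁ n} {xs} → InsSeq A xs B → DelSeq B (reverse xs) A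
  InsSeq⇒DelSeq [] = []
  InsSeq⇒DelSeq {xs = j ∷ js} (I ∷ steps) =
    subst (λ X → DelSeq _ X _) (sym (Listₚ.unfold-reverse j js)) (DelSeq-∷ʳ (InsSeq⇒DelSeq steps) (InsertionStep.inverse I))

  DelSeq-resp : ∀ {n k k₂} {A B : Mat k n} {C : Mat k₂ n} {xs} → A ≗ₘ B → DelSeq A xs C →
                ∃ λ k′ → Σ (Mat k′ n) λ C′ → DelSeq B xs C′ × MatEq C C′
  DelSeq-resp {B = B} A≗B []                    = _ , B , [] , ≗ₘ⇒MatEq A≗B
  DelSeq-resp {C = C} A≗B (D ∷ steps)           = _ , C , DelStep-resp A≗B D ∷ steps , ≗ₘ⇒MatEq (λ _ _ → refl)

  -- the last insertion undoes the first deletion, by uniqueness of insertions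
  del-ins-unique : ∀ {n k k₁ k₂} (M : Mat k n) J {M₁ : Mat k₁ n} {M₂ : Mat k₂ n} → DelSeq M J M₁ → InsSeq M₁ (reverse J) M₂ → MatEq M₂ M
  del-ins-unique M []       []                 []  = ≗ₘ⇒MatEq (λ _ _ → refl)
  del-ins-unique M (j ∷ js) {M₁} {M₂} (_∷_ {M₁ = A₁} D steps) ins
    with InsSeq-++⁻ (reverse js) (j ∷ []) (subst (λ X → InsSeq M₁ X M₂) (Listₚ.unfold-reverse j js) ins)
  ... | _ , B , ins-js , (I ∷ []) with del-ins-unique A₁ js steps ins-js
  ... | refl , B≡A₁ = ≗ₘ⇒MatEq (insertion-unique (InsStep-resp (MatEq-refl⇒≗ₘ (refl , B≡A₁)) I) (DeletionStep.inverse D))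

  -- the first deletion undoes the last insertion, by uniqueness of deletions
  ins-del-unique : ∀ {n k k₁ k₂} (M : Mat k n) I {M₁ : Mat k₁ n} {M₂ : Mat k₂ n} → InsSeq M (reverse I) M₁ → DelSeq M₁ I M₂ → MatEq M₂ M
  ins-del-unique M []       []  []                 = ≗ₘ⇒MatEq (λ _ _ → refl)
  ins-del-unique {n} M (j ∷ js) {M₁} {M₂} ins (D ∷ steps)
    with InsSeq-++⁻ (reverse js) (j ∷ []) (subst (λ X → InsSeq M X M₁) (Listₚ.unfold-reverse j js) ins)
  ... | _ , B , ins-js , (I ∷ []) = transfer (DelSeq-resp (deletion-unique D (InsertionStep.inverse I)) steps)
    where
    transfer : (∃ λ k′ → Σ (Mat k′ n) λ M₂′ → DelSeq B js M₂′ × MatEq M₂ M₂′) → MatEq M₂ M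
    transfer (_ , M₂′ , steps′ , M₂≈M₂′) = MatEq-trans {A = M₂} {M₂′} {M} M₂≈M₂′ (ins-del-unique M js ins-js steps′)

  later-InessPivotal : ∀ {k n} {A : Mat (suc k) n} {j : Fin n} {A′ : Mat k n} → DelStep A j A′ →
                       ∀ {js} → All (j <_) js → All (InessPivotal A) js → All (InessPivotal A′) js
  later-InessPivotal D []            []                 = []
  later-InessPivotal D (j<j′ ∷ j<js) (ess ∷ inessentials) = DeletionStep.preserves-InessPivotal D j<j′ ess ∷ later-InessPivotal D j<js inessentials

  deletions-exist : ∀ {n k} (M : Mat k n) → IsRREF M → ∀ J → AllPairs _<_ J → All (InessPivotal M) J →
                    ∃ λ k₁ → Σ (Mat k₁ n) (DelSeq M J)
  deletions-exist {k = k}     M rref []       _                []                            = k , M , []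
  deletions-exist {k = zero}  M rref (j ∷ js) _                ((() , _) ∷ _)
  deletions-exist {k = suc k} M rref (j ∷ js) (j<js ∷ sorted) (inessential ∷ inessentials) =
    let A₁ , D = deletion-exists rref inessential
        k₁ , M₁ , steps = deletions-exist A₁ (DeletionStep.rref′ D) js sorted (later-InessPivotal D j<js inessentials)
    in  k₁ , M₁ , D ∷ steps

  insertions-exist : ∀ {n k} (M : Mat k n) → IsRREF M → ∀ I → AllPairs _<_ I → All (InessNonpivotal M) I →
                     ∃ λ k₁ → Σ (Mat k₁ n) λ M₁ → InsSeq M (reverse I) M₁ × IsRREF M₁ ×
                              (∀ {j′} → All (j′ <_) I → InessNonpivotal M j′ → InessNonpivotal M₁ j′)
  insertions-exist {k = k} M rref [] _ [] = k , M , [] , rref , (λ _ ess → ess)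
  insertions-exist M rref (j ∷ js) (j<js ∷ sorted) (inessential ∷ inessentials) =
    let _ , C , steps , rref-C , preserved = insertions-exist M rref js sorted inessentials
        M₁ , I = insertion-exists rref-C (preserved j<js inessential)
    in  _ , M₁ , subst (λ X → InsSeq M X M₁) (sym (Listₚ.unfold-reverse j js)) (InsSeq-∷ʳ steps I) , InsertionStep.rref⁺ I ,
        (λ { (j′<j ∷ j′<js) ess → InsertionStep.preserves-InessNonpivotal I j′<j (preserved j′<js ess) })

  del-ins-roundTrip : ∀ {k n} (M : Mat k n) → IsRREF M → ∀ J → Linked _<_ J → All (InessPivotal M) J → RoundTrip Del Ins M J
  del-ins-roundTrip {k} M rref J sorted inessentials =
    let k₁ , M₁ , dels = deletions-exist M rref J (Linked⇒AllPairs Finₚ.<-trans sorted) inessentials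
    in  (k₁ , M₁ , k , M , dels , DelSeq⇒InsSeq dels) , (λ _ _ dels ins → del-ins-unique M J dels ins)

  ins-del-roundTrip : ∀ {k n} (M : Mat k n) → IsRREF M → ∀ I → Linked _<_ I → All (InessNonpivotal M) I → RoundTrip Ins Del M I
  ins-del-roundTrip {k} M rref I sorted inessentials =
    let k₁ , M₁ , ins , _ = insertions-exist M rref I (Linked⇒AllPairs Finₚ.<-trans sorted) inessentials
    in  (k₁ , M₁ , k , M , ins , subst (λ X → DelSeq M₁ X M) (Listₚ.reverse-involutive I) (InsSeq⇒DelSeq ins))
      , (λ _ _ ins dels → ins-del-unique M I ins dels)

  InSet∖InSubset⇒InessNonpivotal : ∀ {k n} {M : Mat k n} {j : Fin n} → InSet M j × ¬ InSubset M j → InessNonpivotal M j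
  InSet∖InSubset⇒InessNonpivotal (inj₁ pivotal    , ¬pivotal) = contradiction pivotal ¬pivotal
  InSet∖InSubset⇒InessNonpivotal (inj₂ nonpivotal , _)        = nonpivotal

mainTheorem9 : (𝔽 : FiniteField) → let open LinAlg 𝔽 in
  ∀ {k n : ℕ} (X : Row n → Set) → IsSubspace X →
  (M : Mat k n) → IsRREF M → RowSpaceIs M X →
    (∀ (J : List (Fin n)) → Linked _<_ J → All (InSubset M) J →
       RoundTrip Del Ins M J)
  × (∀ (I : List (Fin n)) → Linked _<_ I → All (λ j → InSet M j × ¬ InSubset M j) I →
       RoundTrip Ins Del M I)
-- Once M = RE(X) is given, the round trips are statements about M alone, so X is not consulted.
mainTheorem9 𝔽 _ _ M rref _ =
    del-ins-roundTrip 𝔽 M rref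
  , λ I sorted columns → ins-del-roundTrip 𝔽 M rref I sorted (All.map (InSet∖InSubset⇒InessNonpivotal 𝔽) columns)
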